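{- Let $n\ge 1$ and let $\tau$ act on $X_n$ by $\tau(x)=\{\{n-i: i\in B\}: B\in x\}$, i.e. induced by the involution $i\mapsto n-i$ of $[n-1]$. Then the triple $(X_n,\langle\tau\rangle,\mathrm{Cat}_n(q))$ exhibits the cyclic sieving phenomenon, where $\langle\tau\rangle$ is the cyclic group of order $2$ generated by $\tau$; that is, $\mathrm{Cat}_n(1)=|X_n|$ and the number of $x\in X_n$ with $\tau(x)=x$ equals $\mathrm{Cat}_n(-1)$.
   Context: For $m\ge 1$ let $[m]=\{1,\dots,m\}$. A ball is a subset of $[m]$ of cardinality $1$ and an arc is a subset of cardinality $2$. A $(1,2)$-configuration of $[m]$ is a set of pairwise disjoint balls and arcs in $[m]$ (the empty set is allowed). It is noncrossing if it contains no two arcs $\{i_1,j_1\},\{i_2,j_2\}$ with $i_1<i_2<j_1<j_2$. $X_n$ denotes the set of all noncrossing $(1,2)$-configurations of $[n-1]$. $\mathrm{Cat}_n(q)=\frac{1}{[n+1]_q}\begin{bmatrix}2n\\ n\end{bmatrix}_q$ with $[m]_q=1+q+\dots+q^{m-1}$, $[m]!_q=[m]_q\cdots[1]_q$, $\begin{bmatrix}m\\ k\end{bmatrix}_q=\frac{[m]!_q}{[k]!_q[m-k]!_q}$. A triple $(X,C,X(q))$, with $C$ a cyclic group of order $N$ generated by $c$ acting on a finite set $X$ and $X(q)\in\mathbb{Z}_{\ge0}[q]$, exhibits the cyclic sieving phenomenon if $X(1)=|X|$ and for every positive integer $d$, $|\{x\in X: c^d(x)=x\}|=X(e^{2\pi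 i d/N})$. -}

module Defs where

open import Data.Nat using (ℕ; zero; suc; _+_; _*_; _∸_)
open import Data.Integer as ℤ using (ℤ; +_)
open import Data.Fin as Fin using (Fin; opposite; _<_; _<?_)
open import Data.Fin.Properties using (all?) renaming (_≟_ to _≟F_)
open import Data.Maybe using (Maybe; nothing; just)
import Data.Maybe as Maybe
import Data.Maybe.Properties as MaybeP
open import Data.Vec using (Vec; []; _∷_; lookup; tabulate)
import Data.Vec.Properties as VecP
open import Data.List using (List; []; _∷_; map; concatMap; length; filter; replicate; foldr; allFin)
open import Data.Nat.ListAction using (sum)
open import Data.Product using (_×_)
open import Data.Empty using (⊥)
open import Relation.Nullary using (Dec; ¬_; no)
open import Relation.Nullary.Decidable using (_×-dec_; _→-dec_; ¬?)
open import Relation.Binary.PropositionalEquality using (_≡_)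

-- (1,2)-configurations of [m], encoded as Vec (Maybe (Fin m)) m.
-- Point i ∈ [m] is represented by the index i : Fin m (value i+1).
--   v[i] = nothing          : i is not covered by any block
--   v[i] = just i           : {i} is a ball
--   v[i] = just j  (j ≠ i)  : {i,j} is an arc (then v[j] = just i)
-- This is a bijection with sets of pairwise disjoint balls and arcs.

Config : ℕ → Set
Config m = Vec (Maybe (Fin m)) m

IsConfig : ∀ {m} → Config m → Set
IsConfig {m} v = ∀ (i j : Fin m) → lookup v i ≡ just j → lookup v j ≡ just i

NonCrossing : ∀ {m} → Config m → Set
NonCrossing {m} v = ∀ (i₁ i₂ j₁ j₂ : Fin m) → i₁ < i₂ → i₂ < j₁ → j₁ < j₂ →
  lookup v i₁ ≡ just j₁ → lookup v i₂ ≡ just j₂ → ⊥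

IsNCConfig : ∀ {m} → Config m → Set
IsNCConfig v = IsConfig v × NonCrossing v

isConfig? : ∀ {m} (v : Config m) → Dec (IsConfig v)
isConfig? v = all? λ i → all? λ j →
  MaybeP.≡-dec _≟F_ (lookup v i) (just j) →-dec MaybeP.≡-dec _≟F_ (lookup v j) (just i)

nonCrossing? : ∀ {m} (v : Config m) → Dec (NonCrossing v)
nonCrossing? v = all? λ i₁ → all? λ i₂ → all? λ j₁ → all? λ j₂ →
  (i₁ <? i₂) →-dec ((i₂ <? j₁) →-dec ((j₁ <? j₂) →-dec
    (MaybeP.≡-dec _≟F_ (lookup v i₁) (just j₁) →-dec
      (MaybeP.≡-dec _≟F_ (lookup v i₂) (just j₂) →-dec no⊥))))
  where no⊥ : Dec ⊥
        no⊥ = no λ ()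

isNCConfig? : ∀ {m} (v : Config m) → Dec (IsNCConfig v)
isNCConfig? v = isConfig? v ×-dec nonCrossing? v

vecs : ∀ {A : Set} → List A → (k : ℕ) → List (Vec A k)
vecs xs zero    = [] ∷ []
vecs xs (suc k) = concatMap (λ x → map (x ∷_) (vecs xs k)) xs

allConfigs : (m : ℕ) → List (Config m)
allConfigs m = vecs (nothing ∷ map just (allFin m)) m

Xn : (n : ℕ) → List (Config (n ∸ 1))
Xn n = filter isNCConfig? (allConfigs (n ∸ 1))

-- τ induced by i ↦ n - i on [n-1] (index i ↦ opposite i)
τ : ∀ {m} → Config m → Config m
τ v = tabulate λ i → Maybe.map opposite (lookup v (opposite i))

fixed? : ∀ {m} (v : Config m) → Dec (τ v ≡ v)
fixed? v = VecP.≡-dec (MaybeP.≡-dec _≟F_) (τ v) v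

cardXn : ℕ → ℕ
cardXn n = length (Xn n)

fixedXn : ℕ → ℕ
fixedXn n = length (filter fixed? (Xn n))

-- Polynomials in q with ℕ coefficients, as coefficient lists (constant first)

Poly : Set
Poly = List ℕ

_⊕_ : Poly → Poly → Poly
[]       ⊕ q        = q
(a ∷ p)  ⊕ []       = a ∷ p
(a ∷ p)  ⊕ (b ∷ q)  = (a + b) ∷ (p ⊕ q)

_⊗_ : Poly → Poly → Poly
[]      ⊗ q = []
(a ∷ p) ⊗ q = map (a *_) q ⊕ (0 ∷ (p ⊗ q))

coeff : Poly → ℕ → ℕ
coeff []      k       = 0
coeff (a ∷ p) zero    = a
coeff (a ∷ p) (suc k) = coeff p k

-- equality of polynomials (coefficientwise; ignores trailing zeros)
_≈ₚ_ : Poly → Poly → Set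
p ≈ₚ q = ∀ k → coeff p k ≡ coeff q k

qInt : ℕ → Poly
qInt m = replicate m 1

qFact : ℕ → Poly
qFact zero    = 1 ∷ []
qFact (suc m) = qInt (suc m) ⊗ qFact m

eval1 : Poly → ℕ
eval1 = sum

evalNeg1 : Poly → ℤ
evalNeg1 = foldr (λ a acc → + a ℤ.- acc) (+ 0)

-- P is Cat_n(q) = [2n]!_q / ([n+1]_q [n]!_q [n]!_q), i.e.
-- P · [n+1]_q · [n]!_q · [n]!_q = [2n]!_q  (division in ℤ[q] is unique)
IsCatPoly : ℕ → Poly → Set
IsCatPoly n P = (((P ⊗ qInt (suc n)) ⊗ qFact n) ⊗ qFact n) ≈ₚ qFact (n + n)

-- Cat_n(q) is realised by a polynomial with coefficients in ℕ: for n = k + 1 it is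
-- [2k+1 choose k]_q − q [2k+1 choose k−1]_q, a difference whose nonnegativity is exhibited by a
-- q-analogue of the ballot recursion, and multiplying it by [n+1]_q [n]!_q² gives [2n]!_q. At
-- q = 1 it is a ballot number; at q = −1 the Gaussian binomials collapse to ordinary binomials of
-- half size, and the value is the central binomial coefficient C(n, ⌊n/2⌋).
--
-- A configuration of [n−1] is encoded by a word in blank, ball, opener and closer (the smaller
-- and larger end of an arc). The words of noncrossing configurations are exactly the Dyck words:
-- the arcs are recovered by repeatedly matching the first closer with the last opener before it,
-- and a noncrossing configuration is determined by its word since every arc encloses a balanced
-- segment. Dyck words are counted by the same ballot numbers. Under the encoding τ reverses the
-- word and exchanges openers with closers, so a τ-fixed configuration is a self-dual Dyck word,
-- determined by its left half: any prefix of a Dyck word, followed by a blank or a ball in the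
-- middle when n − 1 is odd. A recursion on the height of the path counts these halves as
-- C(n, ⌊n/2⌋).

module Submission where

module Parity where

  open import Data.Nat using (ℕ; zero; suc; _+_; _∸_; _≤_; _<_; z≤n; s≤s; ⌊_/2⌋)
  open import Data.Nat.Combinatorics using (_C_; nCk≡nC[n∸k]; nCk+nC[k+1]≡[n+1]C[k+1])
  open import Data.Nat.Properties using (+-suc; m+n∸m≡n; m≤m+n; suc-injective; ≰⇒>; <⇒≱; ≤-trans; n≤1+n)
  open import Relation.Binary.PropositionalEquality

  double : ℕ → ℕ
  double zero    = zero
  double (suc n) = suc (suc (double n))

  double≡+ : ∀ n → double n ≡ n + n
  double≡+ zero    = refl
  double≡+ (suc n) = cong suc (trans (cong suc (double≡+ n)) (sym (+-suc n n)))

  double-injective : ∀ {m n} → double m ≡ double n → m ≡ n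
  double-injective {zero}  {zero}  _ = refl
  double-injective {suc m} {suc n} e = cong suc (double-injective (suc-injective (suc-injective e)))

  double≢suc-double : ∀ m n → double m ≢ suc (double n)
  double≢suc-double (suc m) (suc n) e = double≢suc-double m n (suc-injective (suc-injective e))

  double-mono-≤ : ∀ {m n} → m ≤ n → double m ≤ double n
  double-mono-≤ z≤n       = z≤n
  double-mono-≤ (s≤s m≤n) = s≤s (s≤s (double-mono-≤ m≤n))

  double-mono-< : ∀ {m n} → m < n → double m < double n
  double-mono-< (s≤s m≤n) = s≤s (≤-trans (double-mono-≤ m≤n) (n≤1+n _))

  double-cancel-≤ : ∀ {m n} → double m ≤ double n → m ≤ n
  double-cancel-≤ {zero}  _                 = z≤n
  double-cancel-≤ {suc m} {suc n} (s≤s (s≤s le)) = s≤s (double-cancel-≤ le)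

  double-cancel-< : ∀ {m n} → double m < double n → m < n
  double-cancel-< {m} {n} lt = ≰⇒> λ n≤m → <⇒≱ lt (double-mono-≤ n≤m)

  n≤double : ∀ n → n ≤ double n
  n≤double n = subst (n ≤_) (sym (double≡+ n)) (m≤m+n n n)

  double∸≡ : ∀ n → double n ∸ n ≡ n
  double∸≡ n = trans (cong (_∸ n) (double≡+ n)) (m+n∸m≡n n n)

  data EvenOdd : ℕ → Set where
    even : ∀ i → EvenOdd (double i)
    odd  : ∀ i → EvenOdd (suc (double i))

  evenOdd : ∀ n → EvenOdd n
  evenOdd zero = even zero
  evenOdd (suc n) with evenOdd n
  ... | even i = odd i
  ... | odd i  = even (suc i)

  ⌊double/2⌋ : ∀ i → ⌊ double i /2⌋ ≡ i
  ⌊double/2⌋ zero    = refl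
  ⌊double/2⌋ (suc i) = cong suc (⌊double/2⌋ i)

  ⌊1+double/2⌋ : ∀ i → ⌊ suc (double i) /2⌋ ≡ i
  ⌊1+double/2⌋ zero    = refl
  ⌊1+double/2⌋ (suc i) = cong suc (⌊1+double/2⌋ i)

  central : ℕ → ℕ
  central n = n C ⌊ n /2⌋

  C-middle-sym : ∀ i → suc (double i) C suc i ≡ suc (double i) C i
  C-middle-sym i = trans (nCk≡nC[n∸k] (s≤s (n≤double i))) (cong (suc (double i) C_) (double∸≡ i))

  central-odd : ∀ i → central (suc (double i)) ≡ suc (double i) C i
  central-odd i = cong (suc (double i) C_) (⌊1+double/2⌋ i)

  central-even : ∀ i → central (double (suc i)) ≡ suc (double i) C i + suc (double i) C i
  central-even i = begin
    double (suc i) C ⌊ double (suc i) /2⌋                  ≡⟨ cong (double (suc i) C_) (⌊double/2⌋ (suc i)) ⟩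
    double (suc i) C suc i                                 ≡⟨ nCk+nC[k+1]≡[n+1]C[k+1] (suc (double i)) i ⟨
    suc (double i) C i + suc (double i) C suc i            ≡⟨ cong (suc (double i) C i +_) (C-middle-sym i) ⟩
    suc (double i) C i + suc (double i) C i                ∎
    where open ≡-Reasoning

module Polynomial where

  open import Defs
  open import Algebra.Bundles using (CommutativeSemiring)
  open import Data.List using ([]; _∷_; map)
  open import Data.Nat using (ℕ; zero; suc; _+_; _*_)
  open import Data.Nat.Properties
  open import Algebra.Properties.CommutativeSemigroup +-commutativeSemigroup using (interchange)
  open import Data.Product using (_,_)
  open import Relation.Binary.Bundles using (Setoid)
  open import Relation.Binary.PropositionalEquality
  import Relation.Binary.Reasoning.Setoid as SetoidReasoning

  infix 4 _≋_

  -- The coefficientwise equality _≈ₚ_ of Defs, as a record so that p and q can be inferred from a proof.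
  record _≋_ (p q : Poly) : Set where
    constructor mk≋
    field coeff-≡ : ∀ k → coeff p k ≡ coeff q k

  open _≋_ public

  ≋-refl : ∀ {p} → p ≋ p
  ≋-refl = mk≋ λ _ → refl

  ≋-sym : ∀ {p q} → p ≋ q → q ≋ p
  ≋-sym p≋q = mk≋ λ k → sym (coeff-≡ p≋q k)

  ≋-trans : ∀ {p q r} → p ≋ q → q ≋ r → p ≋ r
  ≋-trans p≋q q≋r = mk≋ λ k → trans (coeff-≡ p≋q k) (coeff-≡ q≋r k)

  ≋-setoid : Setoid _ _
  ≋-setoid = record
    { Carrier = Poly ; _≈_ = _≋_
    ; isEquivalence = record { refl = ≋-refl ; sym = ≋-sym ; trans = ≋-trans } }

  module ≋-Reasoning = SetoidReasoning ≋-setoid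

  ∷-cong : ∀ {a b p q} → a ≡ b → p ≋ q → a ∷ p ≋ b ∷ q
  ∷-cong a≡b p≋q = mk≋ λ { zero → a≡b ; (suc k) → coeff-≡ p≋q k }

  ∷-tail : ∀ {a b p q} → a ∷ p ≋ b ∷ q → p ≋ q
  ∷-tail e = mk≋ λ k → coeff-≡ e (suc k)

  scale : ℕ → Poly → Poly
  scale a = map (a *_)

  coeff-⊕ : ∀ p q k → coeff (p ⊕ q) k ≡ coeff p k + coeff q k
  coeff-⊕ []      q       k       = refl
  coeff-⊕ (a ∷ p) []      k       = sym (+-identityʳ _)
  coeff-⊕ (a ∷ p) (b ∷ q) zero    = refl
  coeff-⊕ (a ∷ p) (b ∷ q) (suc k) = coeff-⊕ p q k

  coeff-scale : ∀ a p k → coeff (scale a p) k ≡ a * coeff p k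
  coeff-scale a []      k       = sym (*-zeroʳ a)
  coeff-scale a (b ∷ p) zero    = refl
  coeff-scale a (b ∷ p) (suc k) = coeff-scale a p k

  ⊕-cong : ∀ {p p′ q q′} → p ≋ p′ → q ≋ q′ → p ⊕ q ≋ p′ ⊕ q′
  ⊕-cong {p} {p′} {q} {q′} p≋p′ q≋q′ = mk≋ λ k → begin
    coeff (p ⊕ q) k           ≡⟨ coeff-⊕ p q k ⟩
    coeff p k + coeff q k     ≡⟨ cong₂ _+_ (coeff-≡ p≋p′ k) (coeff-≡ q≋q′ k) ⟩
    coeff p′ k + coeff q′ k   ≡⟨ coeff-⊕ p′ q′ k ⟨
    coeff (p′ ⊕ q′) k         ∎
    where open ≡-Reasoning

  ⊕-congˡ : ∀ p {q q′} → q ≋ q′ → p ⊕ q ≋ p ⊕ q′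
  ⊕-congˡ p = ⊕-cong (≋-refl {p})

  ⊕-congʳ : ∀ {p p′} q → p ≋ p′ → p ⊕ q ≋ p′ ⊕ q
  ⊕-congʳ q p≋p′ = ⊕-cong p≋p′ (≋-refl {q})

  ⊕-comm : ∀ p q → p ⊕ q ≋ q ⊕ p
  ⊕-comm p q = mk≋ λ k → begin
    coeff (p ⊕ q) k         ≡⟨ coeff-⊕ p q k ⟩
    coeff p k + coeff q k   ≡⟨ +-comm (coeff p k) _ ⟩
    coeff q k + coeff p k   ≡⟨ coeff-⊕ q p k ⟨
    coeff (q ⊕ p) k         ∎
    where open ≡-Reasoning

  ⊕-assoc : ∀ p q r → (p ⊕ q) ⊕ r ≋ p ⊕ (q ⊕ r)
  ⊕-assoc p q r = mk≋ λ k → begin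
    coeff ((p ⊕ q) ⊕ r) k                   ≡⟨ coeff-⊕ (p ⊕ q) r k ⟩
    coeff (p ⊕ q) k + coeff r k             ≡⟨ cong (_+ coeff r k) (coeff-⊕ p q k) ⟩
    (coeff p k + coeff q k) + coeff r k     ≡⟨ +-assoc (coeff p k) _ _ ⟩
    coeff p k + (coeff q k + coeff r k)     ≡⟨ cong (coeff p k +_) (coeff-⊕ q r k) ⟨
    coeff p k + coeff (q ⊕ r) k             ≡⟨ coeff-⊕ p (q ⊕ r) k ⟨
    coeff (p ⊕ (q ⊕ r)) k                   ∎
    where open ≡-Reasoning

  ⊕-identityʳ : ∀ p → p ⊕ [] ≋ p
  ⊕-identityʳ p = mk≋ λ k → trans (coeff-⊕ p [] k) (+-identityʳ _)

  ⊕-cancelʳ : ∀ p q r → p ⊕ r ≋ q ⊕ r → p ≋ q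
  ⊕-cancelʳ p q r e = mk≋ λ k → +-cancelʳ-≡ (coeff r k) _ _
    (trans (sym (coeff-⊕ p r k)) (trans (coeff-≡ e k) (coeff-⊕ q r k)))

  ∷-zero-tail : ∀ {a p} → a ∷ p ≋ [] → p ≋ []
  ∷-zero-tail e = mk≋ λ k → coeff-≡ e (suc k)

  0∷-zero : ∀ {p} → p ≋ [] → 0 ∷ p ≋ []
  0∷-zero p≋0 = mk≋ λ { zero → refl ; (suc k) → coeff-≡ p≋0 k }

  scale-cong : ∀ a {p q} → p ≋ q → scale a p ≋ scale a q
  scale-cong a {p} {q} p≋q = mk≋ λ k →
    trans (coeff-scale a p k) (trans (cong (a *_) (coeff-≡ p≋q k)) (sym (coeff-scale a q k)))

  scale-zero : ∀ p → scale 0 p ≋ []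
  scale-zero p = mk≋ (coeff-scale 0 p)

  scale-one : ∀ p → scale 1 p ≋ p
  scale-one p = mk≋ λ k → trans (coeff-scale 1 p k) (*-identityˡ _)

  scale-distrib-⊕ : ∀ a p q → scale a (p ⊕ q) ≋ scale a p ⊕ scale a q
  scale-distrib-⊕ a p q = mk≋ λ k → begin
    coeff (scale a (p ⊕ q)) k                   ≡⟨ coeff-scale a (p ⊕ q) k ⟩
    a * coeff (p ⊕ q) k                         ≡⟨ cong (a *_) (coeff-⊕ p q k) ⟩
    a * (coeff p k + coeff q k)                 ≡⟨ *-distribˡ-+ a _ _ ⟩
    a * coeff p k + a * coeff q k               ≡⟨ cong₂ _+_ (coeff-scale a p k) (coeff-scale a q k) ⟨
    coeff (scale a p) k + coeff (scale a q) k   ≡⟨ coeff-⊕ (scale a p) (scale a q) k ⟨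
    coeff (scale a p ⊕ scale a q) k             ∎
    where open ≡-Reasoning

  scale-distrib-+ : ∀ a b p → scale (a + b) p ≋ scale a p ⊕ scale b p
  scale-distrib-+ a b p = mk≋ λ k → begin
    coeff (scale (a + b) p) k                   ≡⟨ coeff-scale (a + b) p k ⟩
    (a + b) * coeff p k                         ≡⟨ *-distribʳ-+ _ a b ⟩
    a * coeff p k + b * coeff p k               ≡⟨ cong₂ _+_ (coeff-scale a p k) (coeff-scale b p k) ⟨
    coeff (scale a p) k + coeff (scale b p) k   ≡⟨ coeff-⊕ (scale a p) (scale b p) k ⟨
    coeff (scale a p ⊕ scale b p) k             ∎
    where open ≡-Reasoning

  scale-scale : ∀ a b p → scale a (scale b p) ≋ scale (a * b) p
  scale-scale a b p = mk≋ λ k → begin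
    coeff (scale a (scale b p)) k   ≡⟨ coeff-scale a (scale b p) k ⟩
    a * coeff (scale b p) k         ≡⟨ cong (a *_) (coeff-scale b p k) ⟩
    a * (b * coeff p k)             ≡⟨ *-assoc a b _ ⟨
    a * b * coeff p k               ≡⟨ coeff-scale (a * b) p k ⟨
    coeff (scale (a * b) p) k       ∎
    where open ≡-Reasoning

  0∷-⊗ : ∀ p q → (0 ∷ p) ⊗ q ≋ 0 ∷ (p ⊗ q)
  0∷-⊗ p q = ⊕-congʳ (0 ∷ (p ⊗ q)) (scale-zero q)

  ⊗-zeroˡ : ∀ p → [] ⊗ p ≋ []
  ⊗-zeroˡ p = ≋-refl

  ⊗-zeroʳ : ∀ p → p ⊗ [] ≋ []
  ⊗-zeroʳ []      = ≋-refl
  ⊗-zeroʳ (a ∷ p) = 0∷-zero (⊗-zeroʳ p)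

  ⊗-identityˡ : ∀ p → (1 ∷ []) ⊗ p ≋ p
  ⊗-identityˡ p = ≋-trans (⊕-congˡ (scale 1 p) (0∷-zero ≋-refl)) (≋-trans (⊕-identityʳ (scale 1 p)) (scale-one p))

  ⊗-zero-congˡ : ∀ p q → p ≋ [] → p ⊗ q ≋ []
  ⊗-zero-congˡ []      q p≋0 = ≋-refl
  ⊗-zero-congˡ (a ∷ p) q p≋0 rewrite coeff-≡ p≋0 0 =
    ⊕-cong (scale-zero q) (0∷-zero (⊗-zero-congˡ p q (∷-zero-tail p≋0)))

  ⊗-congˡ : ∀ {p p′} q → p ≋ p′ → p ⊗ q ≋ p′ ⊗ q
  ⊗-congˡ {[]}    {p′}     q e = ≋-sym (⊗-zero-congˡ p′ q (≋-sym e))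
  ⊗-congˡ {a ∷ p} {[]}     q e = ⊗-zero-congˡ (a ∷ p) q e
  ⊗-congˡ {a ∷ p} {b ∷ p′} q e rewrite coeff-≡ e 0 = ⊕-congˡ (scale b q) (∷-cong refl (⊗-congˡ q (∷-tail e)))

  ⊗-congʳ : ∀ p {q q′} → q ≋ q′ → p ⊗ q ≋ p ⊗ q′
  ⊗-congʳ []      e = ≋-refl
  ⊗-congʳ (a ∷ p) e = ⊕-cong (scale-cong a e) (∷-cong refl (⊗-congʳ p e))

  ⊗-cong : ∀ {p p′ q q′} → p ≋ p′ → q ≋ q′ → p ⊗ q ≋ p′ ⊗ q′
  ⊗-cong {p′ = p′} {q} p≋p′ q≋q′ = ≋-trans (⊗-congˡ q p≋p′) (⊗-congʳ p′ q≋q′)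

  ⊕-interchange : ∀ p q r s → (p ⊕ q) ⊕ (r ⊕ s) ≋ (p ⊕ r) ⊕ (q ⊕ s)
  ⊕-interchange p q r s = mk≋ λ k → begin
    coeff ((p ⊕ q) ⊕ (r ⊕ s)) k                                 ≡⟨ coeff-⊕ (p ⊕ q) _ k ⟩
    coeff (p ⊕ q) k + coeff (r ⊕ s) k                           ≡⟨ cong₂ _+_ (coeff-⊕ p q k) (coeff-⊕ r s k) ⟩
    (coeff p k + coeff q k) + (coeff r k + coeff s k)           ≡⟨ interchange (coeff p k) _ _ _ ⟩
    (coeff p k + coeff r k) + (coeff q k + coeff s k)           ≡⟨ cong₂ _+_ (coeff-⊕ p r k) (coeff-⊕ q s k) ⟨
    coeff (p ⊕ r) k + coeff (q ⊕ s) k                           ≡⟨ coeff-⊕ (p ⊕ r) _ k ⟨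
    coeff ((p ⊕ r) ⊕ (q ⊕ s)) k                                 ∎
    where open ≡-Reasoning

  ⊗-distribʳ : ∀ p q r → (q ⊕ r) ⊗ p ≋ (q ⊗ p) ⊕ (r ⊗ p)
  ⊗-distribʳ p []      r       = ≋-refl
  ⊗-distribʳ p (a ∷ q) []      = ≋-sym (⊕-identityʳ _)
  ⊗-distribʳ p (a ∷ q) (b ∷ r) =
    ≋-trans (⊕-cong (scale-distrib-+ a b p) (∷-cong refl (⊗-distribʳ p q r)))
            (⊕-interchange (scale a p) (scale b p) (0 ∷ (q ⊗ p)) (0 ∷ (r ⊗ p)))

  ⊗-∷ʳ : ∀ p b q → p ⊗ (b ∷ q) ≋ scale b p ⊕ (0 ∷ (p ⊗ q))
  ⊗-∷ʳ []      b q = ≋-sym (0∷-zero ≋-refl)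
  ⊗-∷ʳ (a ∷ p) b q = ∷-cong (trans (+-identityʳ _) (trans (*-comm a b) (sym (+-identityʳ _)))) (begin
    scale a q ⊕ (p ⊗ (b ∷ q))                     ≈⟨ ⊕-congˡ (scale a q) (⊗-∷ʳ p b q) ⟩
    scale a q ⊕ (scale b p ⊕ (0 ∷ (p ⊗ q)))       ≈⟨ ≋-sym (⊕-assoc (scale a q) _ _) ⟩
    (scale a q ⊕ scale b p) ⊕ (0 ∷ (p ⊗ q))       ≈⟨ ⊕-congʳ _ (⊕-comm (scale a q) _) ⟩
    (scale b p ⊕ scale a q) ⊕ (0 ∷ (p ⊗ q))       ≈⟨ ⊕-assoc (scale b p) _ _ ⟩
    scale b p ⊕ ((a ∷ p) ⊗ q)                     ∎)
    where open ≋-Reasoning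

  ⊗-comm : ∀ p q → p ⊗ q ≋ q ⊗ p
  ⊗-comm []      q = ≋-sym (⊗-zeroʳ q)
  ⊗-comm (a ∷ p) q = ≋-trans (⊕-congˡ (scale a q) (∷-cong refl (⊗-comm p q))) (≋-sym (⊗-∷ʳ q a p))

  ⊗-distribˡ : ∀ p q r → p ⊗ (q ⊕ r) ≋ (p ⊗ q) ⊕ (p ⊗ r)
  ⊗-distribˡ p q r =
    ≋-trans (⊗-comm p _) (≋-trans (⊗-distribʳ p q r) (⊕-cong (⊗-comm q p) (⊗-comm r p)))

  scale-⊗ : ∀ a p q → scale a (p ⊗ q) ≋ scale a p ⊗ q
  scale-⊗ a []      q = ≋-refl
  scale-⊗ a (b ∷ p) q = ≋-trans (scale-distrib-⊕ a (scale b q) _)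
    (⊕-cong (scale-scale a b q) (∷-cong (*-zeroʳ a) (scale-⊗ a p q)))

  ⊗-assoc : ∀ p q r → (p ⊗ q) ⊗ r ≋ p ⊗ (q ⊗ r)
  ⊗-assoc []      q r = ≋-refl
  ⊗-assoc (a ∷ p) q r = ≋-trans (⊗-distribʳ r (scale a q) (0 ∷ (p ⊗ q)))
    (⊕-cong (≋-sym (scale-⊗ a q r)) (≋-trans (0∷-⊗ (p ⊗ q) r) (∷-cong refl (⊗-assoc p q r))))

  Poly-commutativeSemiring : CommutativeSemiring _ _
  Poly-commutativeSemiring = record
    { Carrier = Poly ; _≈_ = _≋_ ; _+_ = _⊕_ ; _*_ = _⊗_ ; 0# = [] ; 1# = 1 ∷ []
    ; isCommutativeSemiring = record
      { isSemiring = record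
        { isSemiringWithoutAnnihilatingZero = record
          { +-isCommutativeMonoid = record
            { isMonoid = record
              { isSemigroup = record
                { isMagma = record
                  { isEquivalence = Setoid.isEquivalence ≋-setoid
                  ; ∙-cong = ⊕-cong }
                ; assoc = ⊕-assoc }
              ; identity = (λ _ → ≋-refl) , ⊕-identityʳ }
            ; comm = ⊕-comm }
          ; *-cong = ⊗-cong
          ; *-assoc = ⊗-assoc
          ; *-identity = ⊗-identityˡ , (λ p → ≋-trans (⊗-comm p _) (⊗-identityˡ p))
          ; distrib = ⊗-distribˡ , ⊗-distribʳ }
        ; zero = ⊗-zeroˡ , ⊗-zeroʳ }
      ; *-comm = ⊗-comm } }

module QBinomial where

  open import Defs
  open Polynomial
  open import Data.List using ([]; _∷_)
  open import Data.Nat using (ℕ; zero; suc; _+_; _<_; s≤s)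
  open import Data.Nat.Properties using (+-suc; +-comm; +-identityʳ; n<1+n; m<n⇒m<1+n)
  open import Relation.Binary.PropositionalEquality using (_≡_; refl; sym; trans; cong)
  open import Algebra.Solver.Ring.NaturalCoefficients.Default Poly-commutativeSemiring
  open ≋-Reasoning

  infix 30 q^_

  q^_ : ℕ → Poly
  q^ zero  = 1 ∷ []
  q^ suc k = 0 ∷ q^ k

  0∷≋q⊗ : ∀ p → 0 ∷ p ≋ q^ 1 ⊗ p
  0∷≋q⊗ p = ≋-sym (≋-trans (0∷-⊗ (1 ∷ []) p) (∷-cong refl (⊗-identityˡ p)))

  q^-+ : ∀ a b → q^ (a + b) ≋ q^ a ⊗ q^ b
  q^-+ zero    b = ≋-sym (⊗-identityˡ (q^ b))
  q^-+ (suc a) b = ≋-trans (∷-cong refl (q^-+ a b)) (≋-sym (0∷-⊗ (q^ a) (q^ b)))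

  q^-sucʳ : ∀ k → q^ suc k ≋ q^ k ⊗ q^ 1
  q^-sucʳ k = ≋-trans (q^-+ 1 k) (⊗-comm (q^ 1) (q^ k))

  q^-cong : ∀ {a b} → a ≡ b → q^ a ≋ q^ b
  q^-cong refl = ≋-refl

  qInt-+ : ∀ a b → qInt (a + b) ≋ qInt a ⊕ (q^ a ⊗ qInt b)
  qInt-+ zero    b = ≋-sym (⊗-identityˡ (qInt b))
  qInt-+ (suc a) b = ≋-trans (∷-cong refl (qInt-+ a b))
    (⊕-congˡ (1 ∷ qInt a) (≋-sym (0∷-⊗ (q^ a) (qInt b))))

  qInt-suc : ∀ m → qInt (suc m) ≋ (1 ∷ []) ⊕ (q^ 1 ⊗ qInt m)
  qInt-suc m = ⊕-congˡ (1 ∷ []) (0∷≋q⊗ (qInt m))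

  qInt-cong : ∀ {a b} → a ≡ b → qInt a ≋ qInt b
  qInt-cong refl = ≋-refl

  qFact-cong : ∀ {a b} → a ≡ b → qFact a ≋ qFact b
  qFact-cong refl = ≋-refl

  qBinom : ℕ → ℕ → Poly
  qBinom m       zero    = 1 ∷ []
  qBinom zero    (suc k) = []
  qBinom (suc m) (suc k) = qBinom m k ⊕ (q^ suc k ⊗ qBinom m (suc k))

  qBinom-cong : ∀ {m m′} k → m ≡ m′ → qBinom m k ≋ qBinom m′ k
  qBinom-cong k refl = ≋-refl

  m<k⇒qBinom≋[] : ∀ m k → m < k → qBinom m k ≋ []
  m<k⇒qBinom≋[] zero    (suc k) _         = ≋-refl
  m<k⇒qBinom≋[] (suc m) (suc k) (s≤s m<k) = ⊕-cong (m<k⇒qBinom≋[] m k m<k)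
    (≋-trans (⊗-congʳ (q^ suc k) (m<k⇒qBinom≋[] m (suc k) (m<n⇒m<1+n m<k))) (⊗-zeroʳ (q^ suc k)))

  qBinom-diagonal : ∀ m → qBinom m m ≋ 1 ∷ []
  qBinom-diagonal zero    = ≋-refl
  qBinom-diagonal (suc m) = begin
    qBinom m m ⊕ (q^ suc m ⊗ qBinom m (suc m))   ≈⟨ ⊕-cong (qBinom-diagonal m) (⊗-congʳ (q^ suc m) (m<k⇒qBinom≋[] m (suc m) (n<1+n m))) ⟩
    (1 ∷ []) ⊕ (q^ suc m ⊗ [])                   ≈⟨ ⊕-congˡ (1 ∷ []) (⊗-zeroʳ (q^ suc m)) ⟩
    (1 ∷ []) ⊕ []                                ≈⟨ ⊕-identityʳ (1 ∷ []) ⟩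
    1 ∷ []                                       ∎

  qBinom-pascalʳ : ∀ k j {n} → n ≡ k + j → qBinom (suc n) (suc k) ≋ (q^ j ⊗ qBinom n k) ⊕ qBinom n (suc k)
  qBinom-pascalʳ zero zero refl =
    ≋-trans (qBinom-diagonal 1) (≋-sym (≋-trans (⊕-identityʳ ((1 ∷ []) ⊗ (1 ∷ []))) (⊗-identityˡ (1 ∷ []))))
  qBinom-pascalʳ zero (suc j) refl = begin
    (1 ∷ []) ⊕ (q^ 1 ⊗ qBinom (suc j) 1)
      ≈⟨ ⊕-congˡ (1 ∷ []) (⊗-congʳ (q^ 1) (qBinom-pascalʳ zero j refl)) ⟩
    (1 ∷ []) ⊕ (q^ 1 ⊗ ((q^ j ⊗ (1 ∷ [])) ⊕ qBinom j 1))
      ≈⟨ solve 3 (λ qʲ q b → con 1 :+ q :* (qʲ :* con 1 :+ b) := (q :* qʲ) :* con 1 :+ (con 1 :+ q :* b))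
           ≋-refl (q^ j) (q^ 1) (qBinom j 1) ⟩
    ((q^ 1 ⊗ q^ j) ⊗ (1 ∷ [])) ⊕ ((1 ∷ []) ⊕ (q^ 1 ⊗ qBinom j 1))
      ≈⟨ ⊕-congʳ (qBinom (suc j) 1) (⊗-congˡ (1 ∷ []) (≋-sym (q^-+ 1 j))) ⟩
    (q^ suc j ⊗ (1 ∷ [])) ⊕ qBinom (suc j) 1
      ∎
  qBinom-pascalʳ (suc k) zero refl = begin
    qBinom (suc (suc k + 0)) (suc (suc k))    ≈⟨ qBinom-cong (suc (suc k)) (cong suc k+0≡k) ⟩
    qBinom (suc (suc k)) (suc (suc k))        ≈⟨ qBinom-diagonal (suc (suc k)) ⟩
    1 ∷ []                                    ≈⟨ ≋-sym (⊕-identityʳ _) ⟩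
    (1 ∷ []) ⊕ []                             ≈⟨ ≋-sym (⊕-cong (≋-trans (⊗-identityˡ _) diag) empty) ⟩
    (q^ 0 ⊗ qBinom (suc k + 0) (suc k)) ⊕ qBinom (suc k + 0) (suc (suc k))   ∎
    where
    k+0≡k = cong suc (+-identityʳ k)
    diag : qBinom (suc k + 0) (suc k) ≋ 1 ∷ []
    diag = ≋-trans (qBinom-cong (suc k) k+0≡k) (qBinom-diagonal (suc k))
    empty : qBinom (suc k + 0) (suc (suc k)) ≋ []
    empty = ≋-trans (qBinom-cong (suc (suc k)) k+0≡k) (m<k⇒qBinom≋[] (suc k) (suc (suc k)) (n<1+n (suc k)))
  qBinom-pascalʳ (suc k) (suc j) refl = begin
    qBinom (suc n) (suc k) ⊕ (qˢˢᵏ ⊗ qBinom (suc n) (suc (suc k)))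
      ≈⟨ ⊕-cong (qBinom-pascalʳ k (suc j) refl) (⊗-congʳ qˢˢᵏ (qBinom-pascalʳ (suc k) j (+-suc k j))) ⟩
    ((qˢʲ ⊗ b₀) ⊕ b₁) ⊕ (qˢˢᵏ ⊗ ((q^ j ⊗ b₁) ⊕ b₂))
      ≈⟨ solve 6 (λ a b₀ b₁ b₂ c x → (a :* b₀ :+ b₁) :+ c :* (x :* b₁ :+ b₂) := (a :* b₀ :+ b₁) :+ ((c :* x) :* b₁ :+ c :* b₂))
           ≋-refl qˢʲ b₀ b₁ b₂ qˢˢᵏ (q^ j) ⟩
    ((qˢʲ ⊗ b₀) ⊕ b₁) ⊕ (((qˢˢᵏ ⊗ q^ j) ⊗ b₁) ⊕ (qˢˢᵏ ⊗ b₂))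
      ≈⟨ ⊕-congˡ ((qˢʲ ⊗ b₀) ⊕ b₁) (⊕-congʳ (qˢˢᵏ ⊗ b₂) (⊗-congˡ b₁ exponents)) ⟩
    ((qˢʲ ⊗ b₀) ⊕ b₁) ⊕ (((qˢʲ ⊗ q^ suc k) ⊗ b₁) ⊕ (qˢˢᵏ ⊗ b₂))
      ≈⟨ solve 6 (λ a b₀ b₁ b₂ c e → (a :* b₀ :+ b₁) :+ ((a :* e) :* b₁ :+ c :* b₂) := a :* (b₀ :+ e :* b₁) :+ (b₁ :+ c :* b₂))
           ≋-refl qˢʲ b₀ b₁ b₂ qˢˢᵏ (q^ suc k) ⟩
    (qˢʲ ⊗ qBinom (suc n) (suc k)) ⊕ qBinom (suc n) (suc (suc k))
      ∎
    where
    n = k + suc j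
    b₀ = qBinom n k
    b₁ = qBinom n (suc k)
    b₂ = qBinom n (suc (suc k))
    qˢʲ = q^ suc j
    qˢˢᵏ = q^ suc (suc k)
    exponents : qˢˢᵏ ⊗ q^ j ≋ qˢʲ ⊗ q^ suc k
    exponents = ≋-trans (≋-sym (q^-+ (suc (suc k)) j))
      (≋-trans (q^-cong (cong suc (trans (cong suc (+-comm k j)) (sym (+-suc j k))))) (q^-+ (suc j) (suc k)))

  qBinom-sym : ∀ a b {n} → n ≡ a + b → qBinom n a ≋ qBinom n b
  qBinom-sym zero    b       refl = ≋-sym (qBinom-diagonal b)
  qBinom-sym (suc a) zero    refl = ≋-trans (qBinom-cong (suc a) (+-identityʳ (suc a))) (qBinom-diagonal (suc a))
  qBinom-sym (suc a) (suc b) refl = begin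
    qBinom n a ⊕ (q^ suc a ⊗ qBinom n (suc a))   ≈⟨ ⊕-cong (qBinom-sym a (suc b) refl) (⊗-congʳ (q^ suc a) (qBinom-sym (suc a) b (+-suc a b))) ⟩
    qBinom n (suc b) ⊕ (q^ suc a ⊗ qBinom n b)   ≈⟨ ⊕-comm (qBinom n (suc b)) _ ⟩
    (q^ suc a ⊗ qBinom n b) ⊕ qBinom n (suc b)   ≈⟨ ≋-sym (qBinom-pascalʳ b (suc a) a+sb≡b+sa) ⟩
    qBinom (suc n) (suc b)                       ∎
    where
    n = a + suc b
    a+sb≡b+sa : a + suc b ≡ b + suc a
    a+sb≡b+sa = trans (+-suc a b) (trans (cong suc (+-comm a b)) (sym (+-suc b a)))

  qBinom-qFact : ∀ k j {n} → n ≡ k + j → qBinom n k ⊗ (qFact k ⊗ qFact j) ≋ qFact n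
  qBinom-qFact zero j refl = ≋-trans (⊗-identityˡ _) (⊗-identityˡ (qFact j))
  qBinom-qFact (suc k) zero refl = begin
    qBinom (suc k + 0) (suc k) ⊗ (qFact (suc k) ⊗ (1 ∷ []))
      ≈⟨ ⊗-cong (≋-trans (qBinom-cong (suc k) (+-identityʳ (suc k))) (qBinom-diagonal (suc k))) (⊗-comm (qFact (suc k)) _) ⟩
    (1 ∷ []) ⊗ ((1 ∷ []) ⊗ qFact (suc k))
      ≈⟨ ≋-trans (⊗-identityˡ _) (⊗-identityˡ _) ⟩
    qFact (suc k)
      ≈⟨ qFact-cong (sym (+-identityʳ (suc k))) ⟩
    qFact (suc k + 0)
      ∎
  qBinom-qFact (suc k) (suc j) refl = begin
    (b₀ ⊕ (qˢᵏ ⊗ b₁)) ⊗ ((iₖ ⊗ fₖ) ⊗ (iⱼ ⊗ fⱼ))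
      ≈⟨ solve 7 (λ b₀ b₁ x iₖ fₖ iⱼ fⱼ → (b₀ :+ x :* b₁) :* ((iₖ :* fₖ) :* (iⱼ :* fⱼ))
                   := iₖ :* (b₀ :* (fₖ :* (iⱼ :* fⱼ))) :+ (x :* iⱼ) :* (b₁ :* ((iₖ :* fₖ) :* fⱼ)))
           ≋-refl b₀ b₁ qˢᵏ iₖ fₖ iⱼ fⱼ ⟩
    (iₖ ⊗ (b₀ ⊗ (fₖ ⊗ (iⱼ ⊗ fⱼ)))) ⊕ ((qˢᵏ ⊗ iⱼ) ⊗ (b₁ ⊗ ((iₖ ⊗ fₖ) ⊗ fⱼ)))
      ≈⟨ ⊕-cong (⊗-congʳ iₖ (qBinom-qFact k (suc j) refl)) (⊗-congʳ (qˢᵏ ⊗ iⱼ) (qBinom-qFact (suc k) j (+-suc k j))) ⟩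
    (iₖ ⊗ qFact n) ⊕ ((qˢᵏ ⊗ iⱼ) ⊗ qFact n)
      ≈⟨ ≋-sym (⊗-distribʳ (qFact n) iₖ (qˢᵏ ⊗ iⱼ)) ⟩
    (iₖ ⊕ (qˢᵏ ⊗ iⱼ)) ⊗ qFact n
      ≈⟨ ⊗-congˡ (qFact n) (≋-sym (qInt-+ (suc k) (suc j))) ⟩
    qInt (suc n) ⊗ qFact n
      ∎
    where
    n = k + suc j
    b₀ = qBinom n k
    b₁ = qBinom n (suc k)
    qˢᵏ = q^ suc k
    iₖ = qInt (suc k)
    iⱼ = qInt (suc j)
    fₖ = qFact k
    fⱼ = qFact j

  -- [m choose k - 1]_q, which vanishes for k = 0.
  qBinom⁻ : ℕ → ℕ → Poly
  qBinom⁻ m zero    = []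
  qBinom⁻ m (suc k) = qBinom m k

  qBinom-pascal⁻ : ∀ m k → qBinom (suc m) k ≋ qBinom⁻ m k ⊕ (q^ k ⊗ qBinom m k)
  qBinom-pascal⁻ m zero    = ≋-sym (⊗-identityˡ (1 ∷ []))
  qBinom-pascal⁻ m (suc k) = ≋-refl

  qBinom-pascalʳ⁻ : ∀ k j {n} → n ≡ k + j → qBinom (suc n) k ≋ (q^ suc j ⊗ qBinom⁻ n k) ⊕ qBinom n k
  qBinom-pascalʳ⁻ zero    j _   = ≋-sym (⊕-congʳ (1 ∷ []) (⊗-zeroʳ (q^ suc j)))
  qBinom-pascalʳ⁻ (suc k) j n≡ = qBinom-pascalʳ k (suc j) (trans n≡ (sym (+-suc k j)))

module QCatalan where

  open import Defs
  open Polynomial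
  open QBinomial
  open Parity
  open import Data.List using ([]; _∷_)
  open import Data.Nat using (ℕ; zero; suc; _+_)
  open import Function using (_∘_)
  open import Data.Nat.Properties using (+-suc; +-comm; +-assoc; +-identityʳ)
  open import Relation.Binary.PropositionalEquality using (_≡_; refl; sym; trans; cong)
  open import Algebra.Solver.Ring.NaturalCoefficients.Default Poly-commutativeSemiring
  open ≋-Reasoning

  -- qBallotₑ k h = [2k+h choose k]_q − qᵉ [2k+h choose k−1]_q (see the specs below); the
  -- recursion shows that these differences have coefficients in ℕ.
  qBallot₀ : ℕ → ℕ → Poly
  qBallot₁ : ℕ → ℕ → Poly
  qBallot₀ zero    h       = 1 ∷ []
  qBallot₀ (suc k) zero    = q^ suc k ⊗ qBallot₁ k 1
  qBallot₀ (suc k) (suc h) = qBallot₀ (suc k) h ⊕ (q^ suc (suc (k + h)) ⊗ qBallot₁ k (suc (suc h)))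
  qBallot₁ zero    h       = 1 ∷ []
  qBallot₁ (suc k) zero    = qBallot₁ k 1
  qBallot₁ (suc k) (suc h) = qBallot₁ k (suc (suc h)) ⊕ (q^ suc k ⊗ qBallot₀ (suc k) h)

  private
    double-+ : ∀ k h → double k + h ≡ k + (k + h)
    double-+ k h = trans (cong (_+ h) (double≡+ k)) (+-assoc k k h)

    2k+1≡k+[1+k] : ∀ k → double k + 1 ≡ k + suc k
    2k+1≡k+[1+k] k = trans (double-+ k 1) (cong (k +_) (+-comm k 1))

    2[1+k]≡2+2k+1 : ∀ k → double (suc k) + 0 ≡ suc (double k + 1)
    2[1+k]≡2+2k+1 k = cong suc (trans (cong suc (+-identityʳ (double k))) (+-comm 1 (double k)))

    2[1+k]+1+h≡1+2+2k+h : ∀ k h → double (suc k) + suc h ≡ suc (suc (suc (double k + h)))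
    2[1+k]+1+h≡1+2+2k+h k h = cong (suc ∘ suc) (+-suc (double k) h)

    2+2k+h≡k+[2+k+h] : ∀ k h → suc (suc (double k + h)) ≡ k + suc (suc (k + h))
    2+2k+h≡k+[2+k+h] k h = trans (cong (suc ∘ suc) (double-+ k h)) (sym (trans (+-suc k _) (cong suc (+-suc k _))))

    2+2k+h≡2k+[2+h] : ∀ k h → suc (suc (double k + h)) ≡ double k + suc (suc h)
    2+2k+h≡2k+[2+h] k h = sym (trans (+-suc (double k) (suc h)) (cong suc (+-suc (double k) h)))

  qBallot₀-spec : ∀ k h {n} → n ≡ double k + h → qBallot₀ k h ⊕ qBinom⁻ n k ≋ qBinom n k
  qBallot₁-spec : ∀ k h {n} → n ≡ double k + h → qBallot₁ k h ⊕ (q^ 1 ⊗ qBinom⁻ n k) ≋ qBinom n k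

  qBallot₀-spec zero h _ = ⊕-identityʳ (1 ∷ [])
  qBallot₀-spec (suc k) zero {n} n≡ = begin
    (qᵏ⁺¹ ⊗ o) ⊕ qBinom n k
      ≈⟨ ⊕-congˡ (qᵏ⁺¹ ⊗ o) (qBinom-cong k n≡1+N) ⟩
    (qᵏ⁺¹ ⊗ o) ⊕ qBinom (suc N) k
      ≈⟨ ⊕-congˡ (qᵏ⁺¹ ⊗ o) (qBinom-pascalʳ⁻ k (suc k) (2k+1≡k+[1+k] k)) ⟩
    (qᵏ⁺¹ ⊗ o) ⊕ ((q^ suc (suc k) ⊗ qBinom⁻ N k) ⊕ qBinom N k)
      ≈⟨ ⊕-congˡ (qᵏ⁺¹ ⊗ o) (⊕-congʳ (qBinom N k) (⊗-congˡ (qBinom⁻ N k) (q^-sucʳ (suc k)))) ⟩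
    (qᵏ⁺¹ ⊗ o) ⊕ (((qᵏ⁺¹ ⊗ q^ 1) ⊗ qBinom⁻ N k) ⊕ qBinom N k)
      ≈⟨ solve 5 (λ a o x b⁻ b → a :* o :+ ((a :* x) :* b⁻ :+ b) := a :* (o :+ x :* b⁻) :+ b)
           ≋-refl qᵏ⁺¹ o (q^ 1) (qBinom⁻ N k) (qBinom N k) ⟩
    (qᵏ⁺¹ ⊗ (o ⊕ (q^ 1 ⊗ qBinom⁻ N k))) ⊕ qBinom N k
      ≈⟨ ⊕-cong (⊗-congʳ qᵏ⁺¹ (qBallot₁-spec k 1 refl)) (qBinom-sym k (suc k) (2k+1≡k+[1+k] k)) ⟩
    (qᵏ⁺¹ ⊗ qBinom N k) ⊕ qBinom N (suc k)
      ≈⟨ ≋-sym (qBinom-pascalʳ k (suc k) (2k+1≡k+[1+k] k)) ⟩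
    qBinom (suc N) (suc k)
      ≈⟨ qBinom-cong (suc k) (sym n≡1+N) ⟩
    qBinom n (suc k)
      ∎
    where
    N = double k + 1
    n≡1+N = trans n≡ (2[1+k]≡2+2k+1 k)
    o = qBallot₁ k 1
    qᵏ⁺¹ = q^ suc k
  qBallot₀-spec (suc k) (suc h) {n} n≡ = begin
    (z ⊕ (qʲ ⊗ o)) ⊕ qBinom n k
      ≈⟨ ⊕-congˡ (z ⊕ (qʲ ⊗ o)) (qBinom-cong k n≡1+M) ⟩
    (z ⊕ (qʲ ⊗ o)) ⊕ qBinom (suc M) k
      ≈⟨ ⊕-congˡ (z ⊕ (qʲ ⊗ o)) (qBinom-pascalʳ⁻ k j (2+2k+h≡k+[2+k+h] k h)) ⟩
    (z ⊕ (qʲ ⊗ o)) ⊕ ((q^ suc j ⊗ qBinom⁻ M k) ⊕ qBinom M k)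
      ≈⟨ ⊕-congˡ (z ⊕ (qʲ ⊗ o)) (⊕-congʳ (qBinom M k) (⊗-congˡ (qBinom⁻ M k) (q^-sucʳ j))) ⟩
    (z ⊕ (qʲ ⊗ o)) ⊕ (((qʲ ⊗ q^ 1) ⊗ qBinom⁻ M k) ⊕ qBinom M k)
      ≈⟨ solve 6 (λ z a o x b⁻ b → (z :+ a :* o) :+ ((a :* x) :* b⁻ :+ b) := (z :+ b) :+ a :* (o :+ x :* b⁻))
           ≋-refl z qʲ o (q^ 1) (qBinom⁻ M k) (qBinom M k) ⟩
    (z ⊕ qBinom M k) ⊕ (qʲ ⊗ (o ⊕ (q^ 1 ⊗ qBinom⁻ M k)))
      ≈⟨ ⊕-cong (qBallot₀-spec (suc k) h refl) (⊗-congʳ qʲ (qBallot₁-spec k (suc (suc h)) (2+2k+h≡2k+[2+h] k h))) ⟩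
    qBinom M (suc k) ⊕ (qʲ ⊗ qBinom M k)
      ≈⟨ ⊕-comm (qBinom M (suc k)) _ ⟩
    (qʲ ⊗ qBinom M k) ⊕ qBinom M (suc k)
      ≈⟨ ≋-sym (qBinom-pascalʳ k j (2+2k+h≡k+[2+k+h] k h)) ⟩
    qBinom (suc M) (suc k)
      ≈⟨ qBinom-cong (suc k) (sym n≡1+M) ⟩
    qBinom n (suc k)
      ∎
    where
    M = suc (suc (double k + h))
    n≡1+M = trans n≡ (2[1+k]+1+h≡1+2+2k+h k h)
    j = suc (suc (k + h))
    qʲ = q^ j
    z = qBallot₀ (suc k) h
    o = qBallot₁ k (suc (suc h))

  qBallot₁-spec zero h _ = ≋-trans (⊕-congˡ (1 ∷ []) (⊗-zeroʳ (q^ 1))) (⊕-identityʳ (1 ∷ []))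
  qBallot₁-spec (suc k) zero {n} n≡ = begin
    o ⊕ (q^ 1 ⊗ qBinom n k)
      ≈⟨ ⊕-congˡ o (⊗-congʳ (q^ 1) (≋-trans (qBinom-cong k n≡1+N) (qBinom-pascal⁻ N k))) ⟩
    o ⊕ (q^ 1 ⊗ (qBinom⁻ N k ⊕ (q^ k ⊗ qBinom N k)))
      ≈⟨ solve 5 (λ o x b⁻ xᵏ b → o :+ x :* (b⁻ :+ xᵏ :* b) := (o :+ x :* b⁻) :+ (x :* xᵏ) :* b)
           ≋-refl o (q^ 1) (qBinom⁻ N k) (q^ k) (qBinom N k) ⟩
    (o ⊕ (q^ 1 ⊗ qBinom⁻ N k)) ⊕ ((q^ 1 ⊗ q^ k) ⊗ qBinom N k)
      ≈⟨ ⊕-cong (qBallot₁-spec k 1 refl) (⊗-cong (≋-sym (q^-+ 1 k)) (qBinom-sym k (suc k) (2k+1≡k+[1+k] k))) ⟩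
    qBinom (suc N) (suc k)
      ≈⟨ qBinom-cong (suc k) (sym n≡1+N) ⟩
    qBinom n (suc k)
      ∎
    where
    N = double k + 1
    n≡1+N = trans n≡ (2[1+k]≡2+2k+1 k)
    o = qBallot₁ k 1
  qBallot₁-spec (suc k) (suc h) {n} n≡ = begin
    (o ⊕ (qᵏ⁺¹ ⊗ z)) ⊕ (q^ 1 ⊗ qBinom n k)
      ≈⟨ ⊕-congˡ (o ⊕ (qᵏ⁺¹ ⊗ z)) (⊗-congʳ (q^ 1) (≋-trans (qBinom-cong k n≡1+M) (qBinom-pascal⁻ M k))) ⟩
    (o ⊕ (qᵏ⁺¹ ⊗ z)) ⊕ (q^ 1 ⊗ (qBinom⁻ M k ⊕ (q^ k ⊗ qBinom M k)))
      ≈⟨ solve 7 (λ o a z x b⁻ xᵏ b → (o :+ a :* z) :+ x :* (b⁻ :+ xᵏ :* b) := (o :+ x :* b⁻) :+ (a :* z :+ (x :* xᵏ) :* b))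
           ≋-refl o qᵏ⁺¹ z (q^ 1) (qBinom⁻ M k) (q^ k) (qBinom M k) ⟩
    (o ⊕ (q^ 1 ⊗ qBinom⁻ M k)) ⊕ ((qᵏ⁺¹ ⊗ z) ⊕ ((q^ 1 ⊗ q^ k) ⊗ qBinom M k))
      ≈⟨ ⊕-cong (qBallot₁-spec k (suc (suc h)) (2+2k+h≡2k+[2+h] k h)) (⊕-congˡ (qᵏ⁺¹ ⊗ z) (⊗-congˡ (qBinom M k) (≋-sym (q^-+ 1 k)))) ⟩
    qBinom M k ⊕ ((qᵏ⁺¹ ⊗ z) ⊕ (qᵏ⁺¹ ⊗ qBinom M k))
      ≈⟨ ⊕-congˡ (qBinom M k) (≋-trans (≋-sym (⊗-distribˡ qᵏ⁺¹ z (qBinom M k))) (⊗-congʳ qᵏ⁺¹ (qBallot₀-spec (suc k) h refl))) ⟩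
    qBinom (suc M) (suc k)
      ≈⟨ qBinom-cong (suc k) (sym n≡1+M) ⟩
    qBinom n (suc k)
      ∎
    where
    M = suc (suc (double k + h))
    n≡1+M = trans n≡ (2[1+k]+1+h≡1+2+2k+h k h)
    qᵏ⁺¹ = q^ suc k
    z = qBallot₀ (suc k) h
    o = qBallot₁ k (suc (suc h))

  qInt-product : ∀ k → qInt (suc k) ⊗ qInt (suc (suc k)) ≋ qInt (suc k + suc k) ⊕ (q^ 1 ⊗ (qInt k ⊗ qInt (suc k)))
  qInt-product k = begin
    iₖ₊₁ ⊗ qInt (suc (suc k))
      ≈⟨ ⊗-congʳ iₖ₊₁ (≋-trans (qInt-suc (suc k)) (⊕-congˡ (1 ∷ []) (⊗-congʳ (q^ 1) iₖ₊₁-split))) ⟩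
    iₖ₊₁ ⊗ ((1 ∷ []) ⊕ (q^ 1 ⊗ (qInt k ⊕ (q^ k ⊗ (1 ∷ [])))))
      ≈⟨ solve 4 (λ i₁ x i xᵏ → i₁ :* (con 1 :+ x :* (i :+ xᵏ :* con 1)) := (i₁ :+ (x :* xᵏ) :* i₁) :+ x :* (i :* i₁))
           ≋-refl iₖ₊₁ (q^ 1) (qInt k) (q^ k) ⟩
    (iₖ₊₁ ⊕ ((q^ 1 ⊗ q^ k) ⊗ iₖ₊₁)) ⊕ (q^ 1 ⊗ (qInt k ⊗ iₖ₊₁))
      ≈⟨ ⊕-congʳ _ (≋-trans (⊕-congˡ iₖ₊₁ (⊗-congˡ iₖ₊₁ (≋-sym (q^-+ 1 k)))) (≋-sym (qInt-+ (suc k) (suc k)))) ⟩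
    qInt (suc k + suc k) ⊕ (q^ 1 ⊗ (qInt k ⊗ iₖ₊₁))
      ∎
    where
    iₖ₊₁ = qInt (suc k)
    iₖ₊₁-split : iₖ₊₁ ≋ qInt k ⊕ (q^ k ⊗ (1 ∷ []))
    iₖ₊₁-split = ≋-trans (qInt-cong (+-comm 1 k)) (qInt-+ k 1)

  -- For n = k + 1 this is [2k+1 choose k]_q − q [2k+1 choose k−1]_q.
  qCatalan : ℕ → Poly
  qCatalan zero    = 1 ∷ []
  qCatalan (suc k) = qBallot₁ k 1

  -- Multiplying qCatalan (k+1) + q [2k+1 choose k−1] = [2k+1 choose k] by [k+2] [k+1]!², the
  -- right-hand side becomes [2k+1]! ([2k+2] + q [k] [k+1]) and the q-term [2k+1]! q [k] [k+1].
  qCatalan-suc-spec : ∀ k → (((qCatalan (suc k) ⊗ qInt (suc (suc k))) ⊗ qFact (suc k)) ⊗ qFact (suc k)) ≋ qFact (suc k + suc k)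
  qCatalan-suc-spec zero = ≋-refl
  qCatalan-suc-spec (suc c) = begin
    lhs            ≈⟨ ⊕-cancelʳ lhs (fₙ ⊗ iₙ₊₁) r lhs+r ⟩
    fₙ ⊗ iₙ₊₁      ≈⟨ ⊗-comm fₙ iₙ₊₁ ⟩
    iₙ₊₁ ⊗ fₙ      ≈⟨ ⊗-congʳ iₙ₊₁ (qFact-cong (2k+1≡k+[1+k] k)) ⟩
    qFact (suc k + suc k) ∎
    where
    k = suc c
    n = double k + 1
    o = qBallot₁ k 1
    iₖ = qInt k
    iₖ₊₁ = qInt (suc k)
    iₖ₊₂ = qInt (suc (suc k))
    iₙ₊₁ = qInt (suc k + suc k)
    fₖ = qFact k
    fₖ₊₁ = qFact (suc k)
    fₙ = qFact n
    lhs = ((o ⊗ iₖ₊₂) ⊗ fₖ₊₁) ⊗ fₖ₊₁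
    r = (((q^ 1 ⊗ qBinom n c) ⊗ iₖ₊₂) ⊗ fₖ₊₁) ⊗ fₖ₊₁
    r-spec : r ≋ fₙ ⊗ (q^ 1 ⊗ (iₖ ⊗ iₖ₊₁))
    r-spec = begin
      (((q^ 1 ⊗ qBinom n c) ⊗ iₖ₊₂) ⊗ (iₖ₊₁ ⊗ (iₖ ⊗ qFact c))) ⊗ (iₖ₊₁ ⊗ (iₖ ⊗ qFact c))
        ≈⟨ solve 6 (λ x b i₂ i₁ i f → (((x :* b) :* i₂) :* (i₁ :* (i :* f))) :* (i₁ :* (i :* f))
                    := (b :* (f :* (i₂ :* (i₁ :* (i :* f))))) :* (x :* (i :* i₁)))
             ≋-refl (q^ 1) (qBinom n c) iₖ₊₂ iₖ₊₁ iₖ (qFact c) ⟩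
      (qBinom n c ⊗ (qFact c ⊗ qFact (suc (suc k)))) ⊗ (q^ 1 ⊗ (iₖ ⊗ iₖ₊₁))
        ≈⟨ ⊗-congˡ (q^ 1 ⊗ (iₖ ⊗ iₖ₊₁)) (qBinom-qFact c (suc (suc k)) 2k+1≡c+[2+k]) ⟩
      fₙ ⊗ (q^ 1 ⊗ (iₖ ⊗ iₖ₊₁))
        ∎
      where
      2k+1≡c+[2+k] : n ≡ c + suc (suc k)
      2k+1≡c+[2+k] = trans (2k+1≡k+[1+k] k) (sym (+-suc c (suc k)))
    lhs+r : lhs ⊕ r ≋ (fₙ ⊗ iₙ₊₁) ⊕ r
    lhs+r = begin
      lhs ⊕ r
        ≈⟨ solve 5 (λ o x b i₂ f₁ → ((o :* i₂) :* f₁) :* f₁ :+ (((x :* b) :* i₂) :* f₁) :* f₁ := (((o :+ x :* b) :* i₂) :* f₁) :* f₁)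
             ≋-refl o (q^ 1) (qBinom n c) iₖ₊₂ fₖ₊₁ ⟩
      (((o ⊕ (q^ 1 ⊗ qBinom n c)) ⊗ iₖ₊₂) ⊗ fₖ₊₁) ⊗ fₖ₊₁
        ≈⟨ ⊗-congˡ fₖ₊₁ (⊗-congˡ fₖ₊₁ (⊗-congˡ iₖ₊₂ (qBallot₁-spec k 1 refl))) ⟩
      ((qBinom n k ⊗ iₖ₊₂) ⊗ fₖ₊₁) ⊗ fₖ₊₁
        ≈⟨ solve 5 (λ b i₂ i₁ f f₁ → ((b :* i₂) :* (i₁ :* f)) :* f₁ := (b :* (f :* f₁)) :* (i₁ :* i₂))
             ≋-refl (qBinom n k) iₖ₊₂ iₖ₊₁ fₖ fₖ₊₁ ⟩
      (qBinom n k ⊗ (fₖ ⊗ fₖ₊₁)) ⊗ (iₖ₊₁ ⊗ iₖ₊₂)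
        ≈⟨ ⊗-cong (qBinom-qFact k (suc k) (2k+1≡k+[1+k] k)) (qInt-product k) ⟩
      fₙ ⊗ (qInt (suc k + suc k) ⊕ (q^ 1 ⊗ (iₖ ⊗ iₖ₊₁)))
        ≈⟨ ⊗-distribˡ fₙ _ _ ⟩
      (fₙ ⊗ iₙ₊₁) ⊕ (fₙ ⊗ (q^ 1 ⊗ (iₖ ⊗ iₖ₊₁)))
        ≈⟨ ⊕-congˡ (fₙ ⊗ iₙ₊₁) (≋-sym r-spec) ⟩
      (fₙ ⊗ iₙ₊₁) ⊕ r
        ∎

  qCatalan-isCatPoly : ∀ n → IsCatPoly n (qCatalan n)
  qCatalan-isCatPoly zero    = λ _ → refl
  qCatalan-isCatPoly (suc k) = coeff-≡ (qCatalan-suc-spec k)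

module EvalOne where

  open import Defs
  open Polynomial
  open QBinomial
  open QCatalan
  open import Data.List using ([]; _∷_)
  open import Data.Nat using (ℕ; zero; suc; _+_; _*_)
  open import Data.Nat.Properties
  open import Algebra.Properties.CommutativeSemigroup +-commutativeSemigroup using (interchange)
  open import Relation.Binary.PropositionalEquality

  eval1-⊕ : ∀ p q → eval1 (p ⊕ q) ≡ eval1 p + eval1 q
  eval1-⊕ []      q       = refl
  eval1-⊕ (a ∷ p) []      = sym (+-identityʳ _)
  eval1-⊕ (a ∷ p) (b ∷ q) = trans (cong (a + b +_) (eval1-⊕ p q)) (interchange a b (eval1 p) (eval1 q))

  eval1-scale : ∀ a p → eval1 (scale a p) ≡ a * eval1 p
  eval1-scale a []      = sym (*-zeroʳ a)
  eval1-scale a (b ∷ p) = trans (cong (a * b +_) (eval1-scale a p)) (sym (*-distribˡ-+ a b (eval1 p)))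

  eval1-⊗ : ∀ p q → eval1 (p ⊗ q) ≡ eval1 p * eval1 q
  eval1-⊗ []      q = refl
  eval1-⊗ (a ∷ p) q = begin
    eval1 (scale a q ⊕ (0 ∷ (p ⊗ q)))     ≡⟨ eval1-⊕ (scale a q) (0 ∷ (p ⊗ q)) ⟩
    eval1 (scale a q) + eval1 (p ⊗ q)     ≡⟨ cong₂ _+_ (eval1-scale a q) (eval1-⊗ p q) ⟩
    a * eval1 q + eval1 p * eval1 q       ≡⟨ *-distribʳ-+ (eval1 q) a (eval1 p) ⟨
    (a + eval1 p) * eval1 q               ∎
    where open ≡-Reasoning

  eval1-q^⊗ : ∀ k p → eval1 (q^ k ⊗ p) ≡ eval1 p
  eval1-q^⊗ k p = trans (eval1-⊗ (q^ k) p) (trans (cong (_* eval1 p) (eval1-q^ k)) (*-identityˡ _))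
    where
    eval1-q^ : ∀ k → eval1 (q^ k) ≡ 1
    eval1-q^ zero    = refl
    eval1-q^ (suc k) = eval1-q^ k

  -- ballot k h = C(2k+h, k) − C(2k+h, k−1), the value of both qBallotₑ k h at q = 1.
  ballot : ℕ → ℕ → ℕ
  ballot zero    h       = 1
  ballot (suc k) zero    = ballot k 1
  ballot (suc k) (suc h) = ballot (suc k) h + ballot k (suc (suc h))

  eval1-qBallot₀ : ∀ k h → eval1 (qBallot₀ k h) ≡ ballot k h
  eval1-qBallot₁ : ∀ k h → eval1 (qBallot₁ k h) ≡ ballot k h
  eval1-qBallot₀ zero    h       = refl
  eval1-qBallot₀ (suc k) zero    = trans (eval1-q^⊗ (suc k) (qBallot₁ k 1)) (eval1-qBallot₁ k 1)
  eval1-qBallot₀ (suc k) (suc h) = trans (eval1-⊕ (qBallot₀ (suc k) h) _)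
    (cong₂ _+_ (eval1-qBallot₀ (suc k) h) (trans (eval1-q^⊗ (suc (suc (k + h))) (qBallot₁ k (suc (suc h)))) (eval1-qBallot₁ k (suc (suc h)))))
  eval1-qBallot₁ zero    h       = refl
  eval1-qBallot₁ (suc k) zero    = eval1-qBallot₁ k 1
  eval1-qBallot₁ (suc k) (suc h) = begin
    eval1 (qBallot₁ k (suc (suc h)) ⊕ (q^ suc k ⊗ qBallot₀ (suc k) h))
      ≡⟨ eval1-⊕ (qBallot₁ k (suc (suc h))) _ ⟩
    eval1 (qBallot₁ k (suc (suc h))) + eval1 (q^ suc k ⊗ qBallot₀ (suc k) h)
      ≡⟨ cong₂ _+_ (eval1-qBallot₁ k (suc (suc h))) (trans (eval1-q^⊗ (suc k) (qBallot₀ (suc k) h)) (eval1-qBallot₀ (suc k) h)) ⟩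
    ballot k (suc (suc h)) + ballot (suc k) h
      ≡⟨ +-comm (ballot k (suc (suc h))) _ ⟩
    ballot (suc k) (suc h)
      ∎
    where open ≡-Reasoning

  eval1-qCatalan : ∀ m → eval1 (qCatalan (suc m)) ≡ ballot m 1
  eval1-qCatalan m = eval1-qBallot₁ m 1

module EvalMinusOne where

  open import Defs
  open Polynomial
  open QBinomial
  open QCatalan
  open Parity
  open import Data.Integer using (ℤ; +_; -_; _+_; _*_; _-_)
  open import Data.Integer.Properties using (+-identityˡ; +-identityʳ; *-zeroʳ; *-identityˡ; pos-+; pos-*)
  open import Data.Integer.Tactic.RingSolver using (solve-∀)
  open import Data.List using ([]; _∷_)
  open import Data.Nat as ℕ using (ℕ; zero; suc)
  open import Data.Nat.Combinatorics using (_C_; nCk+nC[k+1]≡[n+1]C[k+1])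
  open import Data.Nat.Properties using (+-comm)
  open import Relation.Binary.PropositionalEquality

  private
    −-distrib : ∀ a b c d → (a + b) - (c + d) ≡ (a - c) + (b - d)
    −-distrib = solve-∀

  evalNeg1-⊕ : ∀ p q → evalNeg1 (p ⊕ q) ≡ evalNeg1 p + evalNeg1 q
  evalNeg1-⊕ []      q       = sym (+-identityˡ _)
  evalNeg1-⊕ (a ∷ p) []      = sym (+-identityʳ _)
  evalNeg1-⊕ (a ∷ p) (b ∷ q) = trans (cong₂ _-_ (pos-+ a b) (evalNeg1-⊕ p q)) (−-distrib (+ a) (+ b) (evalNeg1 p) (evalNeg1 q))

  evalNeg1-scale : ∀ a p → evalNeg1 (scale a p) ≡ + a * evalNeg1 p
  evalNeg1-scale a []      = sym (*-zeroʳ (+ a))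
  evalNeg1-scale a (b ∷ p) = trans (cong₂ _-_ (pos-* a b) (evalNeg1-scale a p)) (distrib (+ a) (+ b) (evalNeg1 p))
    where
    distrib : ∀ a b c → a * b - a * c ≡ a * (b - c)
    distrib = solve-∀

  evalNeg1-⊗ : ∀ p q → evalNeg1 (p ⊗ q) ≡ evalNeg1 p * evalNeg1 q
  evalNeg1-⊗ []      q = refl
  evalNeg1-⊗ (a ∷ p) q = begin
    evalNeg1 (scale a q ⊕ (0 ∷ (p ⊗ q)))                 ≡⟨ evalNeg1-⊕ (scale a q) (0 ∷ (p ⊗ q)) ⟩
    evalNeg1 (scale a q) + (+ 0 - evalNeg1 (p ⊗ q))      ≡⟨ cong₂ (λ x y → x + (+ 0 - y)) (evalNeg1-scale a q) (evalNeg1-⊗ p q) ⟩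
    + a * evalNeg1 q + (+ 0 - evalNeg1 p * evalNeg1 q)   ≡⟨ distrib (+ a) (evalNeg1 p) (evalNeg1 q) ⟩
    (+ a - evalNeg1 p) * evalNeg1 q                      ∎
    where
    open ≡-Reasoning
    distrib : ∀ a b c → a * c + (+ 0 - b * c) ≡ (a - b) * c
    distrib = solve-∀

  evalNeg1-zero : ∀ {p} → p ≋ [] → evalNeg1 p ≡ + 0
  evalNeg1-zero {[]}    _ = refl
  evalNeg1-zero {a ∷ p} e rewrite coeff-≡ e 0 | evalNeg1-zero (∷-zero-tail e) = refl

  evalNeg1-cong : ∀ {p q} → p ≋ q → evalNeg1 p ≡ evalNeg1 q
  evalNeg1-cong {[]}    {q}     e = sym (evalNeg1-zero (≋-sym e))
  evalNeg1-cong {a ∷ p} {[]}    e = evalNeg1-zero e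
  evalNeg1-cong {a ∷ p} {b ∷ q} e = cong₂ (λ x y → + x - y) (coeff-≡ e 0) (evalNeg1-cong (∷-tail e))

  evalNeg1-q^-double : ∀ l → evalNeg1 (q^ double l) ≡ + 1
  evalNeg1-q^-double zero    = refl
  evalNeg1-q^-double (suc l) = trans (neg-neg (evalNeg1 (q^ double l))) (evalNeg1-q^-double l)
    where
    neg-neg : ∀ x → + 0 - (+ 0 - x) ≡ x
    neg-neg = solve-∀

  evalNeg1-q^-suc-double : ∀ l → evalNeg1 (q^ suc (double l)) ≡ - + 1
  evalNeg1-q^-suc-double l = cong (λ x → + 0 - x) (evalNeg1-q^-double l)

  evalNeg1-qBinom-suc : ∀ m j → evalNeg1 (qBinom (suc m) (suc j))
                                ≡ evalNeg1 (qBinom m j) + evalNeg1 (q^ suc j) * evalNeg1 (qBinom m (suc j))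
  evalNeg1-qBinom-suc m j = trans (evalNeg1-⊕ (qBinom m j) _) (cong (_+_ (evalNeg1 (qBinom m j))) (evalNeg1-⊗ (q^ suc j) (qBinom m (suc j))))

  private
    x-x≡0 : ∀ x → x + - + 1 * x ≡ + 0
    x-x≡0 = solve-∀

    x-0≡x : ∀ x → x + - + 1 * + 0 ≡ x
    x-0≡x = solve-∀

    0+x≡x : ∀ x → + 0 + + 1 * x ≡ x
    0+x≡x = solve-∀

  evalNeg1-qBinom-even-even : ∀ i l → evalNeg1 (qBinom (double i) (double l)) ≡ + (i C l)
  evalNeg1-qBinom-even-odd : ∀ i l → evalNeg1 (qBinom (double i) (suc (double l))) ≡ + 0
  evalNeg1-qBinom-odd-even : ∀ i l → evalNeg1 (qBinom (suc (double i)) (double l)) ≡ + (i C l)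
  evalNeg1-qBinom-odd-odd : ∀ i l → evalNeg1 (qBinom (suc (double i)) (suc (double l))) ≡ + (i C l)

  evalNeg1-qBinom-even-even zero    zero    = refl
  evalNeg1-qBinom-even-even zero    (suc l) = refl
  evalNeg1-qBinom-even-even (suc i) zero    = refl
  evalNeg1-qBinom-even-even (suc i) (suc l) = begin
    evalNeg1 (qBinom (double (suc i)) (double (suc l)))
      ≡⟨ evalNeg1-qBinom-suc (suc (double i)) (suc (double l)) ⟩
    evalNeg1 (qBinom (suc (double i)) (suc (double l))) + evalNeg1 (q^ double (suc l)) * evalNeg1 (qBinom (suc (double i)) (double (suc l)))
      ≡⟨ cong₂ _+_ (evalNeg1-qBinom-odd-odd i l) (cong₂ _*_ (evalNeg1-q^-double (suc l)) (evalNeg1-qBinom-odd-even i (suc l))) ⟩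
    + (i C l) + + 1 * + (i C suc l)
      ≡⟨ cong (_+_ (+ (i C l))) (*-identityˡ (+ (i C suc l))) ⟩
    + (i C l) + + (i C suc l)
      ≡⟨ pos-+ (i C l) (i C suc l) ⟨
    + (i C l ℕ.+ i C suc l)
      ≡⟨ cong +_ (nCk+nC[k+1]≡[n+1]C[k+1] i l) ⟩
    + (suc i C suc l)
      ∎
    where open ≡-Reasoning

  evalNeg1-qBinom-even-odd zero    l = refl
  evalNeg1-qBinom-even-odd (suc i) l = begin
    evalNeg1 (qBinom (double (suc i)) (suc (double l)))
      ≡⟨ evalNeg1-qBinom-suc (suc (double i)) (double l) ⟩
    evalNeg1 (qBinom (suc (double i)) (double l)) + evalNeg1 (q^ suc (double l)) * evalNeg1 (qBinom (suc (double i)) (suc (double l)))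
      ≡⟨ cong₂ _+_ (evalNeg1-qBinom-odd-even i l) (cong₂ _*_ (evalNeg1-q^-suc-double l) (evalNeg1-qBinom-odd-odd i l)) ⟩
    + (i C l) + - + 1 * + (i C l)
      ≡⟨ x-x≡0 (+ (i C l)) ⟩
    + 0
      ∎
    where open ≡-Reasoning

  evalNeg1-qBinom-odd-even i zero    = refl
  evalNeg1-qBinom-odd-even i (suc l) = begin
    evalNeg1 (qBinom (suc (double i)) (double (suc l)))
      ≡⟨ evalNeg1-qBinom-suc (double i) (suc (double l)) ⟩
    evalNeg1 (qBinom (double i) (suc (double l))) + evalNeg1 (q^ double (suc l)) * evalNeg1 (qBinom (double i) (double (suc l)))
      ≡⟨ cong₂ _+_ (evalNeg1-qBinom-even-odd i l) (cong₂ _*_ (evalNeg1-q^-double (suc l)) (evalNeg1-qBinom-even-even i (suc l))) ⟩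
    + 0 + + 1 * + (i C suc l)
      ≡⟨ 0+x≡x (+ (i C suc l)) ⟩
    + (i C suc l)
      ∎
    where open ≡-Reasoning

  evalNeg1-qBinom-odd-odd i l = begin
    evalNeg1 (qBinom (suc (double i)) (suc (double l)))
      ≡⟨ evalNeg1-qBinom-suc (double i) (double l) ⟩
    evalNeg1 (qBinom (double i) (double l)) + evalNeg1 (q^ suc (double l)) * evalNeg1 (qBinom (double i) (suc (double l)))
      ≡⟨ cong₂ _+_ (evalNeg1-qBinom-even-even i l) (cong₂ _*_ (evalNeg1-q^-suc-double l) (evalNeg1-qBinom-even-odd i l)) ⟩
    + (i C l) + - + 1 * + 0
      ≡⟨ x-0≡x (+ (i C l)) ⟩
    + (i C l)
      ∎
    where open ≡-Reasoning

  evalNeg1-qCatalan-split : ∀ k → evalNeg1 (qCatalan (suc k))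
                                  ≡ evalNeg1 (qBinom (suc (double k)) k) + evalNeg1 (qBinom⁻ (suc (double k)) k)
  evalNeg1-qCatalan-split k = solve-for (evalNeg1 (qCatalan (suc k))) _ _
    (trans (cong (_+_ (evalNeg1 (qCatalan (suc k)))) (sym (evalNeg1-⊗ (q^ 1) (qBinom⁻ (suc (double k)) k))))
    (trans (sym (evalNeg1-⊕ (qCatalan (suc k)) _))
           (evalNeg1-cong (qBallot₁-spec k 1 (+-comm 1 (double k))))))
    where
    solve-for : ∀ a b c → a + - + 1 * b ≡ c → a ≡ c + b
    solve-for a b c refl = a≡a-b+b a b
      where
      a≡a-b+b : ∀ a b → a ≡ a + - + 1 * b + b
      a≡a-b+b = solve-∀

  evalNeg1-qCatalan : ∀ m → evalNeg1 (qCatalan (suc m)) ≡ + central (suc m)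
  evalNeg1-qCatalan m with evenOdd m
  ... | even i = begin
    evalNeg1 (qCatalan (suc (double i)))
      ≡⟨ evalNeg1-qCatalan-split (double i) ⟩
    evalNeg1 (qBinom (suc (double (double i))) (double i)) + evalNeg1 (qBinom⁻ (suc (double (double i))) (double i))
      ≡⟨ cong₂ _+_ (evalNeg1-qBinom-odd-even (double i) i) (lower i) ⟩
    + (double i C i) + lowerValue i
      ≡⟨ pascal i ⟩
    + (suc (double i) C i)
      ≡⟨ cong +_ (central-odd i) ⟨
    + central (suc (double i))
      ∎
    where
    open ≡-Reasoning
    lowerValue : ℕ → ℤ
    lowerValue zero    = + 0
    lowerValue (suc j) = + (double (suc j) C j)
    lower : ∀ i → evalNeg1 (qBinom⁻ (suc (double (double i))) (double i)) ≡ lowerValue i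
    lower zero    = refl
    lower (suc j) = evalNeg1-qBinom-odd-odd (double (suc j)) j
    pascal : ∀ i → + (double i C i) + lowerValue i ≡ + (suc (double i) C i)
    pascal zero    = refl
    pascal (suc j) = trans (sym (pos-+ (double (suc j) C suc j) (double (suc j) C j)))
      (cong +_ (trans (+-comm (double (suc j) C suc j) (double (suc j) C j)) (nCk+nC[k+1]≡[n+1]C[k+1] (double (suc j)) j)))
  ... | odd i = begin
    evalNeg1 (qCatalan (suc (suc (double i))))
      ≡⟨ evalNeg1-qCatalan-split (suc (double i)) ⟩
    evalNeg1 (qBinom (suc (double (suc (double i)))) (suc (double i))) + evalNeg1 (qBinom (suc (double (suc (double i)))) (double i))
      ≡⟨ cong₂ _+_ (evalNeg1-qBinom-odd-odd (suc (double i)) i) (evalNeg1-qBinom-odd-even (suc (double i)) i) ⟩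
    + (suc (double i) C i) + + (suc (double i) C i)
      ≡⟨ pos-+ (suc (double i) C i) (suc (double i) C i) ⟨
    + (suc (double i) C i ℕ.+ suc (double i) C i)
      ≡⟨ cong +_ (central-even i) ⟨
    + central (double (suc i))
      ∎
    where open ≡-Reasoning

module Counting where

  open import Data.Bool using (Bool; true; false)
  open import Data.List using (List; []; _∷_; map; concatMap; length; filter; _++_; cartesianProductWith)
  open import Data.List.Properties using (length-map)
  open import Data.List.Membership.Propositional using (_∈_)
  open import Data.List.Membership.Propositional.Properties using (∈-map⁺; ∈-map⁻; ∈-cartesianProductWith⁺)
  import Data.List.Relation.Unary.All as All
  import Data.List.Relation.Unary.All.Properties as All
  open import Data.List.Relation.Unary.Any using (here; there)
  open import Data.List.Relation.Unary.Unique.Propositional using (Unique; []; _∷_)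
  import Data.List.Relation.Unary.Unique.Propositional.Properties as Unique
  open import Data.Nat using (ℕ; zero; suc; _+_; _≤_; z≤n; s≤s)
  open import Data.Nat.Properties using (+-assoc; ≤-antisym)
  open import Data.Nat.ListAction using (sum)
  open import Data.Product using (Σ; _×_; _,_)
  open import Data.Vec using (Vec; []; _∷_)
  open import Data.Vec.Properties using (∷-injective)
  open import Function using (case_of_)
  open import Relation.Nullary using (contradiction)
  open import Relation.Nullary.Decidable using (T?)
  open import Relation.Binary.PropositionalEquality
  open import Defs using (vecs)

  private
    variable
      A B : Set

    remove : ∀ {x : A} {ys} → x ∈ ys → Σ (List A) λ ys′ → length ys ≡ suc (length ys′) × (∀ {y} → y ∈ ys → y ≢ x → y ∈ ys′)
    remove {ys = y ∷ ys} (here refl) = ys , refl , λ { (here refl) y≢y → contradiction refl y≢y ; (there p) _ → p }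
    remove {ys = y ∷ ys} (there x∈ys) with remove x∈ys
    ... | ys′ , len , keep = y ∷ ys′ , cong suc len , λ { (here refl) _ → here refl ; (there p) y≢x → there (keep p y≢x) }

  Unique-⊆⇒length≤ : ∀ {xs ys : List A} → Unique xs → (∀ {x} → x ∈ xs → x ∈ ys) → length xs ≤ length ys
  Unique-⊆⇒length≤ {xs = []}     _                 _   = z≤n
  Unique-⊆⇒length≤ {xs = x ∷ xs} (x∉xs ∷ unique-xs) xs⊆ys with remove (xs⊆ys (here refl))
  ... | ys′ , len , keep = subst (suc (length xs) ≤_) (sym len)
    (s≤s (Unique-⊆⇒length≤ unique-xs (λ p → keep (xs⊆ys (there p)) (λ y≡x → All.lookup x∉xs p (sym y≡x)))))

  map-unique : ∀ (f : A → B) {xs} → Unique xs → (∀ {x y} → x ∈ xs → y ∈ xs → f x ≡ f y → x ≡ y) → Unique (map f xs)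
  map-unique f []                 _   = []
  map-unique f (x∉xs ∷ unique-xs) inj =
    All.map⁺ (All.tabulate (λ y∈xs fx≡fy → All.lookup x∉xs y∈xs (inj (here refl) (there y∈xs) fx≡fy)))
    ∷ map-unique f unique-xs (λ p q → inj (there p) (there q))

  length-≤-by-injection : ∀ {xs : List A} {ys : List B} (f : A → B) → Unique xs →
    (∀ {x} → x ∈ xs → f x ∈ ys) → (∀ {x y} → x ∈ xs → y ∈ xs → f x ≡ f y → x ≡ y) →
    length xs ≤ length ys
  length-≤-by-injection {xs = xs} f unique-xs into inj = subst (_≤ _) (length-map f xs)
    (Unique-⊆⇒length≤ (map-unique f unique-xs inj) λ fx∈ → case ∈-map⁻ f fx∈ of λ where (x , x∈xs , refl) → into x∈xs)

  length-≡-by-bijection : ∀ {xs : List A} {ys : List B} (f : A → B) → Unique xs → Unique ys →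
    (∀ {x} → x ∈ xs → f x ∈ ys) →
    (∀ {x y} → x ∈ xs → y ∈ xs → f x ≡ f y → x ≡ y) →
    (∀ {y} → y ∈ ys → Σ A λ x → x ∈ xs × f x ≡ y) →
    length xs ≡ length ys
  length-≡-by-bijection {xs = xs} f unique-xs unique-ys into inj onto = ≤-antisym
    (length-≤-by-injection f unique-xs into inj)
    (subst (_ ≤_) (length-map f xs)
      (Unique-⊆⇒length≤ unique-ys λ y∈ys → case onto y∈ys of λ where (x , x∈xs , refl) → ∈-map⁺ f x∈xs))

  vecs-suc : ∀ (xs : List A) k → vecs xs (suc k) ≡ cartesianProductWith _∷_ xs (vecs xs k)
  vecs-suc xs k = concatMap-cons xs
    where
    concatMap-cons : ∀ ys → concatMap (λ y → map (y ∷_) (vecs xs k)) ys ≡ cartesianProductWith _∷_ ys (vecs xs k)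
    concatMap-cons []       = refl
    concatMap-cons (y ∷ ys) = cong (map (y ∷_) (vecs xs k) ++_) (concatMap-cons ys)

  vecs-unique : ∀ {xs : List A} k → Unique xs → Unique (vecs xs k)
  vecs-unique zero    _         = All.[] ∷ []
  vecs-unique {xs = xs} (suc k) unique-xs rewrite vecs-suc xs k =
    Unique.cartesianProductWith⁺ _∷_ ∷-injective unique-xs (vecs-unique k unique-xs)

  ∈-vecs : ∀ {xs : List A} → (∀ x → x ∈ xs) → ∀ {k} (v : Vec A k) → v ∈ vecs xs k
  ∈-vecs every []      = here refl
  ∈-vecs {xs = xs} every {suc k} (x ∷ v) rewrite vecs-suc xs k = ∈-cartesianProductWith⁺ _∷_ (every x) (∈-vecs every v)

  fromBool : Bool → ℕ
  fromBool true  = 1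
  fromBool false = 0

  countᵇ : (A → Bool) → List A → ℕ
  countᵇ p []       = 0
  countᵇ p (x ∷ xs) = fromBool (p x) + countᵇ p xs

  length-filter-T? : ∀ (p : A → Bool) xs → length (filter (λ x → T? (p x)) xs) ≡ countᵇ p xs
  length-filter-T? p []       = refl
  length-filter-T? p (x ∷ xs) with p x
  ... | true  = cong suc (length-filter-T? p xs)
  ... | false = length-filter-T? p xs

  countᵇ-++ : ∀ (p : A → Bool) xs ys → countᵇ p (xs ++ ys) ≡ countᵇ p xs + countᵇ p ys
  countᵇ-++ p []       ys = refl
  countᵇ-++ p (x ∷ xs) ys = trans (cong (fromBool (p x) +_) (countᵇ-++ p xs ys)) (sym (+-assoc (fromBool (p x)) _ _))

  countᵇ-map : ∀ (p : B → Bool) (f : A → B) xs → countᵇ p (map f xs) ≡ countᵇ (λ x → p (f x)) xs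
  countᵇ-map p f []       = refl
  countᵇ-map p f (x ∷ xs) = cong (fromBool (p (f x)) +_) (countᵇ-map p f xs)

  countᵇ-false : ∀ (xs : List A) → countᵇ (λ _ → false) xs ≡ 0
  countᵇ-false []       = refl
  countᵇ-false (x ∷ xs) = countᵇ-false xs

  countᵇ-by-head : ∀ {k} (p : Vec A (suc k) → Bool) xs (vs : List (Vec A k)) →
    countᵇ p (concatMap (λ x → map (x ∷_) vs) xs) ≡ sum (map (λ x → countᵇ (λ v → p (x ∷ v)) vs) xs)
  countᵇ-by-head p []       vs = refl
  countᵇ-by-head p (x ∷ xs) vs = trans (countᵇ-++ p (map (x ∷_) vs) _)
    (cong₂ _+_ (countᵇ-map p (x ∷_) vs) (countᵇ-by-head p xs vs))

module IntervalCount where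

  open Counting
  open import Data.Bool using (Bool; true; false; T)
  open import Data.Empty using (⊥; ⊥-elim)
  open import Data.List using (List; []; _∷_; filter)
  open import Data.List.Membership.Propositional using (_∈_)
  open import Data.List.Membership.Propositional.Properties using (∈-filter⁺; ∈-filter⁻)
  import Data.List.Relation.Unary.All as All
  open import Data.List.Relation.Unary.Any using (here; there)
  open import Data.List.Relation.Unary.Unique.Propositional using (Unique; []; _∷_)
  import Data.List.Relation.Unary.Unique.Propositional.Properties as Unique
  open import Data.Nat using (ℕ; zero; suc; _+_; _≤_; _<_; z≤n; s≤s; _≟_)
  open import Data.Nat.Properties
  open import Data.Nat.Tactic.RingSolver using (solve-∀)
  open import Data.Product using (Σ; _×_; _,_; proj₁)
  open import Data.Sum using (_⊎_; inj₁; inj₂)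
  open import Relation.Binary.PropositionalEquality
  open import Relation.Nullary using (yes; no; contradiction)
  open import Relation.Nullary.Decidable using (T?)

  interval : ℕ → ℕ → List ℕ
  interval a zero    = []
  interval a (suc l) = a ∷ interval (suc a) l

  countIn : (ℕ → Bool) → ℕ → ℕ → ℕ
  countIn p a l = countᵇ p (interval a l)

  private
    a<a+suc : ∀ a l → a < a + suc l
    a<a+suc a l = subst (a <_) (sym (+-suc a l)) (s≤s (m≤m+n a l))

    <-+suc : ∀ {a i} l → i < suc a + l → i < a + suc l
    <-+suc {a} {i} l = subst (i <_) (sym (+-suc a l))

    empty-interval : ∀ {a i} → a ≤ i → i < a + 0 → ⊥
    empty-interval {a} {i} a≤i i<a+0 = <-irrefl refl (≤-<-trans a≤i (subst (i <_) (+-identityʳ a) i<a+0))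

  ∈-interval⁻ : ∀ {i} a l → i ∈ interval a l → a ≤ i × i < a + l
  ∈-interval⁻ a (suc l) (here refl) = ≤-refl , a<a+suc a l
  ∈-interval⁻ a (suc l) (there i∈) with ∈-interval⁻ (suc a) l i∈
  ... | a<i , i<a+l = <⇒≤ a<i , <-+suc l i<a+l

  ∈-interval⁺ : ∀ {i} a l → a ≤ i → i < a + l → i ∈ interval a l
  ∈-interval⁺ a zero    a≤i i<a+l = ⊥-elim (empty-interval a≤i i<a+l)
  ∈-interval⁺ {i} a (suc l) a≤i i<a+l with a ≟ i
  ... | yes refl = here refl
  ... | no  a≢i  = there (∈-interval⁺ (suc a) l (≤∧≢⇒< a≤i a≢i) (subst (i <_) (+-suc a l) i<a+l))

  interval-unique : ∀ a l → Unique (interval a l)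
  interval-unique a zero    = []
  interval-unique a (suc l) = All.tabulate (λ {x} x∈ a≡x → <-irrefl a≡x (proj₁ (∈-interval⁻ (suc a) l x∈))) ∷ interval-unique (suc a) l

  countIn-≤-by-injection : ∀ (p q : ℕ → Bool) a l (f : ℕ → ℕ) →
    (∀ i → a ≤ i → i < a + l → T (p i) → a ≤ f i × f i < a + l × T (q (f i))) →
    (∀ i j → a ≤ i → i < a + l → T (p i) → a ≤ j → j < a + l → T (p j) → f i ≡ f j → i ≡ j) →
    countIn p a l ≤ countIn q a l
  countIn-≤-by-injection p q a l f into inj = subst₂ _≤_ (length-filter-T? p (interval a l)) (length-filter-T? q (interval a l))
    (length-≤-by-injection f (Unique.filter⁺ (λ x → T? (p x)) (interval-unique a l)) into′ inj′)
    where
    into′ : ∀ {i} → i ∈ filter (λ x → T? (p x)) (interval a l) → f i ∈ filter (λ x → T? (q x)) (interval a l)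
    into′ i∈ with ∈-filter⁻ (λ x → T? (p x)) i∈
    ... | i∈I , pi with ∈-interval⁻ a l i∈I
    ... | a≤i , i<a+l with into _ a≤i i<a+l pi
    ... | a≤fi , fi<a+l , qfi = ∈-filter⁺ (λ x → T? (q x)) (∈-interval⁺ a l a≤fi fi<a+l) qfi
    inj′ : ∀ {i j} → i ∈ filter (λ x → T? (p x)) (interval a l) → j ∈ filter (λ x → T? (p x)) (interval a l) → f i ≡ f j → i ≡ j
    inj′ i∈ j∈ with ∈-filter⁻ (λ x → T? (p x)) i∈ | ∈-filter⁻ (λ x → T? (p x)) j∈
    ... | i∈I , pi | j∈I , pj with ∈-interval⁻ a l i∈I | ∈-interval⁻ a l j∈I
    ... | a≤i , i<a+l | a≤j , j<a+l = inj _ _ a≤i i<a+l pi a≤j j<a+l pj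

  countIn-cong : ∀ (p q : ℕ → Bool) a l → (∀ i → a ≤ i → i < a + l → p i ≡ q i) → countIn p a l ≡ countIn q a l
  countIn-cong p q a zero    _  = refl
  countIn-cong p q a (suc l) eq = cong₂ _+_ (cong fromBool (eq a ≤-refl (a<a+suc a l)))
    (countIn-cong p q (suc a) l (λ i a<i i<a+l → eq i (<⇒≤ a<i) (<-+suc l i<a+l)))

  countIn-suc : ∀ p a l → countIn p a (suc l) ≡ countIn p a l + fromBool (p (a + l))
  countIn-suc p a zero    = trans (+-identityʳ _) (cong (λ i → fromBool (p i)) (sym (+-identityʳ a)))
  countIn-suc p a (suc l) = begin
    fromBool (p a) + countIn p (suc a) (suc l)                         ≡⟨ cong (fromBool (p a) +_) (countIn-suc p (suc a) l) ⟩
    fromBool (p a) + (countIn p (suc a) l + fromBool (p (suc a + l)))  ≡⟨ +-assoc (fromBool (p a)) _ _ ⟨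
    countIn p a (suc l) + fromBool (p (suc a + l))                     ≡⟨ cong (λ i → countIn p a (suc l) + fromBool (p i)) (sym (+-suc a l)) ⟩
    countIn p a (suc l) + fromBool (p (a + suc l))                     ∎
    where open ≡-Reasoning

  countIn-+ : ∀ p a l₁ l₂ → countIn p a (l₁ + l₂) ≡ countIn p a l₁ + countIn p (a + l₁) l₂
  countIn-+ p a zero     l₂ = cong (λ b → countIn p b l₂) (sym (+-identityʳ a))
  countIn-+ p a (suc l₁) l₂ = begin
    fromBool (p a) + countIn p (suc a) (l₁ + l₂)                               ≡⟨ cong (fromBool (p a) +_) (countIn-+ p (suc a) l₁ l₂) ⟩
    fromBool (p a) + (countIn p (suc a) l₁ + countIn p (suc a + l₁) l₂)       ≡⟨ +-assoc (fromBool (p a)) _ _ ⟨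
    countIn p a (suc l₁) + countIn p (suc a + l₁) l₂                           ≡⟨ cong (λ b → countIn p a (suc l₁) + countIn p b l₂) (sym (+-suc a l₁)) ⟩
    countIn p a (suc l₁) + countIn p (a + suc l₁) l₂                           ∎
    where open ≡-Reasoning

  countIn-shift : ∀ p a l → countIn p (suc a) l ≡ countIn (λ k → p (suc k)) a l
  countIn-shift p a zero    = refl
  countIn-shift p a (suc l) = cong (fromBool (p (suc a)) +_) (countIn-shift p (suc a) l)

  countIn-none : ∀ p a l → (∀ i → a ≤ i → i < a + l → p i ≡ false) → countIn p a l ≡ 0
  countIn-none p a zero    _    = refl
  countIn-none p a (suc l) none rewrite none a ≤-refl (a<a+suc a l) =
    countIn-none p (suc a) l (λ i a<i i<a+l → none i (<⇒≤ a<i) (<-+suc l i<a+l))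

  countIn≡0 : ∀ p a l → countIn p a l ≡ 0 → ∀ i → a ≤ i → i < a + l → p i ≡ false
  countIn≡0 p a zero    _ i a≤i i<a+l = ⊥-elim (empty-interval a≤i i<a+l)
  countIn≡0 p a (suc l) c≡0 i a≤i i<a+l with p a in pa | a ≟ i
  ... | true  | _        = contradiction c≡0 λ ()
  ... | false | yes refl = pa
  ... | false | no a≢i   = countIn≡0 p (suc a) l c≡0 i (≤∧≢⇒< a≤i a≢i) (subst (i <_) (+-suc a l) i<a+l)

  countIn≢0 : ∀ p a l → countIn p a l ≢ 0 → Σ ℕ λ i → a ≤ i × i < a + l × p i ≡ true
  countIn≢0 p a zero    c≢0 = ⊥-elim (c≢0 refl)
  countIn≢0 p a (suc l) c≢0 with p a in pa
  ... | true  = a , ≤-refl , a<a+suc a l , pa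
  ... | false with countIn≢0 p (suc a) l c≢0
  ... | i , a<i , i<a+l , pi = i , <⇒≤ a<i , <-+suc l i<a+l , pi

  first-true : (p : ℕ → Bool) → ∀ i → p i ≡ true → Σ ℕ λ c → p c ≡ true × c ≤ i × (∀ k → k < c → p k ≡ false)
  first-true p i pi = search i 0 (λ _ ()) refl
    where
    search : ∀ d a → (∀ k → k < a → p k ≡ false) → i ≡ a + d → Σ ℕ λ c → p c ≡ true × c ≤ i × (∀ k → k < c → p k ≡ false)
    search zero    a below i≡a+0 rewrite +-identityʳ a = a , subst (λ k → p k ≡ true) i≡a+0 pi , ≤-reflexive (sym i≡a+0) , below
    search (suc d) a below i≡a+d with p a in pa
    ... | true  = a , pa , subst (a ≤_) (sym i≡a+d) (m≤m+n a (suc d)) , below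
    ... | false = search d (suc a) below′ (trans i≡a+d (+-suc a d))
      where
      below′ : ∀ k → k < suc a → p k ≡ false
      below′ k k<1+a with k ≟ a
      ... | yes refl = pa
      ... | no  k≢a  = below k (≤∧≢⇒< (≤-pred k<1+a) k≢a)

  last-true-below : (p : ℕ → Bool) → ∀ c i → i < c → p i ≡ true →
    Σ ℕ λ j → j < c × p j ≡ true × (∀ k → j < k → k < c → p k ≡ false)
  last-true-below p c i i<c pi = search c ≤-refl (λ k c≤k k<c → ⊥-elim (<-irrefl refl (<-≤-trans k<c c≤k)))
    where
    search : ∀ d → d ≤ c → (∀ k → d ≤ k → k < c → p k ≡ false) → Σ ℕ λ j → j < c × p j ≡ true × (∀ k → j < k → k < c → p k ≡ false)
    search zero    _   above = contradiction (trans (sym pi) (above i z≤n i<c)) λ ()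
    search (suc d) d<c above with p d in pd
    ... | true  = d , d<c , pd , above
    ... | false = search d (<⇒≤ d<c) above′
      where
      above′ : ∀ k → d ≤ k → k < c → p k ≡ false
      above′ k d≤k k<c with d ≟ k
      ... | yes refl = pd
      ... | no  d≢k  = above k (≤∧≢⇒< d≤k d≢k) k<c

  module _ {A : Set} where

    update : (ℕ → A) → ℕ → A → ℕ → A
    update f q x k with k ≟ q
    ... | yes _ = x
    ... | no  _ = f k

    update-≡ : ∀ f q x → update f q x q ≡ x
    update-≡ f q x with q ≟ q
    ... | yes _   = refl
    ... | no  q≢q = ⊥-elim (q≢q refl)

    update-≢ : ∀ f q x k → k ≢ q → update f q x k ≡ f k
    update-≢ f q x k k≢q with k ≟ q
    ... | yes k≡q = ⊥-elim (k≢q k≡q)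
    ... | no  _   = refl

    countIn-update-same : ∀ (P : A → Bool) f q x a l → P (f q) ≡ P x →
      countIn (λ k → P (update f q x k)) a l ≡ countIn (λ k → P (f k)) a l
    countIn-update-same P f q x a l same = countIn-cong _ _ a l λ k _ _ → lemma k
      where
      lemma : ∀ k → P (update f q x k) ≡ P (f k)
      lemma k with k ≟ q
      ... | yes refl = sym same
      ... | no  _    = refl

    countIn-update-outside : ∀ (P : A → Bool) f q x a l → q < a ⊎ a + l ≤ q →
      countIn (λ k → P (update f q x k)) a l ≡ countIn (λ k → P (f k)) a l
    countIn-update-outside P f q x a l outside =
      countIn-cong _ _ a l λ i a≤i i<a+l → cong P (update-≢ f q x i λ { refl → excluded outside a≤i i<a+l })
      where
      excluded : q < a ⊎ a + l ≤ q → a ≤ q → q < a + l → ⊥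
      excluded (inj₁ q<a)   a≤q _     = <-irrefl refl (<-≤-trans q<a a≤q)
      excluded (inj₂ a+l≤q) _   q<a+l = <-irrefl refl (<-≤-trans q<a+l a+l≤q)

    countIn-update-inside : ∀ (P : A → Bool) f q x a l → a ≤ q → q < a + l →
      countIn (λ k → P (update f q x k)) a l + fromBool (P (f q)) ≡ countIn (λ k → P (f k)) a l + fromBool (P x)
    countIn-update-inside P f q x a zero    a≤q q<a+l = ⊥-elim (empty-interval a≤q q<a+l)
    countIn-update-inside P f q x a (suc l) a≤q q<a+l with a ≟ q
    ... | yes refl rewrite countIn-update-outside P f a x (suc a) l (inj₁ ≤-refl) =
      swap-ends (fromBool (P x)) (countIn (λ k → P (f k)) (suc a) l) (fromBool (P (f a)))
      where
      swap-ends : ∀ x r y → x + r + y ≡ y + r + x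
      swap-ends = solve-∀
    ... | no  a≢q = begin
      fromBool (P (f a)) + countIn (λ k → P (update f q x k)) (suc a) l + fromBool (P (f q))
        ≡⟨ +-assoc (fromBool (P (f a))) _ _ ⟩
      fromBool (P (f a)) + (countIn (λ k → P (update f q x k)) (suc a) l + fromBool (P (f q)))
        ≡⟨ cong (fromBool (P (f a)) +_) (countIn-update-inside P f q x (suc a) l (≤∧≢⇒< a≤q a≢q) (subst (q <_) (+-suc a l) q<a+l)) ⟩
      fromBool (P (f a)) + (countIn (λ k → P (f k)) (suc a) l + fromBool (P x))
        ≡⟨ +-assoc (fromBool (P (f a))) _ _ ⟨
      fromBool (P (f a)) + countIn (λ k → P (f k)) (suc a) l + fromBool (P x)
        ∎
      where open ≡-Reasoning

module Words where

  open Counting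
  open EvalOne using (ballot)
  open Parity
  open import Defs using (vecs)
  open import Data.Bool using (Bool; true; false)
  open import Data.List using (List; []; _∷_)
  open import Data.List.Membership.Propositional using (_∈_)
  open import Data.List.Relation.Unary.All using ([]; _∷_)
  open import Data.List.Relation.Unary.Any using (here; there)
  open import Data.List.Relation.Unary.Unique.Propositional using (Unique; []; _∷_)
  open import Data.Nat using (ℕ; zero; suc; _+_; _<_; s≤s; _≡ᵇ_)
  open import Data.Nat.Combinatorics using (_C_; nCk+nC[k+1]≡[n+1]C[k+1])
  open import Data.Nat.Properties using (+-suc; +-assoc; +-identityʳ; n<1+n; m<n⇒m<1+n)
  open import Data.Nat.Tactic.RingSolver using (solve-∀)
  open import Data.Vec using (Vec; []; _∷_)
  open import Relation.Binary.PropositionalEquality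

  data Letter : Set where
    blank ball opener closer : Letter

  letters : List Letter
  letters = blank ∷ ball ∷ opener ∷ closer ∷ []

  letters-unique : Unique letters
  letters-unique = ((λ ()) ∷ (λ ()) ∷ (λ ()) ∷ []) ∷ ((λ ()) ∷ (λ ()) ∷ []) ∷ ((λ ()) ∷ []) ∷ [] ∷ []

  ∈-letters : ∀ x → x ∈ letters
  ∈-letters blank  = here refl
  ∈-letters ball   = there (here refl)
  ∈-letters opener = there (there (here refl))
  ∈-letters closer = there (there (there (here refl)))

  -- Reading a word as a lattice path (opener up, closer down, blank and ball level) started at
  -- height d: isDyck d w says that the path never goes below 0 and ends at 0, isPrefixDyck d w
  -- only the former.
  isDyck : ∀ {m} → ℕ → Vec Letter m → Bool
  isDyck d       []             = d ≡ᵇ 0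
  isDyck d       (blank  ∷ w)   = isDyck d w
  isDyck d       (ball   ∷ w)   = isDyck d w
  isDyck d       (opener ∷ w)   = isDyck (suc d) w
  isDyck zero    (closer ∷ w)   = false
  isDyck (suc d) (closer ∷ w)   = isDyck d w

  isPrefixDyck : ∀ {m} → ℕ → Vec Letter m → Bool
  isPrefixDyck d       []             = true
  isPrefixDyck d       (blank  ∷ w)   = isPrefixDyck d w
  isPrefixDyck d       (ball   ∷ w)   = isPrefixDyck d w
  isPrefixDyck d       (opener ∷ w)   = isPrefixDyck (suc d) w
  isPrefixDyck zero    (closer ∷ w)   = false
  isPrefixDyck (suc d) (closer ∷ w)   = isPrefixDyck d w

  dyckCount : ℕ → ℕ → ℕ
  dyckCount zero    zero    = 1
  dyckCount zero    (suc d) = 0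
  dyckCount (suc m) zero    = dyckCount m 0 + (dyckCount m 0 + (dyckCount m 1 + 0))
  dyckCount (suc m) (suc d) = dyckCount m (suc d) + (dyckCount m (suc d) + (dyckCount m (suc (suc d)) + dyckCount m d))

  countᵇ-isDyck : ∀ m d → countᵇ (isDyck d) (vecs letters m) ≡ dyckCount m d
  countᵇ-isDyck zero    zero    = refl
  countᵇ-isDyck zero    (suc d) = refl
  countᵇ-isDyck (suc m) zero    = trans (countᵇ-by-head (isDyck 0) letters (vecs letters m))
    (cong₂ _+_ (countᵇ-isDyck m 0) (cong₂ _+_ (countᵇ-isDyck m 0)
      (cong₂ _+_ (countᵇ-isDyck m 1) (trans (+-identityʳ _) (countᵇ-false (vecs letters m))))))
  countᵇ-isDyck (suc m) (suc d) = trans (countᵇ-by-head (isDyck (suc d)) letters (vecs letters m))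
    (cong₂ _+_ (countᵇ-isDyck m (suc d)) (cong₂ _+_ (countᵇ-isDyck m (suc d))
      (cong₂ _+_ (countᵇ-isDyck m (suc (suc d))) (trans (+-identityʳ _) (countᵇ-isDyck m d)))))

  dyckCount-short : ∀ m d → m < d → dyckCount m d ≡ 0
  dyckCount-short zero    (suc d) _         = refl
  dyckCount-short (suc m) (suc d) (s≤s m<d) =
    cong₂ _+_ short (cong₂ _+_ short (cong₂ _+_ (dyckCount-short m (suc (suc d)) (m<n⇒m<1+n (m<n⇒m<1+n m<d))) (dyckCount-short m d m<d)))
    where
    short = dyckCount-short m (suc d) (m<n⇒m<1+n m<d)

  dyckCount-ballot : ∀ u d → dyckCount (u + d) d ≡ ballot u (suc (double d))
  dyckCount-ballot zero zero = refl
  dyckCount-ballot zero (suc d) =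
    cong₂ _+_ short (cong₂ _+_ short (cong₂ _+_ (dyckCount-short d (suc (suc d)) (m<n⇒m<1+n (n<1+n d))) (dyckCount-ballot zero d)))
    where
    short = dyckCount-short d (suc d) (n<1+n d)
  dyckCount-ballot (suc zero) zero = refl
  dyckCount-ballot (suc (suc u)) zero = trans
    (cong₂ (λ a x → a + (a + (x + 0))) (dyckCount-ballot (suc u) zero) (trans (cong (λ n → dyckCount n 1) (sym (+-suc u 0))) (dyckCount-ballot u 1)))
    (cong (λ z → a + (a + z)) (+-identityʳ _))
    where
    a = ballot (suc u) 1
  dyckCount-ballot (suc zero) (suc d) = trans
    (cong₂ (λ a z → a + (a + z)) (dyckCount-ballot zero (suc d))
      (cong₂ _+_ (dyckCount-short (suc d) (suc (suc d)) (n<1+n (suc d))) (dyckCount-ballot 1 d)))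
    (rearrange (ballot 1 (suc (double d))))
    where
    rearrange : ∀ y → 1 + (1 + (0 + y)) ≡ (y + 1) + 1
    rearrange = solve-∀
  dyckCount-ballot (suc (suc u)) (suc d) = trans
    (cong₂ (λ a z → a + (a + z)) (dyckCount-ballot (suc u) (suc d)) (cong₂ _+_
      (trans (cong (λ n → dyckCount n (suc (suc d))) (sym (+-suc u (suc d)))) (dyckCount-ballot u (suc (suc d))))
      (trans (cong (λ n → dyckCount (suc n) d) (+-suc u d)) (dyckCount-ballot (suc (suc u)) d))))
    (rearrange a (ballot u (suc (double (suc (suc d))))) (ballot (suc (suc u)) (suc (double d))))
    where
    a = ballot (suc u) (suc (double (suc d)))
    rearrange : ∀ a x y → a + (a + (x + y)) ≡ (y + a) + (a + x)
    rearrange = solve-∀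

  countᵇ-isDyck-ballot : ∀ m → countᵇ (isDyck 0) (vecs letters m) ≡ ballot m 1
  countᵇ-isDyck-ballot m = trans (countᵇ-isDyck m 0) (trans (cong (λ n → dyckCount n 0) (sym (+-identityʳ m))) (dyckCount-ballot m 0))

  prefixCount : ℕ → ℕ → ℕ
  prefixCount zero    d       = 1
  prefixCount (suc m) zero    = prefixCount m 0 + (prefixCount m 0 + (prefixCount m 1 + 0))
  prefixCount (suc m) (suc d) = prefixCount m (suc d) + (prefixCount m (suc d) + (prefixCount m (suc (suc d)) + prefixCount m d))

  countᵇ-isPrefixDyck : ∀ m d → countᵇ (isPrefixDyck d) (vecs letters m) ≡ prefixCount m d
  countᵇ-isPrefixDyck zero    d       = refl
  countᵇ-isPrefixDyck (suc m) zero    = trans (countᵇ-by-head (isPrefixDyck 0) letters (vecs letters m))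
    (cong₂ _+_ (countᵇ-isPrefixDyck m 0) (cong₂ _+_ (countᵇ-isPrefixDyck m 0)
      (cong₂ _+_ (countᵇ-isPrefixDyck m 1) (trans (+-identityʳ _) (countᵇ-false (vecs letters m))))))
  countᵇ-isPrefixDyck (suc m) (suc d) = trans (countᵇ-by-head (isPrefixDyck (suc d)) letters (vecs letters m))
    (cong₂ _+_ (countᵇ-isPrefixDyck m (suc d)) (cong₂ _+_ (countᵇ-isPrefixDyck m (suc d))
      (cong₂ _+_ (countᵇ-isPrefixDyck m (suc (suc d))) (trans (+-identityʳ _) (countᵇ-isPrefixDyck m d)))))

  pascal² : ∀ n k → suc (suc n) C suc (suc k) ≡ n C k + (n C suc k + (n C suc k + n C suc (suc k)))
  pascal² n k = begin
    suc (suc n) C suc (suc k)                                     ≡⟨ nCk+nC[k+1]≡[n+1]C[k+1] (suc n) (suc k) ⟨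
    suc n C suc k + suc n C suc (suc k)                           ≡⟨ cong₂ _+_ (nCk+nC[k+1]≡[n+1]C[k+1] n k) (nCk+nC[k+1]≡[n+1]C[k+1] n (suc k)) ⟨
    (n C k + n C suc k) + (n C suc k + n C suc (suc k))           ≡⟨ +-assoc (n C k) _ _ ⟩
    n C k + (n C suc k + (n C suc k + n C suc (suc k)))           ∎
    where open ≡-Reasoning

  -- The number of prefixes of Dyck words of length m starting at height d is
  -- binomTail m d = Σ_{s ≤ d} C(2m+1, m+1+s).
  tailTerm : ℕ → ℕ → ℕ
  tailTerm m s = suc (double m) C (suc m + s)

  binomTail : ℕ → ℕ → ℕ
  binomTail m zero    = tailTerm m 0
  binomTail m (suc d) = binomTail m d + tailTerm m (suc d)

  binomTail⁻ : ℕ → ℕ → ℕ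
  binomTail⁻ m zero    = 0
  binomTail⁻ m (suc d) = binomTail m d

  binomTail-zero : ∀ d → binomTail 0 d ≡ 1
  binomTail-zero zero    = refl
  binomTail-zero (suc d) = trans (+-identityʳ _) (binomTail-zero d)

  tailTerm-suc : ∀ m s → tailTerm (suc m) s ≡ suc (double m) C (m + s) + (tailTerm m s + (tailTerm m s + tailTerm m (suc s)))
  tailTerm-suc m s = trans (pascal² (suc (double m)) (m + s))
    (cong (λ t → suc (double m) C (m + s) + (tailTerm m s + (tailTerm m s + suc (double m) C suc t))) (sym (+-suc m s)))

  tailTerm-below-zero : ∀ m → suc (double m) C (m + 0) ≡ tailTerm m 0
  tailTerm-below-zero m = trans (cong (suc (double m) C_) (+-identityʳ m))
    (trans (sym (C-middle-sym m)) (cong (λ t → suc (double m) C suc t) (sym (+-identityʳ m))))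

  tailTerm-below-suc : ∀ m s → suc (double m) C (m + suc s) ≡ tailTerm m s
  tailTerm-below-suc m s = cong (suc (double m) C_) (+-suc m s)

  binomTail-step : ∀ m d → binomTail m d ≡ binomTail⁻ m d + tailTerm m d
  binomTail-step m zero    = refl
  binomTail-step m (suc d) = refl

  binomTail-suc : ∀ m d → binomTail (suc m) d ≡ binomTail m d + (binomTail m d + (binomTail m (suc d) + binomTail⁻ m d))
  binomTail-suc m zero = begin
    tailTerm (suc m) 0
      ≡⟨ tailTerm-suc m 0 ⟩
    suc (double m) C (m + 0) + (t₀ + (t₀ + t₁))
      ≡⟨ cong (_+ (t₀ + (t₀ + t₁))) (tailTerm-below-zero m) ⟩
    t₀ + (t₀ + (t₀ + t₁))
      ≡⟨ rearrange t₀ t₁ ⟩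
    t₀ + (t₀ + ((t₀ + t₁) + 0))
      ∎
    where
    open ≡-Reasoning
    t₀ = tailTerm m 0
    t₁ = tailTerm m 1
    rearrange : ∀ a b → a + (a + (a + b)) ≡ a + (a + ((a + b) + 0))
    rearrange = solve-∀
  binomTail-suc m (suc d) = begin
    binomTail (suc m) d + tailTerm (suc m) (suc d)
      ≡⟨ cong₂ _+_ (binomTail-suc m d) (tailTerm-suc m (suc d)) ⟩
    (T + (T + (T₁ + T⁻))) + (suc (double m) C (m + suc d) + (t₁ + (t₁ + t₂)))
      ≡⟨ cong₂ (λ x y → (x + (x + (T₁ + T⁻))) + (y + (t₁ + (t₁ + t₂)))) (binomTail-step m d) (tailTerm-below-suc m d) ⟩
    ((T⁻ + t) + ((T⁻ + t) + (T₁ + T⁻))) + (t + (t₁ + (t₁ + t₂)))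
      ≡⟨ rearrange T⁻ t T₁ t₁ t₂ ⟩
    ((T⁻ + t) + t₁) + (((T⁻ + t) + t₁) + ((T₁ + t₂) + (T⁻ + t)))
      ≡⟨ cong (λ x → (x + t₁) + ((x + t₁) + ((T₁ + t₂) + x))) (binomTail-step m d) ⟨
    (T + t₁) + ((T + t₁) + ((T₁ + t₂) + T))
      ∎
    where
    open ≡-Reasoning
    T = binomTail m d
    T₁ = binomTail m (suc d)
    T⁻ = binomTail⁻ m d
    t = tailTerm m d
    t₁ = tailTerm m (suc d)
    t₂ = tailTerm m (suc (suc d))
    rearrange : ∀ T⁻ t T₁ t₁ t₂ → ((T⁻ + t) + ((T⁻ + t) + (T₁ + T⁻))) + (t + (t₁ + (t₁ + t₂)))
                                 ≡ ((T⁻ + t) + t₁) + (((T⁻ + t) + t₁) + ((T₁ + t₂) + (T⁻ + t)))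
    rearrange = solve-∀

  prefixCount-binomTail : ∀ m d → prefixCount m d ≡ binomTail m d
  prefixCount-binomTail zero    d       = sym (binomTail-zero d)
  prefixCount-binomTail (suc m) zero    = trans
    (cong₂ (λ x y → x + (x + (y + 0))) (prefixCount-binomTail m 0) (prefixCount-binomTail m 1))
    (sym (binomTail-suc m 0))
  prefixCount-binomTail (suc m) (suc d) = trans
    (cong₂ (λ x y → x + (x + y)) (prefixCount-binomTail m (suc d))
      (cong₂ _+_ (prefixCount-binomTail m (suc (suc d))) (prefixCount-binomTail m d)))
    (sym (binomTail-suc m (suc d)))

  countᵇ-isPrefixDyck-binomial : ∀ m → countᵇ (isPrefixDyck 0) (vecs letters m) ≡ suc (double m) C suc m
  countᵇ-isPrefixDyck-binomial m = trans (countᵇ-isPrefixDyck m 0)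
    (trans (prefixCount-binomTail m 0) (cong (λ t → suc (double m) C suc t) (+-identityʳ m)))

module Pairing where

  open Counting using (fromBool)
  open IntervalCount
  open Words using (Letter; blank; ball; opener; closer)
  open import Data.Bool using (Bool; true; false; T)
  open import Data.Empty using (⊥; ⊥-elim)
  open import Data.Maybe using (Maybe; just; nothing)
  open import Data.Maybe.Properties using (just-injective)
  open import Data.Nat using (ℕ; zero; suc; _+_; _≤_; _<_; z≤n; s≤s; _≟_; _<?_; _≤?_)
  open import Data.Nat.Properties
  open import Data.Product using (Σ; _×_; _,_; proj₁; proj₂)
  open import Data.Sum using (_⊎_; inj₁; inj₂)
  open import Data.Unit using (tt)
  open import Function using (case_of_)
  open import Relation.Binary.Definitions using (tri<; tri≈; tri>)
  open import Relation.Binary.PropositionalEquality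
  open import Relation.Nullary using (¬_; Dec; yes; no; contradiction)

  isOpener : Letter → Bool
  isOpener opener = true
  isOpener _      = false

  isCloser : Letter → Bool
  isCloser closer = true
  isCloser _      = false

  T-isOpener : ∀ x → T (isOpener x) → x ≡ opener
  T-isOpener opener _ = refl

  T-isCloser : ∀ x → T (isCloser x) → x ≡ closer
  T-isCloser closer _ = refl

  #openers : (ℕ → Letter) → ℕ → ℕ → ℕ
  #openers w = countIn (λ k → isOpener (w k))

  #closers : (ℕ → Letter) → ℕ → ℕ → ℕ
  #closers w = countIn (λ k → isCloser (w k))

  PrefixBalanced : ℕ → (ℕ → Letter) → ℕ → ℕ → Set
  PrefixBalanced d w a l = ∀ t → t ≤ l → #closers w a t ≤ d + #openers w a t

  Balanced : ℕ → (ℕ → Letter) → ℕ → ℕ → Set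
  Balanced d w a l = PrefixBalanced d w a l × #closers w a l ≡ d + #openers w a l

  module _ {w w′ : ℕ → Letter} (a l : ℕ) (agree : ∀ i → a ≤ i → i < a + l → w i ≡ w′ i) where

    private
      agree-≤ : ∀ t → t ≤ l → ∀ i → a ≤ i → i < a + t → w i ≡ w′ i
      agree-≤ t t≤l i a≤i i<a+t = agree i a≤i (<-≤-trans i<a+t (+-monoʳ-≤ a t≤l))

      #closers-≡ : ∀ t → t ≤ l → #closers w a t ≡ #closers w′ a t
      #closers-≡ t t≤l = countIn-cong _ _ a t λ i a≤i i<a+t → cong isCloser (agree-≤ t t≤l i a≤i i<a+t)

      #openers-≡ : ∀ t → t ≤ l → #openers w a t ≡ #openers w′ a t
      #openers-≡ t t≤l = countIn-cong _ _ a t λ i a≤i i<a+t → cong isOpener (agree-≤ t t≤l i a≤i i<a+t)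

    PrefixBalanced-cong : ∀ {d} → PrefixBalanced d w a l → PrefixBalanced d w′ a l
    PrefixBalanced-cong {d} prefix t t≤l = subst₂ _≤_ (#closers-≡ t t≤l) (cong (d +_) (#openers-≡ t t≤l)) (prefix t t≤l)

    Balanced-cong : ∀ {d} → Balanced d w a l → Balanced d w′ a l
    Balanced-cong {d} (prefix , total) =
      PrefixBalanced-cong prefix , trans (sym (#closers-≡ l ≤-refl)) (trans total (cong (d +_) (#openers-≡ l ≤-refl)))

  -- A configuration as the partial map sending each point to its partner (a ball is its own partner).
  Pairing : Set
  Pairing = ℕ → Maybe ℕ

  Symmetric : Pairing → Set
  Symmetric g = ∀ i j → g i ≡ just j → g j ≡ just i

  Bounded : ℕ → Pairing → Set
  Bounded m g = ∀ i j → g i ≡ just j → i < m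

  NoCrossing : Pairing → Set
  NoCrossing g = ∀ i₁ i₂ j₁ j₂ → i₁ < i₂ → i₂ < j₁ → j₁ < j₂ → g i₁ ≡ just j₁ → g i₂ ≡ just j₂ → ⊥

  letterOf : ℕ → Maybe ℕ → Letter
  letterOf i nothing = blank
  letterOf i (just j) with <-cmp i j
  ... | tri< _ _ _ = opener
  ... | tri≈ _ _ _ = ball
  ... | tri> _ _ _ = closer

  wordOf : Pairing → ℕ → Letter
  wordOf g i = letterOf i (g i)

  letterOf-opener : ∀ {i j} → i < j → letterOf i (just j) ≡ opener
  letterOf-opener {i} {j} i<j with <-cmp i j
  ... | tri< _ _ _   = refl
  ... | tri≈ _ i≡j _ = ⊥-elim (<-irrefl i≡j i<j)
  ... | tri> _ _ j<i = ⊥-elim (<-asym i<j j<i)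

  letterOf-closer : ∀ {i j} → j < i → letterOf i (just j) ≡ closer
  letterOf-closer {i} {j} j<i with <-cmp i j
  ... | tri< i<j _ _ = ⊥-elim (<-asym j<i i<j)
  ... | tri≈ _ i≡j _ = ⊥-elim (<-irrefl (sym i≡j) j<i)
  ... | tri> _ _ _   = refl

  letterOf-ball : ∀ i → letterOf i (just i) ≡ ball
  letterOf-ball i with <-cmp i i
  ... | tri< i<i _ _ = ⊥-elim (<-irrefl refl i<i)
  ... | tri≈ _ _ _   = refl
  ... | tri> _ _ i<i = ⊥-elim (<-irrefl refl i<i)

  letterOf-opener⁻ : ∀ i x → letterOf i x ≡ opener → Σ ℕ λ j → x ≡ just j × i < j
  letterOf-opener⁻ i (just j) e with <-cmp i j
  letterOf-opener⁻ i (just j) e  | tri< i<j _ _ = j , refl , i<j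
  letterOf-opener⁻ i (just j) () | tri≈ _ _ _
  letterOf-opener⁻ i (just j) () | tri> _ _ _

  letterOf-closer⁻ : ∀ i x → letterOf i x ≡ closer → Σ ℕ λ j → x ≡ just j × j < i
  letterOf-closer⁻ i (just j) e with <-cmp i j
  letterOf-closer⁻ i (just j) () | tri< _ _ _
  letterOf-closer⁻ i (just j) () | tri≈ _ _ _
  letterOf-closer⁻ i (just j) e  | tri> _ _ j<i = j , refl , j<i

  letterOf-ball⁻ : ∀ i x → letterOf i x ≡ ball → x ≡ just i
  letterOf-ball⁻ i (just j) e with <-cmp i j
  letterOf-ball⁻ i (just j) () | tri< _ _ _
  letterOf-ball⁻ i (just j) e  | tri≈ _ refl _ = refl
  letterOf-ball⁻ i (just j) () | tri> _ _ _

  letterOf-blank⁻ : ∀ i x → letterOf i x ≡ blank → x ≡ nothing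
  letterOf-blank⁻ i nothing  _ = refl
  letterOf-blank⁻ i (just j) e with <-cmp i j
  letterOf-blank⁻ i (just j) () | tri< _ _ _
  letterOf-blank⁻ i (just j) () | tri≈ _ _ _
  letterOf-blank⁻ i (just j) () | tri> _ _ _

  partner : Pairing → ℕ → ℕ
  partner g k with g k
  ... | just j  = j
  ... | nothing = k

  partner-just : ∀ g k j → g k ≡ just j → partner g k ≡ j
  partner-just g k j gk≡j with g k
  partner-just g k j refl | just .j = refl

  Closed : Pairing → ℕ → ℕ → Set
  Closed g a l = ∀ i j → a ≤ i → i < a + l → g i ≡ just j → a ≤ j × j < a + l

  partner-injective : ∀ g → Symmetric g → ∀ {i i′ j j′} → g i ≡ just j → g i′ ≡ just j′ → partner g i ≡ partner g i′ → i ≡ i′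
  partner-injective g sym-g {i} {i′} {j} {j′} gi gi′ same rewrite partner-just g i j gi | partner-just g i′ j′ gi′ =
    just-injective (trans (sym (sym-g i j gi)) (trans (cong g same) (sym-g i′ j′ gi′)))

  -- Every closer in a prefix of a closed segment is matched with an earlier opener.
  closed⇒prefixBalanced : ∀ g a l → Symmetric g → Closed g a l → PrefixBalanced 0 (wordOf g) a l
  closed⇒prefixBalanced g a l sym-g closed t t≤l = countIn-≤-by-injection _ _ a t (partner g) into inj
    where
    into : ∀ i → a ≤ i → i < a + t → T (isCloser (wordOf g i)) →
           a ≤ partner g i × partner g i < a + t × T (isOpener (wordOf g (partner g i)))
    into i a≤i i<a+t closerᵢ with letterOf-closer⁻ i (g i) (T-isCloser _ closerᵢ)
    ... | j , gi , j<i rewrite partner-just g i j gi =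
      proj₁ (closed i j a≤i (<-≤-trans i<a+t (+-monoʳ-≤ a t≤l)) gi) , <-trans j<i i<a+t ,
      subst (λ x → T (isOpener x)) (sym (trans (cong (letterOf j) (sym-g i j gi)) (letterOf-opener j<i))) tt
    inj : ∀ i i′ → a ≤ i → i < a + t → T (isCloser (wordOf g i)) → a ≤ i′ → i′ < a + t → T (isCloser (wordOf g i′)) →
          partner g i ≡ partner g i′ → i ≡ i′
    inj i i′ _ _ closerᵢ _ _ closerᵢ′ with letterOf-closer⁻ i (g i) (T-isCloser _ closerᵢ) | letterOf-closer⁻ i′ (g i′) (T-isCloser _ closerᵢ′)
    ... | _ , gi , _ | _ , gi′ , _ = partner-injective g sym-g gi gi′

  closed⇒openers≤closers : ∀ g a l → Symmetric g → Closed g a l → #openers (wordOf g) a l ≤ #closers (wordOf g) a l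
  closed⇒openers≤closers g a l sym-g closed = countIn-≤-by-injection _ _ a l (partner g) into inj
    where
    into : ∀ i → a ≤ i → i < a + l → T (isOpener (wordOf g i)) →
           a ≤ partner g i × partner g i < a + l × T (isCloser (wordOf g (partner g i)))
    into i a≤i i<a+l openerᵢ with letterOf-opener⁻ i (g i) (T-isOpener _ openerᵢ)
    ... | j , gi , i<j rewrite partner-just g i j gi =
      ≤-trans a≤i (<⇒≤ i<j) , proj₂ (closed i j a≤i i<a+l gi) ,
      subst (λ x → T (isCloser x)) (sym (trans (cong (letterOf j) (sym-g i j gi)) (letterOf-closer i<j))) tt
    inj : ∀ i i′ → a ≤ i → i < a + l → T (isOpener (wordOf g i)) → a ≤ i′ → i′ < a + l → T (isOpener (wordOf g i′)) →
          partner g i ≡ partner g i′ → i ≡ i′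
    inj i i′ _ _ openerᵢ _ _ openerᵢ′ with letterOf-opener⁻ i (g i) (T-isOpener _ openerᵢ) | letterOf-opener⁻ i′ (g i′) (T-isOpener _ openerᵢ′)
    ... | _ , gi , _ | _ , gi′ , _ = partner-injective g sym-g gi gi′

  closed⇒balanced : ∀ g a l → Symmetric g → Closed g a l → Balanced 0 (wordOf g) a l
  closed⇒balanced g a l sym-g closed = prefix , ≤-antisym (prefix l ≤-refl) (closed⇒openers≤closers g a l sym-g closed)
    where prefix = closed⇒prefixBalanced g a l sym-g closed

  wordOf-balanced : ∀ m g → Symmetric g → Bounded m g → Balanced 0 (wordOf g) 0 m
  wordOf-balanced m g sym-g bounded = closed⇒balanced g 0 m sym-g λ i j _ _ gi → z≤n , bounded j i (sym-g i j gi)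

  arc-interior-closed : ∀ g p l → Symmetric g → NoCrossing g → g p ≡ just (suc p + l) → Closed g (suc p) l
  arc-interior-closed g p l sym-g nc gp i j p<i i<q gi with <-cmp j p
  ... | tri< j<p _ _   = ⊥-elim (nc j p i (suc p + l) j<p p<i i<q (sym-g i j gi) gp)
  ... | tri≈ _ refl _  = ⊥-elim (<-irrefl (sym (just-injective (trans (sym gp) (sym-g i j gi)))) i<q)
  ... | tri> _ _ p<j with <-cmp j (suc p + l)
  ...   | tri< j<q _ _  = p<j , j<q
  ...   | tri≈ _ refl _ = ⊥-elim (<-irrefl (just-injective (trans (sym (sym-g p j gp)) (sym-g i j gi))) p<i)
  ...   | tri> _ _ q<j  = ⊥-elim (nc p i (suc p + l) j p<i i<q q<j gp gi)

  SameWord : ℕ → Pairing → Pairing → Set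
  SameWord m g g′ = ∀ i → i < m → wordOf g i ≡ wordOf g′ i

  -- If the arc from p were shorter in g than in g′, the closer ending it in g would make the
  -- interior of the g′-arc unbalanced.
  arc-not-shorter : ∀ m g g′ p l l′ → Symmetric g → NoCrossing g → Symmetric g′ → NoCrossing g′ → Bounded m g′ →
    SameWord m g g′ → g p ≡ just (suc p + l) → g′ p ≡ just (suc p + l′) → l < l′ → ⊥
  arc-not-shorter m g g′ p l l′ sym-g nc sym-g′ nc′ bounded′ same gp gp′ l<l′ =
    1+n≰n (+-cancelˡ-≤ (#closers w a l) 1 0 (subst₂ _≤_ closers-g closers≤openers (prefix′ (suc l) l<l′)))
    where
    a = suc p
    w = wordOf g
    w′ = wordOf g′
    balanced = closed⇒balanced g a l sym-g (arc-interior-closed g p l sym-g nc gp)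
    prefix′ = proj₁ (closed⇒balanced g′ a l′ sym-g′ (arc-interior-closed g′ p l′ sym-g′ nc′ gp′))
    agree : ∀ i → a ≤ i → i < a + suc l → w′ i ≡ w i
    agree i _ i<a+1+l = sym (same i (<-trans (<-≤-trans i<a+1+l (+-monoʳ-≤ a l<l′)) (bounded′ _ p (sym-g′ p _ gp′))))
    end : w (a + l) ≡ closer
    end = trans (cong (letterOf (a + l)) (sym-g p _ gp)) (letterOf-closer (s≤s (m≤m+n p l)))
    closers-g : #closers w′ a (suc l) ≡ #closers w a l + 1
    closers-g = trans (countIn-cong _ _ a (suc l) λ i a≤i i< → cong isCloser (agree i a≤i i<))
                      (trans (countIn-suc _ a l) (cong (λ x → #closers w a l + fromBool (isCloser x)) end))
    closers≤openers : #openers w′ a (suc l) ≡ #closers w a l + 0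
    closers≤openers = trans (countIn-cong _ _ a (suc l) λ i a≤i i< → cong isOpener (agree i a≤i i<))
                      (trans (countIn-suc _ a l) (cong₂ (λ n x → n + fromBool (isOpener x)) (sym (proj₂ balanced)) end))

  same-arc : ∀ m g g′ p j → Symmetric g → NoCrossing g → Bounded m g → Symmetric g′ → NoCrossing g′ → Bounded m g′ →
    SameWord m g g′ → g p ≡ just j → p < j → g′ p ≡ just j
  same-arc m g g′ p j sym-g nc bounded sym-g′ nc′ bounded′ same gp p<j
    with letterOf-opener⁻ p (g′ p) (trans (sym (same p (bounded p j gp))) (trans (cong (letterOf p) gp) (letterOf-opener p<j)))
  ... | j′ , gp′ , p<j′ with m≤n⇒∃[o]m+o≡n p<j | m≤n⇒∃[o]m+o≡n p<j′
  ... | l , refl | l′ , refl with <-cmp l l′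
  ... | tri< l<l′ _ _ = ⊥-elim (arc-not-shorter m g g′ p _ _ sym-g nc sym-g′ nc′ bounded′ same gp gp′ l<l′)
  ... | tri≈ _ refl _ = gp′
  ... | tri> _ _ l′<l = ⊥-elim (arc-not-shorter m g′ g p _ _ sym-g′ nc′ sym-g nc bounded (λ i i<m → sym (same i i<m)) gp′ gp l′<l)

  bounded-nothing : ∀ m g → Bounded m g → ∀ i → ¬ i < m → g i ≡ nothing
  bounded-nothing m g bounded i i≮m with g i in gi
  ... | nothing = refl
  ... | just j  = ⊥-elim (i≮m (bounded i j gi))

  wordOf-injective : ∀ m g g′ → Symmetric g → NoCrossing g → Bounded m g → Symmetric g′ → NoCrossing g′ → Bounded m g′ →
    SameWord m g g′ → ∀ i → g i ≡ g′ i
  wordOf-injective m g g′ sym-g nc bounded sym-g′ nc′ bounded′ same i with i <? m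
  ... | no i≮m = trans (bounded-nothing m g bounded i i≮m) (sym (bounded-nothing m g′ bounded′ i i≮m))
  ... | yes i<m with g i in gi
  ...   | nothing = sym (letterOf-blank⁻ i (g′ i) (trans (sym (same i i<m)) (cong (letterOf i) gi)))
  ...   | just j with <-cmp i j
  ...     | tri< i<j _ _ = sym (same-arc m g g′ i j sym-g nc bounded sym-g′ nc′ bounded′ same gi i<j)
  ...     | tri≈ _ refl _ = sym (letterOf-ball⁻ i (g′ i) (trans (sym (same i i<m)) (trans (cong (letterOf i) gi) (letterOf-ball i))))
  ...     | tri> _ _ j<i = sym (sym-g′ j i (same-arc m g g′ j i sym-g nc bounded sym-g′ nc′ bounded′ same (sym-g i j gi) j<i))

  record Realization (m : ℕ) (w : ℕ → Letter) : Set where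
    field
      pairing    : Pairing
      symmetric  : Symmetric pairing
      bounded    : Bounded m pairing
      noCrossing : NoCrossing pairing
      realizes   : ∀ i → i < m → wordOf pairing i ≡ w i

  open Realization

  -- Without openers, a balanced word has no closers either; its balls are the fixed points.
  realization-without-openers : ∀ m w → #openers w 0 m ≡ 0 → Balanced 0 w 0 m → Realization m w
  realization-without-openers m w no-openers (_ , total) = record
    { pairing    = balls
    ; symmetric  = λ k j e → case balls-just k j e of λ where (refl , _) → e
    ; bounded    = λ k j e → proj₂ (balls-just k j e)
    ; noCrossing = λ i₁ i₂ j₁ j₂ i₁<i₂ i₂<j₁ _ e _ → case balls-just i₁ j₁ e of λ where (refl , _) → <-irrefl refl (<-trans i₁<i₂ i₂<j₁)
    ; realizes   = realizes′
    }
    where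
    balls : Pairing
    balls k with k <? m | w k
    ... | yes _ | ball = just k
    ... | _     | _    = nothing
    balls-just : ∀ k j → balls k ≡ just j → j ≡ k × k < m
    balls-just k j e with k <? m | w k
    balls-just k j refl | yes k<m | ball = refl , k<m
    balls-just k j ()   | yes _   | blank
    balls-just k j ()   | yes _   | opener
    balls-just k j ()   | yes _   | closer
    balls-just k j ()   | no  _   | _
    not-opener : ∀ i → i < m → isOpener (w i) ≡ false
    not-opener i i<m = countIn≡0 _ 0 m no-openers i z≤n i<m
    not-closer : ∀ i → i < m → isCloser (w i) ≡ false
    not-closer i i<m = countIn≡0 _ 0 m (trans total no-openers) i z≤n i<m
    realizes′ : ∀ i → i < m → wordOf balls i ≡ w i
    realizes′ i i<m with i <? m | w i in wi
    ... | no i≮m  | _      = ⊥-elim (i≮m i<m)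
    ... | yes _   | blank  = refl
    ... | yes _   | ball   = letterOf-ball i
    ... | yes _   | opener = contradiction (trans (sym (cong isOpener wi)) (not-opener i i<m)) λ ()
    ... | yes _   | closer = contradiction (trans (sym (cong isCloser wi)) (not-closer i i<m)) λ ()

  record InnermostPair (m : ℕ) (w : ℕ → Letter) : Set where
    field
      {i c}             : ℕ
      i<c               : i < c
      c<m               : c < m
      wi                : w i ≡ opener
      wc                : w c ≡ closer
      no-opener-between : ∀ k → i < k → k < c → isOpener (w k) ≡ false
      no-closer-before  : ∀ k → k < c → isCloser (w k) ≡ false

  innermostPair : ∀ m w → #openers w 0 m ≢ 0 → Balanced 0 w 0 m → InnermostPair m w
  innermostPair m w some-opener (prefix , total) = record
    { i<c = i<c ; c<m = c<m ; wi = wi ; wc = wc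
    ; no-opener-between = proj₂ (proj₂ (proj₂ last-opener)) ; no-closer-before = no-closer-before }
    where
    some-closer : Σ ℕ λ k → 0 ≤ k × k < m × isCloser (w k) ≡ true
    some-closer = countIn≢0 _ 0 m λ none → some-opener (trans (sym total) none)
    first-closer = first-true (λ k → isCloser (w k)) (proj₁ some-closer) (proj₂ (proj₂ (proj₂ some-closer)))
    c = proj₁ first-closer
    c<m : c < m
    c<m = ≤-<-trans (proj₁ (proj₂ (proj₂ first-closer))) (proj₁ (proj₂ (proj₂ some-closer)))
    wc : w c ≡ closer
    wc = T-isCloser (w c) (subst T (sym (proj₁ (proj₂ first-closer))) tt)
    no-closer-before = proj₂ (proj₂ (proj₂ first-closer))
    -- the prefix ending with the first closer can only be balanced by an earlier opener
    some-opener-before : Σ ℕ λ k → 0 ≤ k × k < c × isOpener (w k) ≡ true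
    some-opener-before = countIn≢0 _ 0 c λ none → 1+n≰n (subst₂ _≤_
      (trans (countIn-suc _ 0 c) (cong₂ (λ x y → x + fromBool (isCloser y)) (countIn-none _ 0 c λ k _ → no-closer-before k) wc))
      (trans (countIn-suc _ 0 c) (cong₂ (λ x y → x + fromBool (isOpener y)) none wc))
      (prefix (suc c) c<m))
    last-opener = last-true-below (λ k → isOpener (w k)) c (proj₁ some-opener-before)
      (proj₁ (proj₂ (proj₂ some-opener-before))) (proj₂ (proj₂ (proj₂ some-opener-before)))
    i = proj₁ last-opener
    i<c : i < c
    i<c = proj₁ (proj₂ last-opener)
    wi : w i ≡ opener
    wi = T-isOpener (w i) (subst T (sym (proj₁ (proj₂ (proj₂ last-opener)))) tt)

  -- Blanking out an innermost pair keeps the word balanced, and a realization of the result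
  -- extends by the arc {i, c}.
  module InnermostArc {m : ℕ} {w : ℕ → Letter} (pair : InnermostPair m w) where

    open InnermostPair pair

    private
      c≢i : c ≢ i
      c≢i c≡i = <-irrefl (sym c≡i) i<c

      w₁ : ℕ → Letter
      w₁ = update w i blank

      w₁c : w₁ c ≡ closer
      w₁c = trans (update-≢ w i blank c c≢i) wc

    unmatched : ℕ → Letter
    unmatched = update w₁ c blank

    private
      openers-≤i : ∀ t → t ≤ i → #openers unmatched 0 t ≡ #openers w 0 t
      openers-≤i t t≤i = trans (countIn-update-same isOpener w₁ c blank 0 t (cong isOpener w₁c))
                               (countIn-update-outside isOpener w i blank 0 t (inj₂ t≤i))

      openers->i : ∀ t → i < t → #openers unmatched 0 t + 1 ≡ #openers w 0 t
      openers->i t i<t = begin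
        #openers unmatched 0 t + 1                        ≡⟨ cong (_+ 1) (countIn-update-same isOpener w₁ c blank 0 t (cong isOpener w₁c)) ⟩
        #openers w₁ 0 t + fromBool (isOpener opener)     ≡⟨ cong (λ x → #openers w₁ 0 t + fromBool (isOpener x)) wi ⟨
        #openers w₁ 0 t + fromBool (isOpener (w i))      ≡⟨ countIn-update-inside isOpener w i blank 0 t z≤n i<t ⟩
        #openers w 0 t + 0                                ≡⟨ +-identityʳ _ ⟩
        #openers w 0 t                                    ∎
        where open ≡-Reasoning

      closers-w₁ : ∀ t → #closers w₁ 0 t ≡ #closers w 0 t
      closers-w₁ t = countIn-update-same isCloser w i blank 0 t (cong isCloser wi)

      closers-≤c : ∀ t → t ≤ c → #closers unmatched 0 t ≡ 0
      closers-≤c t t≤c = trans (countIn-update-outside isCloser w₁ c blank 0 t (inj₂ t≤c))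
        (trans (closers-w₁ t) (countIn-none _ 0 t λ k _ k<t → no-closer-before k (<-≤-trans k<t t≤c)))

      closers->c : ∀ t → c < t → #closers unmatched 0 t + 1 ≡ #closers w 0 t
      closers->c t c<t = begin
        #closers unmatched 0 t + 1                        ≡⟨ cong (λ x → #closers unmatched 0 t + fromBool (isCloser x)) (sym w₁c) ⟩
        #closers unmatched 0 t + fromBool (isCloser (w₁ c)) ≡⟨ countIn-update-inside isCloser w₁ c blank 0 t z≤n c<t ⟩
        #closers w₁ 0 t + 0                               ≡⟨ trans (+-identityʳ _) (closers-w₁ t) ⟩
        #closers w 0 t                                    ∎
        where open ≡-Reasoning

      closers-≤ : ∀ t → t ≤ i → #closers unmatched 0 t ≡ #closers w 0 t
      closers-≤ t t≤i = trans (closers-≤c t (≤-trans t≤i (<⇒≤ i<c)))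
        (sym (countIn-none _ 0 t λ k _ k<t → no-closer-before k (<-≤-trans k<t (≤-trans t≤i (<⇒≤ i<c)))))

    unmatched-balanced : Balanced 0 w 0 m → Balanced 0 unmatched 0 m
    unmatched-balanced (prefix , total) = prefix′ , total′
      where
      prefix′ : PrefixBalanced 0 unmatched 0 m
      prefix′ t t≤m with t ≤? i
      ... | yes t≤i = subst₂ _≤_ (sym (closers-≤ t t≤i)) (sym (openers-≤i t t≤i)) (prefix t t≤m)
      ... | no  t≰i with t ≤? c
      ...   | yes t≤c = subst (_≤ #openers unmatched 0 t) (sym (closers-≤c t t≤c)) z≤n
      ...   | no  t≰c = +-cancelʳ-≤ 1 _ _ (subst₂ _≤_ (sym (closers->c t (≰⇒> t≰c))) (sym (openers->i t (≰⇒> t≰i))) (prefix t t≤m))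
      total′ : #closers unmatched 0 m ≡ #openers unmatched 0 m
      total′ = +-cancelʳ-≡ 1 _ _ (trans (closers->c m c<m) (trans total (sym (openers->i m (<-trans i<c c<m)))))

    unmatched-#openers : #openers unmatched 0 m + 1 ≡ #openers w 0 m
    unmatched-#openers = openers->i m (<-trans i<c c<m)

    module _ (r : Realization m unmatched) where

      private
        g′ = pairing r

        unmatched-i : unmatched i ≡ blank
        unmatched-i = trans (update-≢ w₁ c blank i (λ i≡c → c≢i (sym i≡c))) (update-≡ w i blank)

        unmatched-other : ∀ k → k ≢ i → k ≢ c → unmatched k ≡ w k
        unmatched-other k k≢i k≢c = trans (update-≢ w₁ c blank k k≢c) (update-≢ w i blank k k≢i)

        g′-blank : ∀ k → k < m → unmatched k ≡ blank → g′ k ≡ nothing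
        g′-blank k k<m blankₖ = letterOf-blank⁻ k (g′ k) (trans (realizes r k k<m) blankₖ)

        g′i : g′ i ≡ nothing
        g′i = g′-blank i (<-trans i<c c<m) unmatched-i

        g′c : g′ c ≡ nothing
        g′c = g′-blank c c<m (update-≡ w₁ c blank)

        avoids : ∀ k j → g′ k ≡ just j → j ≢ i × j ≢ c
        avoids k j e = (λ { refl → just≢nothing (trans (sym (symmetric r k i e)) g′i) })
                     , (λ { refl → just≢nothing (trans (sym (symmetric r k c e)) g′c) })
          where
          just≢nothing : ∀ {x : ℕ} → just x ≢ nothing
          just≢nothing ()

        between-ball : ∀ k j → i < k → k < c → g′ k ≡ just j → j ≡ k
        between-ball k j i<k k<c e with w k in wk
        ... | blank  = contradiction (trans (sym e) (g′-blank k (<-trans k<c c<m) (trans unmatched-k wk))) λ ()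
          where unmatched-k = unmatched-other k (λ { refl → <-irrefl refl i<k }) (λ { refl → <-irrefl refl k<c })
        ... | ball   = just-injective (trans (sym e) (letterOf-ball⁻ k (g′ k) (trans (realizes r k (<-trans k<c c<m)) (trans unmatched-k wk))))
          where unmatched-k = unmatched-other k (λ { refl → <-irrefl refl i<k }) (λ { refl → <-irrefl refl k<c })
        ... | opener = contradiction (trans (sym (cong isOpener wk)) (no-opener-between k i<k k<c)) λ ()
        ... | closer = contradiction (trans (sym (cong isCloser wk)) (no-closer-before k k<c)) λ ()

        g : Pairing
        g = update (update g′ c (just i)) i (just c)

        gi : g i ≡ just c
        gi = update-≡ _ i (just c)

        gc : g c ≡ just i
        gc = trans (update-≢ _ i (just c) c c≢i) (update-≡ g′ c (just i))

        g-other : ∀ k → k ≢ i → k ≢ c → g k ≡ g′ k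
        g-other k k≢i k≢c = trans (update-≢ _ i (just c) k k≢i) (update-≢ g′ c (just i) k k≢c)

        data Arc (k j : ℕ) : Set where
          new : k ≡ i → j ≡ c → Arc k j
          new′ : k ≡ c → j ≡ i → Arc k j
          old : k ≢ i → k ≢ c → g′ k ≡ just j → Arc k j

        arc : ∀ k j → g k ≡ just j → Arc k j
        arc k j e = by-cases (k ≟ i) (k ≟ c)
          where
          by-cases : Dec (k ≡ i) → Dec (k ≡ c) → Arc k j
          by-cases (yes refl) _          = new refl (just-injective (trans (sym e) gi))
          by-cases (no  _)    (yes refl) = new′ refl (just-injective (trans (sym e) gc))
          by-cases (no  k≢i)  (no  k≢c)  = old k≢i k≢c (trans (sym (g-other k k≢i k≢c)) e)

        g-symmetric : Symmetric g
        g-symmetric k j e with arc k j e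
        ... | new refl refl = gc
        ... | new′ refl refl = gi
        ... | old _ _ e′ = let (j≢i , j≢c) = avoids k j e′ in trans (g-other j j≢i j≢c) (symmetric r k j e′)

        g-bounded : Bounded m g
        g-bounded k j e with arc k j e
        ... | new refl refl = <-trans i<c c<m
        ... | new′ refl refl = c<m
        ... | old _ _ e′ = bounded r k j e′

        forward : ∀ k j → g k ≡ just j → k < j → (k ≡ i × j ≡ c) ⊎ g′ k ≡ just j
        forward k j e k<j with arc k j e
        ... | new k≡i j≡c = inj₁ (k≡i , j≡c)
        ... | new′ refl refl = ⊥-elim (<-asym k<j i<c)
        ... | old _ _ e′ = inj₂ e′

        g-noCrossing : NoCrossing g
        g-noCrossing i₁ i₂ j₁ j₂ i₁<i₂ i₂<j₁ j₁<j₂ e₁ e₂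
          with forward i₁ j₁ e₁ (<-trans i₁<i₂ i₂<j₁) | forward i₂ j₂ e₂ (<-trans i₂<j₁ j₁<j₂)
        ... | inj₁ (refl , refl) | inj₁ (refl , refl) = <-irrefl refl i₁<i₂
        ... | inj₁ (refl , refl) | inj₂ e₂′ = <-irrefl (sym (between-ball i₂ j₂ i₁<i₂ i₂<j₁ e₂′)) (<-trans i₂<j₁ j₁<j₂)
        ... | inj₂ e₁′ | inj₁ (refl , refl) = <-irrefl (between-ball j₁ i₁ i₂<j₁ j₁<j₂ (symmetric r i₁ j₁ e₁′)) (<-trans i₁<i₂ i₂<j₁)
        ... | inj₂ e₁′ | inj₂ e₂′ = noCrossing r i₁ i₂ j₁ j₂ i₁<i₂ i₂<j₁ j₁<j₂ e₁′ e₂′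

        g-realizes : ∀ k → k < m → wordOf g k ≡ w k
        g-realizes k k<m = by-cases (k ≟ i) (k ≟ c)
          where
          by-cases : Dec (k ≡ i) → Dec (k ≡ c) → wordOf g k ≡ w k
          by-cases (yes refl) _          = trans (cong (letterOf i) gi) (trans (letterOf-opener i<c) (sym wi))
          by-cases (no  _)    (yes refl) = trans (cong (letterOf c) gc) (trans (letterOf-closer i<c) (sym wc))
          by-cases (no  k≢i)  (no  k≢c)  = trans (cong (letterOf k) (g-other k k≢i k≢c)) (trans (realizes r k k<m) (unmatched-other k k≢i k≢c))

      extend : Realization m w
      extend = record { pairing = g ; symmetric = g-symmetric ; bounded = g-bounded ; noCrossing = g-noCrossing ; realizes = g-realizes }

  realization-bounded : ∀ n m w → #openers w 0 m ≤ n → Balanced 0 w 0 m → Realization m w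
  realization-bounded n m w ≤n balanced with #openers w 0 m ≟ 0
  ... | yes none = realization-without-openers m w none balanced
  realization-bounded zero    m w ≤0 balanced | no some = ⊥-elim (some (n≤0⇒n≡0 ≤0))
  realization-bounded (suc n) m w ≤n balanced | no some = extend
    (realization-bounded n m unmatched (+-cancelʳ-≤ 1 _ _ (subst₂ _≤_ (sym unmatched-#openers) (+-comm 1 n) ≤n))
                                       (unmatched-balanced balanced))
    where open InnermostArc (innermostPair m w some balanced)

  realization : ∀ m w → Balanced 0 w 0 m → Realization m w
  realization m w = realization-bounded (#openers w 0 m) m w ≤-refl

module Encoding where

  open import Defs
  open Counting
  open IntervalCount
  open Words
  open Pairing
  open import Data.Bool using (Bool; true)
  open import Data.Bool.Properties using (T-≡)
  open import Data.List using (List; []; _∷_; map; filter; length; allFin)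
  open import Data.List.Membership.Propositional using (_∈_)
  open import Data.List.Membership.Propositional.Properties using (∈-filter⁺; ∈-filter⁻; ∈-map⁺; ∈-map⁻; ∈-allFin)
  import Data.List.Relation.Unary.All as All
  open import Data.List.Relation.Unary.Any using (here; there)
  open import Data.List.Relation.Unary.Unique.Propositional using (Unique; _∷_)
  import Data.List.Relation.Unary.Unique.Propositional.Properties as Unique
  open import Data.Empty using (⊥-elim)
  open import Data.Fin as Fin using (Fin; toℕ; fromℕ<)
  import Data.Fin.Properties as Fin
  open import Data.Maybe as Maybe using (Maybe; just; nothing)
  import Data.Maybe.Properties as Maybe
  open import Data.Nat using (ℕ; zero; suc; _+_; _≤_; _<_; z≤n; s≤s; _<?_)
  open import Data.Nat.Properties
  open import Data.Product using (Σ; _×_; _,_; proj₂)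
  open import Data.Vec using (Vec; []; _∷_; lookup; tabulate)
  import Data.Vec.Properties as Vec
  open import Relation.Binary.PropositionalEquality
  open import Relation.Nullary using (¬_; yes; no)
  open import Relation.Nullary.Decidable using (T?)
  open import Function.Bundles using (Equivalence)
  open EvalOne using (ballot)

  lookup-ext : ∀ {A : Set} {m} (v v′ : Vec A m) → (∀ k → lookup v k ≡ lookup v′ k) → v ≡ v′
  lookup-ext v v′ eq = trans (sym (Vec.tabulate∘lookup v)) (trans (Vec.tabulate-cong eq) (Vec.tabulate∘lookup v′))

  wordFun : ∀ {m} → Vec Letter m → ℕ → Letter
  wordFun []      i       = blank
  wordFun (x ∷ v) zero    = x
  wordFun (x ∷ v) (suc i) = wordFun v i

  wordFun-lookup : ∀ {m} (v : Vec Letter m) (i : Fin m) → wordFun v (toℕ i) ≡ lookup v i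
  wordFun-lookup (x ∷ v) Fin.zero    = refl
  wordFun-lookup (x ∷ v) (Fin.suc i) = wordFun-lookup v i

  wordFun-tabulate : ∀ {m} (f : ℕ → Letter) i → i < m → wordFun (tabulate {n = m} (λ k → f (toℕ k))) i ≡ f i
  wordFun-tabulate {m} f i i<m = begin
    wordFun v i                      ≡⟨ cong (wordFun v) (Fin.toℕ-fromℕ< i<m) ⟨
    wordFun v (toℕ (fromℕ< i<m))     ≡⟨ wordFun-lookup v (fromℕ< i<m) ⟩
    lookup v (fromℕ< i<m)            ≡⟨ Vec.lookup∘tabulate _ (fromℕ< i<m) ⟩
    f (toℕ (fromℕ< i<m))             ≡⟨ cong f (Fin.toℕ-fromℕ< i<m) ⟩
    f i                              ∎
    where
    open ≡-Reasoning
    v = tabulate {n = m} (λ k → f (toℕ k))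

  wordFun-injective : ∀ {m} (v v′ : Vec Letter m) → (∀ i → i < m → wordFun v i ≡ wordFun v′ i) → v ≡ v′
  wordFun-injective v v′ same = lookup-ext v v′ λ k → trans (sym (wordFun-lookup v k)) (trans (same (toℕ k) (Fin.toℕ<n k)) (wordFun-lookup v′ k))

  private
    #closers-∷ : ∀ {m} x (v : Vec Letter m) t → #closers (wordFun (x ∷ v)) 0 (suc t) ≡ fromBool (isCloser x) + #closers (wordFun v) 0 t
    #closers-∷ x v t = cong (fromBool (isCloser x) +_) (countIn-shift _ 0 t)

    #openers-∷ : ∀ {m} x (v : Vec Letter m) t → #openers (wordFun (x ∷ v)) 0 (suc t) ≡ fromBool (isOpener x) + #openers (wordFun v) 0 t
    #openers-∷ x v t = cong (fromBool (isOpener x) +_) (countIn-shift _ 0 t)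

    -- Reading the letter x takes the path from height d to height d′, which the arithmetic
    -- hypotheses express on the counts of closers c and openers o of the rest of the word.
    prefix-∷⁻ : ∀ {m} x (v : Vec Letter m) d d′ → (∀ c o → fromBool (isCloser x) + c ≤ d + (fromBool (isOpener x) + o) → c ≤ d′ + o) →
      PrefixBalanced d (wordFun (x ∷ v)) 0 (suc m) → PrefixBalanced d′ (wordFun v) 0 m
    prefix-∷⁻ x v d d′ step prefix t t≤m = step _ _ (subst₂ _≤_ (#closers-∷ x v t) (cong (d +_) (#openers-∷ x v t)) (prefix (suc t) (s≤s t≤m)))

    prefix-∷⁺ : ∀ {m} x (v : Vec Letter m) d d′ → (∀ c o → c ≤ d′ + o → fromBool (isCloser x) + c ≤ d + (fromBool (isOpener x) + o)) →
      PrefixBalanced d′ (wordFun v) 0 m → PrefixBalanced d (wordFun (x ∷ v)) 0 (suc m)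
    prefix-∷⁺ x v d d′ step prefix zero    _         = z≤n
    prefix-∷⁺ x v d d′ step prefix (suc t) (s≤s t≤m) =
      subst₂ _≤_ (sym (#closers-∷ x v t)) (cong (d +_) (sym (#openers-∷ x v t))) (step _ _ (prefix t t≤m))

    total-∷⁻ : ∀ {m} x (v : Vec Letter m) d d′ → (∀ c o → fromBool (isCloser x) + c ≡ d + (fromBool (isOpener x) + o) → c ≡ d′ + o) →
      #closers (wordFun (x ∷ v)) 0 (suc m) ≡ d + #openers (wordFun (x ∷ v)) 0 (suc m) → #closers (wordFun v) 0 m ≡ d′ + #openers (wordFun v) 0 m
    total-∷⁻ {m} x v d d′ step total = step _ _ (trans (sym (#closers-∷ x v m)) (trans total (cong (d +_) (#openers-∷ x v m))))

    total-∷⁺ : ∀ {m} x (v : Vec Letter m) d d′ → (∀ c o → c ≡ d′ + o → fromBool (isCloser x) + c ≡ d + (fromBool (isOpener x) + o)) →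
      #closers (wordFun v) 0 m ≡ d′ + #openers (wordFun v) 0 m → #closers (wordFun (x ∷ v)) 0 (suc m) ≡ d + #openers (wordFun (x ∷ v)) 0 (suc m)
    total-∷⁺ {m} x v d d′ step total = trans (#closers-∷ x v m) (trans (step _ _ total) (cong (d +_) (sym (#openers-∷ x v m))))

    closer-at-0 : ∀ {m} (v : Vec Letter m) → ¬ PrefixBalanced 0 (wordFun (closer ∷ v)) 0 (suc m)
    closer-at-0 v prefix with subst₂ _≤_ (#closers-∷ closer v 0) (#openers-∷ closer v 0) (prefix 1 (s≤s z≤n))
    ... | ()

    up⁻ : ∀ d c o → c ≤ d + (1 + o) → c ≤ suc d + o
    up⁻ d c o = subst (c ≤_) (+-suc d o)

    up⁺ : ∀ d c o → c ≤ suc d + o → c ≤ d + (1 + o)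
    up⁺ d c o = subst (c ≤_) (sym (+-suc d o))

  isDyck⇒balanced : ∀ {m} (v : Vec Letter m) d → isDyck d v ≡ true → Balanced d (wordFun v) 0 m
  isDyck⇒balanced []           zero    _ = (λ { zero z≤n → z≤n }) , refl
  isDyck⇒balanced (blank ∷ v)  d e = let (p , t) = isDyck⇒balanced v d e in
    prefix-∷⁺ blank v d d (λ _ _ h → h) p , total-∷⁺ blank v d d (λ _ _ h → h) t
  isDyck⇒balanced (ball ∷ v)   d e = let (p , t) = isDyck⇒balanced v d e in
    prefix-∷⁺ ball v d d (λ _ _ h → h) p , total-∷⁺ ball v d d (λ _ _ h → h) t
  isDyck⇒balanced (opener ∷ v) d e = let (p , t) = isDyck⇒balanced v (suc d) e in
    prefix-∷⁺ opener v d (suc d) (up⁺ d) p , total-∷⁺ opener v d (suc d) (λ c o h → trans h (sym (+-suc d o))) t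
  isDyck⇒balanced (closer ∷ v) (suc d) e = let (p , t) = isDyck⇒balanced v d e in
    prefix-∷⁺ closer v (suc d) d (λ _ _ → s≤s) p , total-∷⁺ closer v (suc d) d (λ _ _ → cong suc) t

  balanced⇒isDyck : ∀ {m} (v : Vec Letter m) d → Balanced d (wordFun v) 0 m → isDyck d v ≡ true
  balanced⇒isDyck []           zero    _       = refl
  balanced⇒isDyck []           (suc d) (_ , ())
  balanced⇒isDyck (blank ∷ v)  d (p , t) =
    balanced⇒isDyck v d (prefix-∷⁻ blank v d d (λ _ _ h → h) p , total-∷⁻ blank v d d (λ _ _ h → h) t)
  balanced⇒isDyck (ball ∷ v)   d (p , t) =
    balanced⇒isDyck v d (prefix-∷⁻ ball v d d (λ _ _ h → h) p , total-∷⁻ ball v d d (λ _ _ h → h) t)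
  balanced⇒isDyck (opener ∷ v) d (p , t) =
    balanced⇒isDyck v (suc d) (prefix-∷⁻ opener v d (suc d) (up⁻ d) p , total-∷⁻ opener v d (suc d) (λ c o h → trans h (+-suc d o)) t)
  balanced⇒isDyck (closer ∷ v) zero    (p , _) = ⊥-elim (closer-at-0 v p)
  balanced⇒isDyck (closer ∷ v) (suc d) (p , t) =
    balanced⇒isDyck v d (prefix-∷⁻ closer v (suc d) d (λ _ _ → ≤-pred) p , total-∷⁻ closer v (suc d) d (λ _ _ → suc-injective) t)

  isPrefixDyck⇒prefixBalanced : ∀ {m} (v : Vec Letter m) d → isPrefixDyck d v ≡ true → PrefixBalanced d (wordFun v) 0 m
  isPrefixDyck⇒prefixBalanced []           d _ = λ { zero z≤n → z≤n }
  isPrefixDyck⇒prefixBalanced (blank ∷ v)  d e = prefix-∷⁺ blank v d d (λ _ _ h → h) (isPrefixDyck⇒prefixBalanced v d e)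
  isPrefixDyck⇒prefixBalanced (ball ∷ v)   d e = prefix-∷⁺ ball v d d (λ _ _ h → h) (isPrefixDyck⇒prefixBalanced v d e)
  isPrefixDyck⇒prefixBalanced (opener ∷ v) d e = prefix-∷⁺ opener v d (suc d) (up⁺ d) (isPrefixDyck⇒prefixBalanced v (suc d) e)
  isPrefixDyck⇒prefixBalanced (closer ∷ v) (suc d) e = prefix-∷⁺ closer v (suc d) d (λ _ _ → s≤s) (isPrefixDyck⇒prefixBalanced v d e)

  prefixBalanced⇒isPrefixDyck : ∀ {m} (v : Vec Letter m) d → PrefixBalanced d (wordFun v) 0 m → isPrefixDyck d v ≡ true
  prefixBalanced⇒isPrefixDyck []           d _ = refl
  prefixBalanced⇒isPrefixDyck (blank ∷ v)  d p = prefixBalanced⇒isPrefixDyck v d (prefix-∷⁻ blank v d d (λ _ _ h → h) p)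
  prefixBalanced⇒isPrefixDyck (ball ∷ v)   d p = prefixBalanced⇒isPrefixDyck v d (prefix-∷⁻ ball v d d (λ _ _ h → h) p)
  prefixBalanced⇒isPrefixDyck (opener ∷ v) d p = prefixBalanced⇒isPrefixDyck v (suc d) (prefix-∷⁻ opener v d (suc d) (up⁻ d) p)
  prefixBalanced⇒isPrefixDyck (closer ∷ v) zero    p = ⊥-elim (closer-at-0 v p)
  prefixBalanced⇒isPrefixDyck (closer ∷ v) (suc d) p = prefixBalanced⇒isPrefixDyck v d (prefix-∷⁻ closer v (suc d) d (λ _ _ → ≤-pred) p)

  pairingOf : ∀ {n m} → Vec (Maybe (Fin n)) m → Pairing
  pairingOf []      i       = nothing
  pairingOf (x ∷ v) zero    = Maybe.map toℕ x
  pairingOf (x ∷ v) (suc i) = pairingOf v i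

  pairingOf-lookup : ∀ {n m} (v : Vec (Maybe (Fin n)) m) (i : Fin m) → pairingOf v (toℕ i) ≡ Maybe.map toℕ (lookup v i)
  pairingOf-lookup (x ∷ v) Fin.zero    = refl
  pairingOf-lookup (x ∷ v) (Fin.suc i) = pairingOf-lookup v i

  pairingOf-outside : ∀ {n m} (v : Vec (Maybe (Fin n)) m) i → m ≤ i → pairingOf v i ≡ nothing
  pairingOf-outside []      i       _         = refl
  pairingOf-outside (x ∷ v) (suc i) (s≤s m≤i) = pairingOf-outside v i m≤i

  pairingOf-just : ∀ {n m} (v : Vec (Maybe (Fin n)) m) i j → pairingOf v i ≡ just j →
    Σ (Fin m) λ i′ → Σ (Fin n) λ j′ → toℕ i′ ≡ i × toℕ j′ ≡ j × lookup v i′ ≡ just j′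
  pairingOf-just (just j′ ∷ v) zero    j refl = Fin.zero , j′ , refl , refl , refl
  pairingOf-just (x ∷ v)       (suc i) j e with pairingOf-just v i j e
  ... | i′ , j′ , refl , refl , e′ = Fin.suc i′ , j′ , refl , refl , e′

  pairingOf-injective : ∀ {n m} (v v′ : Vec (Maybe (Fin n)) m) → (∀ i → pairingOf v i ≡ pairingOf v′ i) → v ≡ v′
  pairingOf-injective v v′ same = lookup-ext v v′ λ k → Maybe.map-injective Fin.toℕ-injective
    (trans (sym (pairingOf-lookup v k)) (trans (same (toℕ k)) (pairingOf-lookup v′ k)))

  isConfig⇒symmetric : ∀ {m} (v : Config m) → IsConfig v → Symmetric (pairingOf v)
  isConfig⇒symmetric v isConfig i j e with pairingOf-just v i j e
  ... | i′ , j′ , refl , refl , e′ = trans (pairingOf-lookup v j′) (cong (Maybe.map toℕ) (isConfig i′ j′ e′))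

  pairingOf-bounded : ∀ {m} (v : Config m) → Bounded m (pairingOf v)
  pairingOf-bounded v i j e with pairingOf-just v i j e
  ... | i′ , _ , refl , _ , _ = Fin.toℕ<n i′

  nonCrossing⇒noCrossing : ∀ {m} (v : Config m) → NonCrossing v → NoCrossing (pairingOf v)
  nonCrossing⇒noCrossing v nc i₁ i₂ j₁ j₂ i₁<i₂ i₂<j₁ j₁<j₂ e₁ e₂ with pairingOf-just v i₁ j₁ e₁ | pairingOf-just v i₂ j₂ e₂
  ... | i₁′ , j₁′ , refl , refl , e₁′ | i₂′ , j₂′ , refl , refl , e₂′ = nc i₁′ i₂′ j₁′ j₂′ i₁<i₂ i₂<j₁ j₁<j₂ e₁′ e₂′

  private
    pairingOf-lookup-just : ∀ {m} (v : Config m) {i j} → lookup v i ≡ just j → pairingOf v (toℕ i) ≡ just (toℕ j)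
    pairingOf-lookup-just v {i} e = trans (pairingOf-lookup v i) (cong (Maybe.map toℕ) e)

  symmetric⇒isConfig : ∀ {m} (v : Config m) → Symmetric (pairingOf v) → IsConfig v
  symmetric⇒isConfig v sym-v i j e = Maybe.map-injective Fin.toℕ-injective
    (trans (sym (pairingOf-lookup v j)) (sym-v (toℕ i) (toℕ j) (pairingOf-lookup-just v e)))

  noCrossing⇒nonCrossing : ∀ {m} (v : Config m) → NoCrossing (pairingOf v) → NonCrossing v
  noCrossing⇒nonCrossing v nc i₁ i₂ j₁ j₂ i₁<i₂ i₂<j₁ j₁<j₂ e₁ e₂ =
    nc (toℕ i₁) (toℕ i₂) (toℕ j₁) (toℕ j₂) i₁<i₂ i₂<j₁ j₁<j₂ (pairingOf-lookup-just v e₁) (pairingOf-lookup-just v e₂)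

  private
    toFin : ∀ m → Maybe ℕ → Maybe (Fin m)
    toFin m nothing  = nothing
    toFin m (just j) with j <? m
    ... | yes j<m = just (fromℕ< j<m)
    ... | no  _   = nothing

    toℕ-toFin : ∀ m x → (∀ j → x ≡ just j → j < m) → Maybe.map toℕ (toFin m x) ≡ x
    toℕ-toFin m nothing  _     = refl
    toℕ-toFin m (just j) below with j <? m
    ... | yes j<m = cong just (Fin.toℕ-fromℕ< j<m)
    ... | no  j≮m = ⊥-elim (j≮m (below j refl))

  configOf : ∀ m → Pairing → Config m
  configOf m g = tabulate λ i → toFin m (g (toℕ i))

  pairingOf-configOf : ∀ m g → Symmetric g → Bounded m g → ∀ i → pairingOf (configOf m g) i ≡ g i
  pairingOf-configOf m g sym-g bounded i with i <? m
  ... | no  i≮m = trans (pairingOf-outside (configOf m g) i (≮⇒≥ i≮m)) (sym (bounded-nothing m g bounded i i≮m))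
  ... | yes i<m = begin
    pairingOf (configOf m g) i                            ≡⟨ cong (pairingOf (configOf m g)) (Fin.toℕ-fromℕ< i<m) ⟨
    pairingOf (configOf m g) (toℕ i′)                     ≡⟨ pairingOf-lookup (configOf m g) i′ ⟩
    Maybe.map toℕ (lookup (configOf m g) i′)              ≡⟨ cong (Maybe.map toℕ) (Vec.lookup∘tabulate _ i′) ⟩
    Maybe.map toℕ (toFin m (g (toℕ i′)))                  ≡⟨ toℕ-toFin m _ (λ j e → bounded j _ (sym-g _ j e)) ⟩
    g (toℕ i′)                                            ≡⟨ cong g (Fin.toℕ-fromℕ< i<m) ⟩
    g i                                                   ∎
    where
    open ≡-Reasoning
    i′ = fromℕ< i<m

  configWord : ∀ {m} → Config m → Vec Letter m
  configWord v = tabulate λ i → wordOf (pairingOf v) (toℕ i)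

  wordFun-configWord : ∀ {m} (v : Config m) i → i < m → wordFun (configWord v) i ≡ wordOf (pairingOf v) i
  wordFun-configWord v = wordFun-tabulate (wordOf (pairingOf v))

  configWord-isDyck : ∀ {m} (v : Config m) → IsNCConfig v → isDyck 0 (configWord v) ≡ true
  configWord-isDyck {m} v (isConfig , _) = balanced⇒isDyck (configWord v) 0
    (Balanced-cong 0 m (λ i _ i<m → sym (wordFun-configWord v i i<m))
      (wordOf-balanced m (pairingOf v) (isConfig⇒symmetric v isConfig) (pairingOf-bounded v)))

  configWord-injective : ∀ {m} (v v′ : Config m) → IsNCConfig v → IsNCConfig v′ → configWord v ≡ configWord v′ → v ≡ v′
  configWord-injective {m} v v′ (isConfig , nc) (isConfig′ , nc′) same-word = pairingOf-injective v v′
    (wordOf-injective m (pairingOf v) (pairingOf v′)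
      (isConfig⇒symmetric v isConfig) (nonCrossing⇒noCrossing v nc) (pairingOf-bounded v)
      (isConfig⇒symmetric v′ isConfig′) (nonCrossing⇒noCrossing v′ nc′) (pairingOf-bounded v′)
      λ i i<m → trans (sym (wordFun-configWord v i i<m)) (trans (cong (λ u → wordFun u i) same-word) (wordFun-configWord v′ i i<m)))

  configWord-surjective : ∀ {m} (w : Vec Letter m) → isDyck 0 w ≡ true → Σ (Config m) λ v → IsNCConfig v × configWord v ≡ w
  configWord-surjective {m} w dyck = v , (isConfig , nonCrossing) , wordFun-injective (configWord v) w same-word
    where
    r = realization m (wordFun w) (isDyck⇒balanced w 0 dyck)
    open Realization r
    v = configOf m pairing
    pairingOf-v : ∀ i → pairingOf v i ≡ pairing i
    pairingOf-v = pairingOf-configOf m pairing symmetric bounded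
    isConfig : IsConfig v
    isConfig = symmetric⇒isConfig v λ i j e → trans (pairingOf-v j) (symmetric i j (trans (sym (pairingOf-v i)) e))
    nonCrossing : NonCrossing v
    nonCrossing = noCrossing⇒nonCrossing v λ i₁ i₂ j₁ j₂ i₁<i₂ i₂<j₁ j₁<j₂ e₁ e₂ →
      noCrossing i₁ i₂ j₁ j₂ i₁<i₂ i₂<j₁ j₁<j₂ (trans (sym (pairingOf-v i₁)) e₁) (trans (sym (pairingOf-v i₂)) e₂)
    same-word : ∀ i → i < m → wordFun (configWord v) i ≡ wordFun w i
    same-word i i<m = trans (wordFun-configWord v i i<m) (trans (cong (letterOf i) (pairingOf-v i)) (realizes i i<m))

  allConfigs-unique : ∀ m → Unique (allConfigs m)
  allConfigs-unique m = vecs-unique m (All.tabulate nothing∉ ∷ Unique.map⁺ Maybe.just-injective (Unique.allFin⁺ m))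
    where
    nothing∉ : ∀ {x} → x ∈ map just (allFin m) → nothing ≢ x
    nothing∉ x∈ with ∈-map⁻ just x∈
    ... | _ , _ , refl = λ ()

  ∈-allConfigs : ∀ {m} (v : Config m) → v ∈ allConfigs m
  ∈-allConfigs {m} = ∈-vecs λ where
    nothing  → here refl
    (just i) → there (∈-map⁺ just (∈-allFin i))

  cardXn-ballot : ∀ m → cardXn (suc m) ≡ ballot m 1
  cardXn-ballot m = begin
    length (filter isNCConfig? (allConfigs m))                 ≡⟨ length-≡-by-bijection configWord unique-configs unique-words into inj onto ⟩
    length (filter (λ w → T? (isDyck 0 w)) (vecs letters m))   ≡⟨ length-filter-T? (isDyck 0) (vecs letters m) ⟩
    countᵇ (isDyck 0) (vecs letters m)                         ≡⟨ countᵇ-isDyck-ballot m ⟩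
    ballot m 1                                                 ∎
    where
    open ≡-Reasoning
    dyck? = λ (w : Vec Letter m) → T? (isDyck 0 w)
    unique-configs = Unique.filter⁺ isNCConfig? (allConfigs-unique m)
    unique-words = Unique.filter⁺ dyck? (vecs-unique m letters-unique)
    nc : ∀ {v} → v ∈ filter isNCConfig? (allConfigs m) → IsNCConfig v
    nc v∈ = proj₂ (∈-filter⁻ isNCConfig? {xs = allConfigs m} v∈)
    into : ∀ {v} → v ∈ filter isNCConfig? (allConfigs m) → configWord v ∈ filter dyck? (vecs letters m)
    into {v} v∈ = ∈-filter⁺ dyck? (∈-vecs ∈-letters (configWord v)) (Equivalence.from T-≡ (configWord-isDyck v (nc v∈)))
    inj : ∀ {v v′} → v ∈ filter isNCConfig? (allConfigs m) → v′ ∈ filter isNCConfig? (allConfigs m) → configWord v ≡ configWord v′ → v ≡ v′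
    inj v∈ v′∈ = configWord-injective _ _ (nc v∈) (nc v′∈)
    onto : ∀ {w} → w ∈ filter dyck? (vecs letters m) → Σ (Config m) λ v → v ∈ filter isNCConfig? (allConfigs m) × configWord v ≡ w
    onto {w} w∈ with configWord-surjective w (Equivalence.to T-≡ (proj₂ (∈-filter⁻ dyck? {xs = vecs letters m} w∈)))
    ... | v , ncv , refl = v , ∈-filter⁺ isNCConfig? (∈-allConfigs v) ncv , refl

module Symmetry where

  open import Defs
  open Counting
  open IntervalCount
  open Words
  open Pairing
  open Encoding
  open Parity using (double; double≡+)
  open import Data.Empty using (⊥-elim)
  open import Data.Fin as Fin using (Fin; toℕ; fromℕ<; opposite)
  import Data.Fin.Properties as Fin
  open import Data.Maybe as Maybe using (Maybe; just; nothing)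
  import Data.Maybe.Properties as Maybe
  open import Data.Nat using (ℕ; zero; suc; _+_; _∸_; _≤_; _<_; z≤n; s≤s; _≤?_; _<?_)
  open import Data.Nat.Properties
  open import Data.Product using (_×_; _,_; proj₁; proj₂)
  open import Data.Vec using (Vec; lookup; tabulate)
  import Data.Vec.Properties as Vec
  open import Relation.Binary.Definitions using (Tri; tri<; tri≈; tri>)
  open import Relation.Binary.PropositionalEquality
  open import Relation.Nullary using (yes; no)

  dual : Letter → Letter
  dual blank  = blank
  dual ball   = ball
  dual opener = closer
  dual closer = opener

  dual-involutive : ∀ x → dual (dual x) ≡ x
  dual-involutive blank  = refl
  dual-involutive ball   = refl
  dual-involutive opener = refl
  dual-involutive closer = refl

  isCloser-dual : ∀ x → isCloser (dual x) ≡ isOpener x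
  isCloser-dual blank  = refl
  isCloser-dual ball   = refl
  isCloser-dual opener = refl
  isCloser-dual closer = refl

  isOpener-dual : ∀ x → isOpener (dual x) ≡ isCloser x
  isOpener-dual blank  = refl
  isOpener-dual ball   = refl
  isOpener-dual opener = refl
  isOpener-dual closer = refl

  reverseDual : ∀ {m} → Vec Letter m → Vec Letter m
  reverseDual w = tabulate λ i → dual (lookup w (opposite i))

  private
    toℕ-opposite⁻ : ∀ {m} (i : Fin m) → toℕ i ≡ m ∸ suc (toℕ (opposite i))
    toℕ-opposite⁻ i = trans (cong toℕ (sym (Fin.opposite-involutive i))) (Fin.opposite-prop (opposite i))

    opposite-< : ∀ {m} {i j : Fin m} → toℕ i < toℕ j → toℕ (opposite j) < toℕ (opposite i)
    opposite-< {i = i} {j} i<j = subst₂ _<_ (sym (Fin.opposite-prop j)) (sym (Fin.opposite-prop i)) (∸-monoʳ-< (s≤s i<j) (Fin.toℕ<n j))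

    letterOf-mirror : ∀ m a b → a < m → b < m → letterOf (m ∸ suc a) (just (m ∸ suc b)) ≡ dual (letterOf a (just b))
    letterOf-mirror m a b a<m b<m = by-cases (<-cmp a b)
      where
      by-cases : Tri (a < b) (a ≡ b) (b < a) → letterOf (m ∸ suc a) (just (m ∸ suc b)) ≡ dual (letterOf a (just b))
      by-cases (tri< a<b _ _)  = trans (letterOf-closer (∸-monoʳ-< (s≤s a<b) b<m)) (cong dual (sym (letterOf-opener a<b)))
      by-cases (tri≈ _ refl _) = trans (letterOf-ball (m ∸ suc a)) (cong dual (sym (letterOf-ball a)))
      by-cases (tri> _ _ b<a)  = trans (letterOf-opener (∸-monoʳ-< (s≤s b<a) a<m)) (cong dual (sym (letterOf-closer b<a)))

    lookup-τ : ∀ {m} (v : Config m) i → lookup (τ v) i ≡ Maybe.map opposite (lookup v (opposite i))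
    lookup-τ v = Vec.lookup∘tabulate _

  lookup-configWord : ∀ {m} (v : Config m) i → lookup (configWord v) i ≡ letterOf (toℕ i) (Maybe.map toℕ (lookup v i))
  lookup-configWord v i = trans (Vec.lookup∘tabulate _ i) (cong (letterOf (toℕ i)) (pairingOf-lookup v i))

  configWord-τ : ∀ {m} (v : Config m) → configWord (τ v) ≡ reverseDual (configWord v)
  configWord-τ {m} v = lookup-ext _ _ λ i → begin
    lookup (configWord (τ v)) i                                                   ≡⟨ lookup-configWord (τ v) i ⟩
    letterOf (toℕ i) (Maybe.map toℕ (lookup (τ v) i))                             ≡⟨ cong (λ x → letterOf (toℕ i) (Maybe.map toℕ x)) (lookup-τ v i) ⟩
    letterOf (toℕ i) (Maybe.map toℕ (Maybe.map opposite (lookup v (opposite i)))) ≡⟨ mirror (lookup v (opposite i)) ⟩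
    dual (letterOf (toℕ (opposite i)) (Maybe.map toℕ (lookup v (opposite i))))    ≡⟨ cong dual (lookup-configWord v (opposite i)) ⟨
    dual (lookup (configWord v) (opposite i))                                     ≡⟨ Vec.lookup∘tabulate _ i ⟨
    lookup (reverseDual (configWord v)) i                                         ∎
    where
    open ≡-Reasoning
    mirror : ∀ {i} x → letterOf (toℕ i) (Maybe.map toℕ (Maybe.map opposite x)) ≡ dual (letterOf (toℕ (opposite i)) (Maybe.map toℕ x))
    mirror         nothing  = refl
    mirror {i} (just j) = trans (cong₂ (λ a b → letterOf a (just b)) (toℕ-opposite⁻ i) (Fin.opposite-prop j))
      (letterOf-mirror m (toℕ (opposite i)) (toℕ j) (Fin.toℕ<n (opposite i)) (Fin.toℕ<n j))

  τ-preserves-NC : ∀ {m} (v : Config m) → IsNCConfig v → IsNCConfig (τ v)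
  τ-preserves-NC {m} v (isConfig , nc) = isConfig′ , nc′
    where
    unmirror : ∀ i j → lookup (τ v) i ≡ just j → lookup v (opposite i) ≡ just (opposite j)
    unmirror i j e = map-opposite⁻ (lookup v (opposite i)) (trans (sym (lookup-τ v i)) e)
      where
      map-opposite⁻ : ∀ x → Maybe.map opposite x ≡ just j → x ≡ just (opposite j)
      map-opposite⁻ (just j′) e = cong just (trans (sym (Fin.opposite-involutive j′)) (cong opposite (Maybe.just-injective e)))
    isConfig′ : IsConfig (τ v)
    isConfig′ i j e = trans (lookup-τ v j) (trans (cong (Maybe.map opposite) (isConfig _ _ (unmirror i j e))) (cong just (Fin.opposite-involutive i)))
    nc′ : NonCrossing (τ v)
    nc′ i₁ i₂ j₁ j₂ i₁<i₂ i₂<j₁ j₁<j₂ e₁ e₂ =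
      nc (opposite j₂) (opposite j₁) (opposite i₂) (opposite i₁) (opposite-< j₁<j₂) (opposite-< i₂<j₁) (opposite-< i₁<i₂)
         (isConfig _ _ (unmirror i₂ j₂ e₂)) (isConfig _ _ (unmirror i₁ j₁ e₁))

  SelfDual : ℕ → (ℕ → Letter) → Set
  SelfDual k w = ∀ p → p < k → w p ≡ dual (w (k ∸ suc p))

  module _ (k : ℕ) where

    mirror-involutive : ∀ s → s < k → k ∸ suc (k ∸ suc s) ≡ s
    mirror-involutive s s<k = trans (cong (k ∸_) (sym (+-∸-assoc 1 s<k))) (m∸[m∸n]≡n (<⇒≤ s<k))

    mirror-< : ∀ s → s < k → k ∸ suc s < k
    mirror-< s s<k = ∸-monoʳ-< (s≤s z≤n) s<k

    private
      module Mirror (p : ℕ) (p<k : p < k) where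
        q = k ∸ suc p
        q+1+p≡k : q + suc p ≡ k
        q+1+p≡k = m∸n+n≡m p<k
        1+q+p≡k : suc q + p ≡ k
        1+q+p≡k = trans (sym (+-suc q p)) q+1+p≡k

    mirror-of-right : ∀ p → p < k → k ≤ double p → double (k ∸ suc p) < k
    mirror-of-right p p<k k≤2p = subst (_< k) (sym (double≡+ q)) (subst (q + q <_) q+1+p≡k (+-monoʳ-< q (<-trans q<p (n<1+n p))))
      where
      open Mirror p p<k
      q<p : q < p
      q<p = +-cancelʳ-≤ p (suc q) p (subst₂ _≤_ (sym 1+q+p≡k) (double≡+ p) k≤2p)

    mirror-of-left : ∀ p → p < k → double p < k → double (k ∸ suc p) < k → k ∸ suc p ≡ p
    mirror-of-left p p<k 2p<k 2q<k = ≤-antisym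
      (≤-pred (+-cancelˡ-< q q (suc p) (subst₂ _<_ (double≡+ q) (sym q+1+p≡k) 2q<k)))
      (+-cancelʳ-≤ p p q (≤-pred (subst₂ _<_ (double≡+ p) (sym 1+q+p≡k) 2p<k)))
      where open Mirror p p<k

    mirror-fixed : ∀ p → p < k → k ∸ suc p ≡ p → suc (double p) ≡ k
    mirror-fixed p p<k q≡p = trans (cong suc (double≡+ p)) (trans (cong (λ x → suc (x + p)) (sym q≡p)) 1+q+p≡k)
      where open Mirror p p<k

  reverseDual≡⇒selfDual : ∀ {k} (w : Vec Letter k) → reverseDual w ≡ w → SelfDual k (wordFun w)
  reverseDual≡⇒selfDual {k} w fixed p p<k = begin
    wordFun w p                                   ≡⟨ cong (wordFun w) (Fin.toℕ-fromℕ< p<k) ⟨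
    wordFun w (toℕ p′)                            ≡⟨ wordFun-lookup w p′ ⟩
    lookup w p′                                   ≡⟨ cong (λ u → lookup u p′) fixed ⟨
    lookup (reverseDual w) p′                     ≡⟨ Vec.lookup∘tabulate _ p′ ⟩
    dual (lookup w (opposite p′))                 ≡⟨ cong dual (wordFun-lookup w (opposite p′)) ⟨
    dual (wordFun w (toℕ (opposite p′)))          ≡⟨ cong (λ i → dual (wordFun w i)) (trans (Fin.opposite-prop p′) (cong (λ i → k ∸ suc i) (Fin.toℕ-fromℕ< p<k))) ⟩
    dual (wordFun w (k ∸ suc p))                  ∎
    where
    open ≡-Reasoning
    p′ = fromℕ< p<k

  selfDual⇒reverseDual≡ : ∀ {k} (w : Vec Letter k) → SelfDual k (wordFun w) → reverseDual w ≡ w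
  selfDual⇒reverseDual≡ {k} w selfDual = lookup-ext _ _ λ p → begin
    lookup (reverseDual w) p                      ≡⟨ Vec.lookup∘tabulate _ p ⟩
    dual (lookup w (opposite p))                  ≡⟨ cong dual (wordFun-lookup w (opposite p)) ⟨
    dual (wordFun w (toℕ (opposite p)))           ≡⟨ cong (λ i → dual (wordFun w i)) (Fin.opposite-prop p) ⟩
    dual (wordFun w (k ∸ suc (toℕ p)))            ≡⟨ selfDual (toℕ p) (Fin.toℕ<n p) ⟨
    wordFun w (toℕ p)                             ≡⟨ wordFun-lookup w p ⟩
    lookup w p                                    ∎
    where open ≡-Reasoning

  selfDual-suffix : ∀ k w → SelfDual k w → ∀ s → s ≤ k →
    #closers w (k ∸ s) s ≡ #openers w 0 s × #openers w (k ∸ s) s ≡ #closers w 0 s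
  selfDual-suffix k w selfDual zero    _   = refl , refl
  selfDual-suffix k w selfDual (suc s) s<k = closers , openers
    where
    q = k ∸ suc s
    1+q≡k-s : suc q ≡ k ∸ s
    1+q≡k-s = sym (+-∸-assoc 1 s<k)
    wq : w q ≡ dual (w s)
    wq = trans (selfDual q (mirror-< k s s<k)) (cong (λ i → dual (w i)) (mirror-involutive k s s<k))
    ih = selfDual-suffix k w selfDual s (<⇒≤ s<k)
    closers : #closers w q (suc s) ≡ #openers w 0 (suc s)
    closers = trans (cong₂ _+_ (cong fromBool (trans (cong isCloser wq) (isCloser-dual (w s))))
                               (trans (cong (λ a → #closers w a s) 1+q≡k-s) (proj₁ ih)))
                    (trans (+-comm (fromBool (isOpener (w s))) _) (sym (countIn-suc _ 0 s)))
    openers : #openers w q (suc s) ≡ #closers w 0 (suc s)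
    openers = trans (cong₂ _+_ (cong fromBool (trans (cong isOpener wq) (isOpener-dual (w s))))
                               (trans (cong (λ a → #openers w a s) 1+q≡k-s) (proj₂ ih)))
                    (trans (+-comm (fromBool (isCloser (w s))) _) (sym (countIn-suc _ 0 s)))

  -- A self-dual word is balanced as soon as its first half is prefix-balanced: a prefix
  -- reaching into the second half is the whole word minus a suffix mirroring a short prefix.
  selfDual-balanced : ∀ k h w → SelfDual k w → k ≤ h + h → PrefixBalanced 0 w 0 h → Balanced 0 w 0 k
  selfDual-balanced k h w selfDual k≤2h prefix = prefix′ , total
    where
    total : #closers w 0 k ≡ #openers w 0 k
    total = subst (λ a → #closers w a k ≡ #openers w 0 k) (n∸n≡0 k) (proj₁ (selfDual-suffix k w selfDual k ≤-refl))
    prefix′ : PrefixBalanced 0 w 0 k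
    prefix′ t t≤k with t ≤? h
    ... | yes t≤h = prefix t t≤h
    ... | no  t≰h = +-cancelʳ-≤ (#openers w 0 s) _ _ (subst (_≤ #openers w 0 t + #openers w 0 s) complement (+-monoʳ-≤ (#openers w 0 t) (prefix s s≤h)))
      where
      s = k ∸ t
      t+s≡k : t + s ≡ k
      t+s≡k = m+[n∸m]≡n t≤k
      s≤h : s ≤ h
      s≤h = ≮⇒≥ λ h<s → <-irrefl refl (<-≤-trans (subst (h + h <_) t+s≡k (+-mono-< (≰⇒> t≰h) h<s)) k≤2h)
      k∸s≡t : k ∸ s ≡ t
      k∸s≡t = m∸[m∸n]≡n t≤k
      suffix = selfDual-suffix k w selfDual s (m∸n≤m k t)
      closers-suffix : #closers w t s ≡ #openers w 0 s
      closers-suffix = subst (λ a → #closers w a s ≡ #openers w 0 s) k∸s≡t (proj₁ suffix)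
      openers-suffix : #openers w t s ≡ #closers w 0 s
      openers-suffix = subst (λ a → #openers w a s ≡ #closers w 0 s) k∸s≡t (proj₂ suffix)
      complement : #openers w 0 t + #closers w 0 s ≡ #closers w 0 t + #openers w 0 s
      complement = begin
        #openers w 0 t + #closers w 0 s     ≡⟨ cong (#openers w 0 t +_) openers-suffix ⟨
        #openers w 0 t + #openers w t s     ≡⟨ countIn-+ _ 0 t s ⟨
        #openers w 0 (t + s)                ≡⟨ cong (#openers w 0) t+s≡k ⟩
        #openers w 0 k                      ≡⟨ total ⟨
        #closers w 0 k                      ≡⟨ cong (#closers w 0) t+s≡k ⟨
        #closers w 0 (t + s)                ≡⟨ countIn-+ _ 0 t s ⟩
        #closers w 0 t + #closers w t s     ≡⟨ cong (#closers w 0 t +_) closers-suffix ⟩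
        #closers w 0 t + #openers w 0 s     ∎
        where open ≡-Reasoning

  -- The self-dual word of length k whose left half, including a possible middle letter, is h.
  unfold : ℕ → (ℕ → Letter) → ℕ → Letter
  unfold k h p with double p <? k
  ... | yes _ = h p
  ... | no  _ = dual (h (k ∸ suc p))

  unfold-left : ∀ k h p → double p < k → unfold k h p ≡ h p
  unfold-left k h p 2p<k with double p <? k
  ... | yes _    = refl
  ... | no  2p≮k = ⊥-elim (2p≮k 2p<k)

  unfold-selfDual : ∀ k h → (∀ p → p < k → k ∸ suc p ≡ p → h p ≡ dual (h p)) → SelfDual k (unfold k h)
  unfold-selfDual k h middle p p<k with double p <? k
  ... | no  2p≮k = cong dual (sym (unfold-left k h (k ∸ suc p) (mirror-of-right k p p<k (≮⇒≥ 2p≮k))))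
  ... | yes 2p<k with double (k ∸ suc p) <? k
  ...   | yes 2q<k = let q≡p = mirror-of-left k p p<k 2p<k 2q<k in
    trans (middle p p<k q≡p) (cong (λ i → dual (h i)) (sym q≡p))
  ...   | no  _    = trans (sym (dual-involutive (h p))) (cong (λ i → dual (dual (h i))) (sym (mirror-involutive k p p<k)))

  selfDual-unfold : ∀ k w → SelfDual k w → ∀ p → p < k → unfold k w p ≡ w p
  selfDual-unfold k w selfDual p p<k with double p <? k
  ... | yes _ = refl
  ... | no  _ = sym (selfDual p p<k)

  SelfDual-cong : ∀ k {w w′} → (∀ p → p < k → w p ≡ w′ p) → SelfDual k w → SelfDual k w′
  SelfDual-cong k agree selfDual p p<k =
    trans (sym (agree p p<k)) (trans (selfDual p p<k) (cong dual (agree _ (mirror-< k p p<k))))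

  selfDual-determined : ∀ k {w w′} → SelfDual k w → SelfDual k w′ → (∀ p → double p < k → w p ≡ w′ p) → ∀ p → p < k → w p ≡ w′ p
  selfDual-determined k {w} {w′} selfDual selfDual′ agree p p<k =
    trans (sym (selfDual-unfold k w selfDual p p<k)) (trans unfold-≡ (selfDual-unfold k w′ selfDual′ p p<k))
    where
    unfold-≡ : unfold k w p ≡ unfold k w′ p
    unfold-≡ with double p <? k
    ... | yes 2p<k = agree p 2p<k
    ... | no  2p≮k = cong dual (agree _ (mirror-of-right k p p<k (≮⇒≥ 2p≮k)))

module FixedPoints where

  open import Defs
  open Counting
  open IntervalCount
  open Parity
  open Words
  open Pairing
  open Encoding
  open Symmetry
  open import Data.Bool using (Bool; true; false; _∧_)
  open import Data.Bool.Properties using (T-≡; T-∧)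
  open import Data.Empty using (⊥-elim)
  open import Data.Fin using (toℕ)
  open import Data.List using (List; filter; length)
  open import Data.List.Membership.Propositional using (_∈_)
  open import Data.List.Membership.Propositional.Properties using (∈-filter⁺; ∈-filter⁻)
  open import Data.List.Relation.Unary.Unique.Propositional using (Unique)
  import Data.List.Relation.Unary.Unique.Propositional.Properties as Unique
  open import Data.Nat using (ℕ; zero; suc; _+_; _≤_; _<_; s≤s)
  open import Data.Nat.Combinatorics using (_C_)
  open import Data.Nat.Properties
  open import Data.Product using (Σ; _×_; _,_; proj₁; proj₂)
  open import Data.Sum using (inj₁; inj₂)
  open import Data.Vec.Properties using (∷-injectiveˡ; ∷-injectiveʳ)
  open import Function using (case_of_)
  open import Data.Vec using (Vec; []; _∷_; _∷ʳ_; tabulate)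
  open import Function.Bundles using (Equivalence)
  open import Relation.Binary.PropositionalEquality
  open import Relation.Nullary.Decidable using (T?)

  fixed⇒selfDual : ∀ {m} (v : Config m) → τ v ≡ v → SelfDual m (wordFun (configWord v))
  fixed⇒selfDual v fixed = reverseDual≡⇒selfDual (configWord v) (trans (sym (configWord-τ v)) (cong configWord fixed))

  selfDual⇒fixed : ∀ {m} (v : Config m) → IsNCConfig v → SelfDual m (wordFun (configWord v)) → τ v ≡ v
  selfDual⇒fixed v nc selfDual = configWord-injective (τ v) v (τ-preserves-NC v nc) nc
    (trans (configWord-τ v) (selfDual⇒reverseDual≡ (configWord v) selfDual))

  configWord-prefixBalanced : ∀ {m} (v : Config m) → IsNCConfig v → PrefixBalanced 0 (wordFun (configWord v)) 0 m
  configWord-prefixBalanced v nc = proj₁ (isDyck⇒balanced (configWord v) 0 (configWord-isDyck v nc))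

  firstHalf : ∀ i {m} → Vec Letter m → Vec Letter i
  firstHalf i w = tabulate λ k → wordFun w (toℕ k)

  module _ {m : ℕ} where

    FixedConfig : Config m → Set
    FixedConfig v = v ∈ filter fixed? (filter isNCConfig? (allConfigs m))

    fixedConfig⁻ : ∀ {v} → FixedConfig v → IsNCConfig v × τ v ≡ v
    fixedConfig⁻ v∈ = let (v∈′ , fixed) = ∈-filter⁻ fixed? {xs = filter isNCConfig? (allConfigs m)} v∈ in
      proj₂ (∈-filter⁻ isNCConfig? {xs = allConfigs m} v∈′) , fixed

    fixedConfig⁺ : ∀ {v} → IsNCConfig v → τ v ≡ v → FixedConfig v
    fixedConfig⁺ {v} nc fixed = ∈-filter⁺ fixed? (∈-filter⁺ isNCConfig? (∈-allConfigs v) nc) fixed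

    fixedConfigs-unique : Unique (filter fixed? (filter isNCConfig? (allConfigs m)))
    fixedConfigs-unique = Unique.filter⁺ fixed? (Unique.filter⁺ isNCConfig? (allConfigs-unique m))

    selfDual-fixedConfig : ∀ h → SelfDual m h → Balanced 0 h 0 m →
      Σ (Config m) λ v → FixedConfig v × (∀ p → p < m → wordFun (configWord v) p ≡ h p)
    selfDual-fixedConfig h selfDual balanced = v , fixedConfig⁺ nc (selfDual⇒fixed v nc selfDual′) , agree
      where
      w = tabulate {n = m} λ p → h (toℕ p)
      dyck = balanced⇒isDyck w 0 (Balanced-cong 0 m (λ p _ p<m → sym (wordFun-tabulate h p p<m)) balanced)
      v = proj₁ (configWord-surjective w dyck)
      nc = proj₁ (proj₂ (configWord-surjective w dyck))
      agree : ∀ p → p < m → wordFun (configWord v) p ≡ h p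
      agree p p<m = trans (cong (λ u → wordFun u p) (proj₂ (proj₂ (configWord-surjective w dyck)))) (wordFun-tabulate h p p<m)
      selfDual′ : SelfDual m (wordFun (configWord v))
      selfDual′ = SelfDual-cong m (λ p p<m → sym (agree p p<m)) selfDual

    halfOf : ∀ i → Config m → Vec Letter i
    halfOf i v = firstHalf i (configWord v)

    halfOf-agree : ∀ i v p → p < i → wordFun (halfOf i v) p ≡ wordFun (configWord v) p
    halfOf-agree i v p = wordFun-tabulate (wordFun (configWord v)) p

    halfOf-prefixDyck : ∀ i v → i ≤ m → IsNCConfig v → isPrefixDyck 0 (halfOf i v) ≡ true
    halfOf-prefixDyck i v i≤m nc = prefixBalanced⇒isPrefixDyck (halfOf i v) 0
      (PrefixBalanced-cong 0 i (λ p _ p<i → sym (halfOf-agree i v p p<i))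
        λ t t≤i → configWord-prefixBalanced v nc t (≤-trans t≤i i≤m))

    fixedConfig-determined : ∀ {v v′} → FixedConfig v → FixedConfig v′ →
      (∀ p → double p < m → wordFun (configWord v) p ≡ wordFun (configWord v′) p) → v ≡ v′
    fixedConfig-determined {v} {v′} v∈ v′∈ left = configWord-injective v v′ (proj₁ (fixedConfig⁻ v∈)) (proj₁ (fixedConfig⁻ v′∈))
      (wordFun-injective _ _ (selfDual-determined m (fixed⇒selfDual v (proj₂ (fixedConfig⁻ v∈))) (fixed⇒selfDual v′ (proj₂ (fixedConfig⁻ v′∈))) left))

  prefixDyck-fixedConfig : ∀ i (h : Vec Letter i) → isPrefixDyck 0 h ≡ true → Σ (Config (double i)) λ v → FixedConfig v × halfOf i v ≡ h
  prefixDyck-fixedConfig i h prefixDyck = v , v∈ , wordFun-injective _ _ λ p p<i →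
    trans (halfOf-agree i v p p<i) (trans (agree p (<-≤-trans p<i (n≤double i))) (unfold-left m (wordFun h) p (double-mono-< p<i)))
    where
    m = double i
    w = unfold m (wordFun h)
    -- words of even length have no middle letter
    selfDual : SelfDual m w
    selfDual = unfold-selfDual m (wordFun h) λ p p<m q≡p → ⊥-elim (double≢suc-double i p (sym (mirror-fixed m p p<m q≡p)))
    balanced : Balanced 0 w 0 m
    balanced = selfDual-balanced m i w selfDual (≤-reflexive (double≡+ i))
      (PrefixBalanced-cong 0 i (λ p _ p<i → sym (unfold-left m (wordFun h) p (double-mono-< p<i)))
        (isPrefixDyck⇒prefixBalanced h 0 prefixDyck))
    fixedConfig = selfDual-fixedConfig w selfDual balanced
    v = proj₁ fixedConfig
    v∈ = proj₁ (proj₂ fixedConfig)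
    agree = proj₂ (proj₂ fixedConfig)

  fixedXn-even : ∀ i → fixedXn (suc (double i)) ≡ countᵇ (isPrefixDyck 0) (vecs letters i)
  fixedXn-even i = trans (length-≡-by-bijection (halfOf i) fixedConfigs-unique unique-halves into inj onto)
                         (length-filter-T? (isPrefixDyck 0) (vecs letters i))
    where
    prefixDyck? = λ (h : Vec Letter i) → T? (isPrefixDyck 0 h)
    unique-halves = Unique.filter⁺ prefixDyck? (vecs-unique i letters-unique)
    into : ∀ {v} → FixedConfig v → halfOf i v ∈ filter prefixDyck? (vecs letters i)
    into {v} v∈ = ∈-filter⁺ prefixDyck? (∈-vecs ∈-letters (halfOf i v))
      (Equivalence.from T-≡ (halfOf-prefixDyck i v (n≤double i) (proj₁ (fixedConfig⁻ v∈))))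
    inj : ∀ {v v′} → FixedConfig v → FixedConfig v′ → halfOf i v ≡ halfOf i v′ → v ≡ v′
    inj {v} {v′} v∈ v′∈ same = fixedConfig-determined v∈ v′∈ λ p 2p<m → let p<i = double-cancel-< 2p<m in
      trans (sym (halfOf-agree i v p p<i)) (trans (cong (λ u → wordFun u p) same) (halfOf-agree i v′ p p<i))
    onto : ∀ {h} → h ∈ filter prefixDyck? (vecs letters i) → Σ (Config (double i)) λ v → FixedConfig v × halfOf i v ≡ h
    onto {h} h∈ = prefixDyck-fixedConfig i h (Equivalence.to T-≡ (proj₂ (∈-filter⁻ prefixDyck? {xs = vecs letters i} h∈)))

  isFlat : Letter → Bool
  isFlat blank  = true
  isFlat ball   = true
  isFlat opener = false
  isFlat closer = false

  selfDual-letter-isFlat : ∀ x → x ≡ dual x → isFlat x ≡ true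
  selfDual-letter-isFlat blank  _ = refl
  selfDual-letter-isFlat ball   _ = refl

  isFlat⇒selfDual : ∀ x → isFlat x ≡ true → x ≡ dual x
  isFlat⇒selfDual blank  _ = refl
  isFlat⇒selfDual ball   _ = refl

  wordFun-∷ʳ-< : ∀ {i} (h : Vec Letter i) x p → p < i → wordFun (h ∷ʳ x) p ≡ wordFun h p
  wordFun-∷ʳ-< (y ∷ h) x zero    _         = refl
  wordFun-∷ʳ-< (y ∷ h) x (suc p) (s≤s p<i) = wordFun-∷ʳ-< h x p p<i

  wordFun-∷ʳ-≡ : ∀ {i} (h : Vec Letter i) x → wordFun (h ∷ʳ x) i ≡ x
  wordFun-∷ʳ-≡ []      x = refl
  wordFun-∷ʳ-≡ (y ∷ h) x = wordFun-∷ʳ-≡ h x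

  isPrefixDyck-∷ʳ : ∀ {i} (h : Vec Letter i) x d → isFlat x ≡ true → isPrefixDyck d h ≡ true → isPrefixDyck d (h ∷ʳ x) ≡ true
  isPrefixDyck-∷ʳ []           blank  d _ _ = refl
  isPrefixDyck-∷ʳ []           ball   d _ _ = refl
  isPrefixDyck-∷ʳ (blank ∷ h)  x d       flat e = isPrefixDyck-∷ʳ h x d flat e
  isPrefixDyck-∷ʳ (ball ∷ h)   x d       flat e = isPrefixDyck-∷ʳ h x d flat e
  isPrefixDyck-∷ʳ (opener ∷ h) x d       flat e = isPrefixDyck-∷ʳ h x (suc d) flat e
  isPrefixDyck-∷ʳ (closer ∷ h) x (suc d) flat e = isPrefixDyck-∷ʳ h x d flat e

  flatThenPrefixDyck : ∀ {i} → Vec Letter (suc i) → Bool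
  flatThenPrefixDyck (x ∷ h) = isFlat x ∧ isPrefixDyck 0 h

  countᵇ-flatThenPrefixDyck : ∀ i → countᵇ flatThenPrefixDyck (vecs letters (suc i))
                                    ≡ countᵇ (isPrefixDyck 0) (vecs letters i) + countᵇ (isPrefixDyck 0) (vecs letters i)
  countᵇ-flatThenPrefixDyck i = trans (countᵇ-by-head flatThenPrefixDyck letters (vecs letters i))
    (cong (n +_) (trans (cong (n +_) no-openers-or-closers) (+-identityʳ n)))
    where
    n = countᵇ (isPrefixDyck 0) (vecs letters i)
    no-openers-or-closers : countᵇ (λ _ → false) (vecs letters i) + (countᵇ (λ _ → false) (vecs letters i) + 0) ≡ 0
    no-openers-or-closers rewrite countᵇ-false (vecs letters i) = refl

  middleAndHalf : ∀ i → Config (suc (double i)) → Vec Letter (suc i)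
  middleAndHalf i v = wordFun (configWord v) i ∷ halfOf i v

  flatThenPrefixDyck-fixedConfig : ∀ i x (h : Vec Letter i) → isFlat x ≡ true → isPrefixDyck 0 h ≡ true →
    Σ (Config (suc (double i))) λ v → FixedConfig v × middleAndHalf i v ≡ x ∷ h
  flatThenPrefixDyck-fixedConfig i x h flat prefixDyck = v , v∈ , cong₂ _∷_
    (trans (agree i (s≤s (n≤double i))) (trans (unfold-left m half i ≤-refl) (wordFun-∷ʳ-≡ h x)))
    (wordFun-injective _ _ λ p p<i → trans (halfOf-agree i v p p<i)
      (trans (agree p (<-trans p<i (s≤s (n≤double i)))) (trans (unfold-left m half p (s≤s (double-mono-≤ (<⇒≤ p<i)))) (wordFun-∷ʳ-< h x p p<i))))
    where
    m = suc (double i)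
    half = wordFun (h ∷ʳ x)
    w = unfold m half
    -- the only point mirrored onto itself is the middle one, carrying the flat letter x
    selfDual : SelfDual m w
    selfDual = unfold-selfDual m half λ p p<m q≡p → case double-injective (suc-injective (mirror-fixed m p p<m q≡p)) of λ where
      refl → trans (wordFun-∷ʳ-≡ h x) (trans (isFlat⇒selfDual x flat) (cong dual (sym (wordFun-∷ʳ-≡ h x))))
    m≤2[1+i] : m ≤ suc i + suc i
    m≤2[1+i] = s≤s (≤-trans (≤-reflexive (double≡+ i)) (+-monoʳ-≤ i (n≤1+n i)))
    balanced : Balanced 0 w 0 m
    balanced = selfDual-balanced m (suc i) w selfDual m≤2[1+i]
      (PrefixBalanced-cong 0 (suc i) (λ p _ p<1+i → sym (unfold-left m half p (s≤s (double-mono-≤ (≤-pred p<1+i)))))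
        (isPrefixDyck⇒prefixBalanced (h ∷ʳ x) 0 (isPrefixDyck-∷ʳ h x 0 flat prefixDyck)))
    fixedConfig = selfDual-fixedConfig w selfDual balanced
    v = proj₁ fixedConfig
    v∈ = proj₁ (proj₂ fixedConfig)
    agree = proj₂ (proj₂ fixedConfig)

  fixedXn-odd : ∀ i → fixedXn (suc (suc (double i))) ≡ countᵇ flatThenPrefixDyck (vecs letters (suc i))
  fixedXn-odd i = trans (length-≡-by-bijection (middleAndHalf i) fixedConfigs-unique unique-halves into inj onto)
                        (length-filter-T? flatThenPrefixDyck (vecs letters (suc i)))
    where
    m = suc (double i)
    i<m : i < m
    i<m = s≤s (n≤double i)
    flatThenPrefixDyck? = λ (h : Vec Letter (suc i)) → T? (flatThenPrefixDyck h)
    unique-halves = Unique.filter⁺ flatThenPrefixDyck? (vecs-unique (suc i) letters-unique)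
    into : ∀ {v} → FixedConfig v → middleAndHalf i v ∈ filter flatThenPrefixDyck? (vecs letters (suc i))
    into {v} v∈ = ∈-filter⁺ flatThenPrefixDyck? (∈-vecs ∈-letters (middleAndHalf i v))
      (Equivalence.from T-∧ (Equivalence.from T-≡ flat , Equivalence.from T-≡ (halfOf-prefixDyck i v (<⇒≤ i<m) nc)))
      where
      nc = proj₁ (fixedConfig⁻ v∈)
      selfDual = fixed⇒selfDual v (proj₂ (fixedConfig⁻ v∈))
      flat = selfDual-letter-isFlat _ (trans (selfDual i i<m) (cong (λ p → dual (wordFun (configWord v) p)) (double∸≡ i)))
    inj : ∀ {v v′} → FixedConfig v → FixedConfig v′ → middleAndHalf i v ≡ middleAndHalf i v′ → v ≡ v′
    inj {v} {v′} v∈ v′∈ same = fixedConfig-determined v∈ v′∈ left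
      where
      left : ∀ p → double p < m → wordFun (configWord v) p ≡ wordFun (configWord v′) p
      left p 2p<m with m≤n⇒m<n∨m≡n (double-cancel-≤ (≤-pred 2p<m))
      ... | inj₁ p<i = trans (sym (halfOf-agree i v p p<i)) (trans (cong (λ u → wordFun u p) (∷-injectiveʳ same)) (halfOf-agree i v′ p p<i))
      ... | inj₂ refl = ∷-injectiveˡ same
    onto : ∀ {xh} → xh ∈ filter flatThenPrefixDyck? (vecs letters (suc i)) → Σ (Config m) λ v → FixedConfig v × middleAndHalf i v ≡ xh
    onto {x ∷ h} xh∈ = flatThenPrefixDyck-fixedConfig i x h (Equivalence.to T-≡ (proj₁ flat&prefix)) (Equivalence.to T-≡ (proj₂ flat&prefix))
      where flat&prefix = Equivalence.to T-∧ (proj₂ (∈-filter⁻ flatThenPrefixDyck? {xs = vecs letters (suc i)} xh∈))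

  fixedXn-central : ∀ m → fixedXn (suc m) ≡ central (suc m)
  fixedXn-central m with evenOdd m
  ... | even i = begin
    fixedXn (suc (double i))                        ≡⟨ fixedXn-even i ⟩
    countᵇ (isPrefixDyck 0) (vecs letters i)         ≡⟨ countᵇ-isPrefixDyck-binomial i ⟩
    suc (double i) C suc i                          ≡⟨ C-middle-sym i ⟩
    suc (double i) C i                              ≡⟨ central-odd i ⟨
    central (suc (double i))                        ∎
    where open ≡-Reasoning
  ... | odd i = begin
    fixedXn (suc (suc (double i)))                                                     ≡⟨ fixedXn-odd i ⟩
    countᵇ flatThenPrefixDyck (vecs letters (suc i))                                   ≡⟨ countᵇ-flatThenPrefixDyck i ⟩
    countᵇ (isPrefixDyck 0) (vecs letters i) + countᵇ (isPrefixDyck 0) (vecs letters i) ≡⟨ cong (λ n → n + n) (trans (countᵇ-isPrefixDyck-binomial i) (C-middle-sym i)) ⟩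
    suc (double i) C i + suc (double i) C i                                            ≡⟨ central-even i ⟨
    central (double (suc i))                                                           ∎
    where open ≡-Reasoning

open import Defs
open import Data.Nat using (ℕ; suc; _≤_)
open import Data.Integer using (+_)
open import Data.Product using (Σ; _×_; _,_)
open import Relation.Binary.PropositionalEquality using (_≡_; sym; trans; cong)

open QCatalan
open EvalOne
open EvalMinusOne
open Encoding
open FixedPoints

lemma4p1 : (n : ℕ) → 1 ≤ n →
    Σ Poly (λ P → IsCatPoly n P × (eval1 P ≡ cardXn n) × (evalNeg1 P ≡ + fixedXn n))
lemma4p1 (suc m) _ =
  qCatalan (suc m) ,
  qCatalan-isCatPoly (suc m) ,
  trans (eval1-qCatalan m) (sym (cardXn-ballot m)) ,
  trans (evalNeg1-qCatalan m) (cong +_ (sym (fixedXn-central m)))
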